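{- Let $T$ be a strong monad on $\mathbb{C}$, $Y$ an object, $S:=T(-\times Y)^Y$, $\mathcal{A}_S=(\mathbb{C},S,A,a)$ a $\lambda_c(\Sigma)$-structure and $\mathcal{A}_T=(\mathbb{C},T,A,\mathrm{SPS}(a))$ the associated $\lambda_c(\mathrm{SPS}(\Sigma))$-structure. For every well-typed term $\Gamma\vdash M\colon\mathbf{t}$ over $\Sigma$, $$[\![\mathrm{SPS}(M)]\!]^{\mathcal{A}_T}=\big(S(\rho_{\mathbf{t}})\circ[\![M]\!]^{\mathcal{A}_S}\circ\rho_\Gamma^{ -1}\big)^\dagger,$$ where on the right $(\cdot)^\dagger$ turns a morphism $[\![\Gamma^\circ]\!]_T\to T([\![\mathbf{t}^\circ]\!]_T\times Y)^Y$ into $[\![\Gamma^\circ]\!]_T\times Y\to T([\![\mathbf{t}^\circ]\!]_T\times Y)$. In particular, if all types in $\Gamma$ and $\mathbf{t}$ are ground, then $[\![\mathrm{SPS}(M)]\!]^{\mathcal{A}_T}=([\![M]\!]^{\mathcal{A}_S})^\dagger$.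
   Context: Standing conventions: $\mathbb{C}$ is a stable bicartesian closed category; $\mathrm{ev}_{X,Y}\colon X^Y\times Y\to X$ is evaluation, $(\cdot)^\dagger$ is transposition along $(-\times Y)\dashv(-)^Y$. Strong monads have left strength $\mathrm{st}\colon X\times TW\to T(X\times W)$ and right strength $\mathrm{st}'\colon TW\times X\to T(W\times X)$. $S=T(-\times Y)^Y$ is the strong monad with unit $(\eta^T_{X\times Y})^\dagger$, multiplication $(\mu^T_{X\times Y}\circ T(\mathrm{ev}))^Y$, strength $(\mathrm{st}^T\circ(X\times\mathrm{ev}))^\dagger$. Syntax: base types $B$; types $\mathbf{t}::=b\mid\mathbf{1}\mid\mathbf{t}_1\times\mathbf{t}_2\mid\mathbf{0}\mid\mathbf{t}_1+\mathbf{t}_2\mid\mathbf{t}_1\to\mathbf{t}_2$; ground types have no $\to$. Signature $\Sigma=(B,K,E,\mathrm{ar},\mathrm{car})$ with constants $K$, generic effects $E$, $\mathrm{ar},\mathrm{car}\colon K+E\to$ ground types. Terms $x\mid c\,M\mid e\,M\mid()\mid(M,N)\mid\pi_iM\mid\delta(M)\mid\iota_iM\mid\delta(M,x_1\colon\mathbf{t}_1.N_1,x_2\colon\mathbf{t}_2.N_2)\mid\lambda x\colon\mathbf{t}.M\mid M\,N$ with standard typing. A $\lambda_c(\Sigma)$-structure $(\mathbb{C},T,A,a)$: $T$ strong monad, $A(b)$ object for $b\in B$, $a(c)\colon[\![\mathrm{ar}(c)]\!]\to[\![\mathrm{car}(c)]\!]$, $a(e)\colon[\![\mathrm{ar}(e)]\!]\to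 T[\![\mathrm{car}(e)]\!]$; types interpreted via the bi-CCC structure with $[\![\mathbf{t}_1\to\mathbf{t}_2]\!]=T[\![\mathbf{t}_2]\!]^{[\![\mathbf{t}_1]\!]}$ and contexts as products; terms $\Gamma\vdash M\colon\mathbf{t}$ interpreted as $[\![M]\!]\colon[\![\Gamma]\!]\to T[\![\mathbf{t}]\!]$ by Moggi's call-by-value semantics: $[\![x_i]\!]=\eta\circ\pi_i$, $[\![()]\!]=\eta\circ!$, $[\![c\,M]\!]=T(a(c))\circ[\![M]\!]$, $[\![e\,M]\!]=\mu\circ T(a(e))\circ[\![M]\!]$, $[\![(M,N)]\!]=\mu\circ T(\mathrm{st})\circ\mathrm{st}'\circ\langle[\![M]\!],[\![N]\!]\rangle$, $[\![\pi_iM]\!]=T\pi_i\circ[\![M]\!]$, $[\![\iota_iM]\!]=T\iota_i\circ[\![M]\!]$, $[\![\delta(M)]\!]=T!\circ[\![M]\!]$, $[\![\delta(M,x_1.N_1,x_2.N_2)]\!]=\mu\circ T([[\![N_1]\!],[\![N_2]\!]]\circ\mathrm{dist})\circ\mathrm{st}\circ\langle\mathrm{id},[\![M]\!]\rangle$, $[\![\lambda x.M]\!]=\eta\circ[\![M]\!]^\dagger$, $[\![M\,N]\!]=\mu\circ T\mu\circ T^2(\mathrm{ev})\circ T(\mathrm{st})\circ\mathrm{st}'\circ\langle[\![M]\!],[\![N]\!]\rangle$. We write $[\![\cdot]\!]_S$, $[\![\cdot]\!]_T$ for type interpretations under $\mathcal{A}_S$, $\mathcal{A}_T$. SPS transformation: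 add base type $b^Y$ with $A(b^Y)=Y$. Types: $\mathbf{t}^\circ=\mathbf{t}$ for $b,\mathbf{1},\mathbf{0}$; $(\cdot)^\circ$ commutes with $\times,+$; $(\mathbf{t}_1\to\mathbf{t}_2)^\circ=(\mathbf{t}_1^\circ\times b^Y)\to(\mathbf{t}_2^\circ\times b^Y)$; $\mathrm{SPS}(\mathbf{t})=\mathbf{t}^\circ\times b^Y$; $\Gamma^\circ=x_1\colon\mathbf{t}_1^\circ,\dots,x_m\colon\mathbf{t}_m^\circ$ and $\mathrm{SPS}(\Gamma)=\Gamma^\circ,y\colon b^Y$. Terms ($z$ fresh): $\mathrm{SPS}(x)=(x,y)$; $\mathrm{SPS}(c\,M)=c\,\mathrm{SPS}(M)$; $\mathrm{SPS}(e\,M)=e\,\mathrm{SPS}(M)$; $\mathrm{SPS}(())=((),y)$; $\mathrm{SPS}((M,N))=(\lambda z.((\pi_1z,\pi_1\pi_2z),\pi_2\pi_2z))((\lambda z.(\pi_1z,(\lambda y.\mathrm{SPS}(N))(\pi_2z)))\mathrm{SPS}(M))$; $\mathrm{SPS}(\pi_iM)=(\lambda z.(\pi_i\pi_1z,\pi_2z))\mathrm{SPS}(M)$; $\mathrm{SPS}(\delta(M))=(\lambda z.(\delta(\pi_1z),\pi_2z))\mathrm{SPS}(M)$; $\mathrm{SPS}(\iota_iM)=(\lambda z.(\iota_i\pi_1z,\pi_2z))\mathrm{SPS}(M)$; $\mathrm{SPS}(\delta(M,x_1\colon\mathbf{t}_1.M_1,x_2\colon\mathbf{t}_2.M_2))=\delta(N,z\colon\mathrm{SPS}(\mathbf{t}_1).\mathrm{SPS}(M_1)[\pi_1z/x_1,\pi_2z/y],z\colon\mathrm{SPS}(\mathbf{t}_2).\mathrm{SPS}(M_2)[\pi_1z/x_2,\pi_2z/y])$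 with $N=(\lambda z.\delta(\pi_1z,x_1\colon\mathbf{t}_1^\circ.\iota_1(x_1,\pi_2z),x_2\colon\mathbf{t}_2^\circ.\iota_2(x_2,\pi_2z)))\mathrm{SPS}(M)$; $\mathrm{SPS}(\lambda x\colon\mathbf{t}_1.M)=(\lambda z\colon\mathrm{SPS}(\mathbf{t}_1).\mathrm{SPS}(M)[\pi_1z/x,\pi_2z/y],y)$; $\mathrm{SPS}(M\,N)=(\lambda z.(\pi_1z)((\lambda y.\mathrm{SPS}(N))(\pi_2z)))\mathrm{SPS}(M)$. Signature $\mathrm{SPS}(\Sigma)=(B+\{b^Y\},K,E,\mathrm{ar}',\mathrm{car}')$ with $\mathrm{ar}'(k)=\mathrm{ar}(k)\times b^Y$, $\mathrm{car}'(k)=\mathrm{car}(k)\times b^Y$. Structure $\mathcal{A}_T=(\mathbb{C},T,A,\mathrm{SPS}(a))$ with $\mathrm{SPS}(a)(c)=a(c)\times\mathrm{id}_Y$ and $\mathrm{SPS}(a)(e)=a(e)^\dagger\colon[\![\mathrm{ar}(e)]\!]\times Y\to T([\![\mathrm{car}(e)]\!]\times Y)$. Isomorphisms $\rho_{\mathbf{t}}\colon[\![\mathbf{t}]\!]_S\to[\![\mathbf{t}^\circ]\!]_T$: identity for $\mathbf{0},\mathbf{1},b$; $\rho_{\mathbf{t}_1\times\mathbf{t}_2}=\rho_{\mathbf{t}_1}\times\rho_{\mathbf{t}_2}$; $\rho_{\mathbf{t}_1+\mathbf{t}_2}=\rho_{\mathbf{t}_1}+\rho_{\mathbf{t}_2}$;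 $\rho_{\mathbf{t}_1\to\mathbf{t}_2}=\cong\circ\, S(\rho_{\mathbf{t}_2})^{\rho_{\mathbf{t}_1}^{ -1}}$, where $S(\rho_{\mathbf{t}_2})^{\rho_{\mathbf{t}_1}^{ -1}}\colon S[\![\mathbf{t}_2]\!]_S^{[\![\mathbf{t}_1]\!]_S}\to S[\![\mathbf{t}_2^\circ]\!]_T^{[\![\mathbf{t}_1^\circ]\!]_T}$ post-composes with $S(\rho_{\mathbf{t}_2})$ and pre-composes with $\rho_{\mathbf{t}_1}^{ -1}$, and $\cong\colon(T([\![\mathbf{t}_2^\circ]\!]_T\times Y)^Y)^{[\![\mathbf{t}_1^\circ]\!]_T}\to T([\![\mathbf{t}_2^\circ]\!]_T\times Y)^{[\![\mathbf{t}_1^\circ]\!]_T\times Y}$ is the currying isomorphism. For $\Gamma=x_1\colon\mathbf{t}_1,\dots,x_m\colon\mathbf{t}_m$, $\rho_\Gamma=\rho_{\mathbf{t}_1\times\cdots\times\mathbf{t}_m}$. Note $[\![\mathrm{SPS}(\Gamma)]\!]_T=[\![\Gamma^\circ]\!]_T\times Y$. -}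

module Defs where

open import Level using (Level; _⊔_)
open import Data.Sum using (_⊎_; inj₁; inj₂)
open import Data.Unit using (⊤; tt)
open import Relation.Binary using (IsEquivalence)

record BCCC (o ℓ e : Level) : Set (Level.suc (o ⊔ ℓ ⊔ e)) where
  infixr 9 _∘_
  infix  4 _≈_
  infixr 8 _^_
  infixr 7 _×_
  infixr 6 _+_
  infix  5 _⇒_
  field
    Obj : Set o
    _⇒_ : Obj → Obj → Set ℓ
    _≈_ : ∀ {A B} → A ⇒ B → A ⇒ B → Set e
    ≈-equiv : ∀ {A B} → IsEquivalence (_≈_ {A} {B})
    id  : ∀ {A} → A ⇒ A
    _∘_ : ∀ {A B C} → B ⇒ C → A ⇒ B → A ⇒ C
    ∘-resp-≈ : ∀ {A B C} {f h : B ⇒ C} {g i : A ⇒ B} → f ≈ h → g ≈ i → f ∘ g ≈ h ∘ i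
    assoc : ∀ {A B C D} {f : A ⇒ B} {g : B ⇒ C} {h : C ⇒ D} → (h ∘ g) ∘ f ≈ h ∘ (g ∘ f)
    identityˡ : ∀ {A B} {f : A ⇒ B} → id ∘ f ≈ f
    identityʳ : ∀ {A B} {f : A ⇒ B} → f ∘ id ≈ f
    𝟏 : Obj
    ! : ∀ {A} → A ⇒ 𝟏
    !-unique : ∀ {A} (f : A ⇒ 𝟏) → f ≈ !
    _×_ : Obj → Obj → Obj
    π₁ : ∀ {A B} → A × B ⇒ A
    π₂ : ∀ {A B} → A × B ⇒ B
    ⟨_,_⟩ : ∀ {A B C} → C ⇒ A → C ⇒ B → C ⇒ A × B
    project₁ : ∀ {A B C} {f : C ⇒ A} {g : C ⇒ B} → π₁ ∘ ⟨ f , g ⟩ ≈ f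
    project₂ : ∀ {A B C} {f : C ⇒ A} {g : C ⇒ B} → π₂ ∘ ⟨ f , g ⟩ ≈ g
    ⟨⟩-unique : ∀ {A B C} {f : C ⇒ A} {g : C ⇒ B} {h : C ⇒ A × B} →
                π₁ ∘ h ≈ f → π₂ ∘ h ≈ g → h ≈ ⟨ f , g ⟩
    𝟎 : Obj
    ¡ : ∀ {A} → 𝟎 ⇒ A
    ¡-unique : ∀ {A} (f : 𝟎 ⇒ A) → f ≈ ¡
    _+_ : Obj → Obj → Obj
    ι₁ : ∀ {A B} → A ⇒ A + B
    ι₂ : ∀ {A B} → B ⇒ A + B
    [_,_] : ∀ {A B C} → A ⇒ C → B ⇒ C → A + B ⇒ C
    inject₁ : ∀ {A B C} {f : A ⇒ C} {g : B ⇒ C} → [ f , g ] ∘ ι₁ ≈ f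
    inject₂ : ∀ {A B C} {f : A ⇒ C} {g : B ⇒ C} → [ f , g ] ∘ ι₂ ≈ g
    []-unique : ∀ {A B C} {f : A ⇒ C} {g : B ⇒ C} {h : A + B ⇒ C} →
                h ∘ ι₁ ≈ f → h ∘ ι₂ ≈ g → h ≈ [ f , g ]
    _^_ : Obj → Obj → Obj
    ev : ∀ {A B} → (B ^ A) × A ⇒ B
    curry : ∀ {A B C} → C × A ⇒ B → C ⇒ B ^ A
    β : ∀ {A B C} {f : C × A ⇒ B} → ev ∘ ⟨ curry f ∘ π₁ , π₂ ⟩ ≈ f
    λ-unique : ∀ {A B C} {f : C × A ⇒ B} {h : C ⇒ B ^ A} →
               ev ∘ ⟨ h ∘ π₁ , π₂ ⟩ ≈ f → h ≈ curry f

module BCCCKit {o ℓ e} (C : BCCC o ℓ e) where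
  open BCCC C public

  infixr 7 _⁂_
  infixr 6 _⊹_

  _⁂_ : ∀ {A B A' B'} → A ⇒ A' → B ⇒ B' → A × B ⇒ A' × B'
  f ⁂ g = ⟨ f ∘ π₁ , g ∘ π₂ ⟩

  _⊹_ : ∀ {A B A' B'} → A ⇒ A' → B ⇒ B' → A + B ⇒ A' + B'
  f ⊹ g = [ ι₁ ∘ f , ι₂ ∘ g ]

  -- inverse transposition  (g ↦ g†  for  g : Z ⇒ X ^ Y)
  uncurry : ∀ {X Y Z} → Z ⇒ X ^ Y → Z × Y ⇒ X
  uncurry g = ev ∘ (g ⁂ id)

  swap : ∀ {A B} → A × B ⇒ B × A
  swap = ⟨ π₂ , π₁ ⟩

  α : ∀ {A B D} → (A × B) × D ⇒ A × (B × D)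
  α = ⟨ π₁ ∘ π₁ , ⟨ π₂ ∘ π₁ , π₂ ⟩ ⟩

  α⁻¹ : ∀ {A B D} → A × (B × D) ⇒ (A × B) × D
  α⁻¹ = ⟨ ⟨ π₁ , π₁ ∘ π₂ ⟩ , π₂ ∘ π₂ ⟩

  -- distributivity  X × (A + B) → X × A + X × B  (canonical in a CCC)
  dist : ∀ {X A B} → X × (A + B) ⇒ (X × A) + (X × B)
  dist = ev ∘ ⟨ [ curry (ι₁ ∘ swap) , curry (ι₂ ∘ swap) ] ∘ π₂ , π₁ ⟩

  expMap : ∀ {A A' B B'} → A' ⇒ A → B ⇒ B' → B ^ A ⇒ B' ^ A'
  expMap f g = curry (g ∘ ev ∘ (id ⁂ f))

  curryIso : ∀ {D Y Z} → (D ^ Y) ^ Z ⇒ D ^ (Z × Y)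
  curryIso = curry (ev ∘ ⟨ ev ∘ ⟨ π₁ , π₁ ∘ π₂ ⟩ , π₂ ∘ π₂ ⟩)

  curryIso⁻¹ : ∀ {D Y Z} → D ^ (Z × Y) ⇒ (D ^ Y) ^ Z
  curryIso⁻¹ = curry (curry (ev ∘ ⟨ π₁ ∘ π₁ , ⟨ π₂ ∘ π₁ , π₂ ⟩ ⟩))

module _ {o ℓ e} (C : BCCC o ℓ e) where
  open BCCCKit C

  record MonadOps : Set (o ⊔ ℓ) where
    field
      F₀ : Obj → Obj
      F₁ : ∀ {A B} → A ⇒ B → F₀ A ⇒ F₀ B
      η  : ∀ {A} → A ⇒ F₀ A
      μ  : ∀ {A} → F₀ (F₀ A) ⇒ F₀ A
      st : ∀ {X W} → X × F₀ W ⇒ F₀ (X × W)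

    st' : ∀ {X W} → F₀ W × X ⇒ F₀ (W × X)
    st' = F₁ swap ∘ st ∘ swap

  record StrongMonad : Set (o ⊔ ℓ ⊔ e) where
    field
      ops : MonadOps
    open MonadOps ops
    field
      F-resp-≈ : ∀ {A B} {f g : A ⇒ B} → f ≈ g → F₁ f ≈ F₁ g
      F-id : ∀ {A} → F₁ (id {A}) ≈ id
      F-∘ : ∀ {A B D} {f : A ⇒ B} {g : B ⇒ D} → F₁ (g ∘ f) ≈ F₁ g ∘ F₁ f
      η-natural : ∀ {A B} {f : A ⇒ B} → F₁ f ∘ η ≈ η ∘ f
      μ-natural : ∀ {A B} {f : A ⇒ B} → F₁ f ∘ μ ≈ μ ∘ F₁ (F₁ f)
      μ-assoc : ∀ {A} → μ {A} ∘ F₁ μ ≈ μ ∘ μ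
      μ-η : ∀ {A} → μ {A} ∘ η ≈ id
      μ-Fη : ∀ {A} → μ {A} ∘ F₁ η ≈ id
      st-natural : ∀ {X X' W W'} {f : X ⇒ X'} {g : W ⇒ W'} →
                   F₁ (f ⁂ g) ∘ st ≈ st ∘ (f ⁂ F₁ g)
      st-unit : ∀ {X W} → F₁ π₂ ∘ st {X} {W} ≈ π₂
      st-α : ∀ {A B W} → F₁ α ∘ st {A × B} {W} ≈ st ∘ (id ⁂ st) ∘ α
      st-η : ∀ {X W} → st {X} {W} ∘ (id ⁂ η) ≈ η
      st-μ : ∀ {X W} → st {X} {W} ∘ (id ⁂ μ) ≈ μ ∘ F₁ st ∘ st

  -- The monad S = T(- × Y)^Y (operations only; its laws are a consequence)
  SOps : MonadOps → Obj → MonadOps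
  SOps T Y = record
    { F₀ = λ X → T.F₀ (X × Y) ^ Y
    ; F₁ = λ f → curry (T.F₁ (f ⁂ id) ∘ ev)
    ; η  = curry T.η
    ; μ  = curry ((T.μ ∘ T.F₁ ev) ∘ ev)
    ; st = curry (T.F₁ α⁻¹ ∘ T.st ∘ (id ⁂ ev) ∘ α)
    }
    where module T = MonadOps T

infixr 7 _⊗_
infixr 6 _⊕_
infixr 5 _⇛_

data Ty (B : Set) : Set where
  base : B → Ty B
  𝟙 𝟘 : Ty B
  _⊗_ _⊕_ _⇛_ : Ty B → Ty B → Ty B

data Ground {B : Set} : Ty B → Set where
  base : ∀ b → Ground (base b)
  𝟙 : Ground 𝟙
  𝟘 : Ground 𝟘
  _⊗_ : ∀ {s t} → Ground s → Ground t → Ground (s ⊗ t)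
  _⊕_ : ∀ {s t} → Ground s → Ground t → Ground (s ⊕ t)

infixl 4 _▸_
data Ctx (B : Set) : Set where
  ε : Ctx B
  _▸_ : Ctx B → Ty B → Ctx B

infix 3 _∋_
data _∋_ {B : Set} : Ctx B → Ty B → Set where
  here  : ∀ {Γ t} → Γ ▸ t ∋ t
  there : ∀ {Γ s t} → Γ ∋ t → Γ ▸ s ∋ t

-- signatures Σ = (B, K, E, ar, car); ar, car defined on K + E, ground-valued
record Sig : Set₁ where
  field
    B K E : Set
    ar car : K ⊎ E → Ty B
    ar-ground  : ∀ k → Ground (ar k)
    car-ground : ∀ k → Ground (car k)

module _ (Σ : Sig) where
  open Sig Σ

  data Term : Ctx B → Ty B → Set where
    var  : ∀ {Γ t} → Γ ∋ t → Term Γ t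
    con  : ∀ {Γ} (c : K) → Term Γ (ar (inj₁ c)) → Term Γ (car (inj₁ c))
    eff  : ∀ {Γ} (e : E) → Term Γ (ar (inj₂ e)) → Term Γ (car (inj₂ e))
    unit : ∀ {Γ} → Term Γ 𝟙
    pair : ∀ {Γ s t} → Term Γ s → Term Γ t → Term Γ (s ⊗ t)
    fst  : ∀ {Γ s t} → Term Γ (s ⊗ t) → Term Γ s
    snd  : ∀ {Γ s t} → Term Γ (s ⊗ t) → Term Γ t
    absurd : ∀ {Γ t} → Term Γ 𝟘 → Term Γ t
    inl  : ∀ {Γ s t} → Term Γ s → Term Γ (s ⊕ t)
    inr  : ∀ {Γ s t} → Term Γ t → Term Γ (s ⊕ t)
    case : ∀ {Γ s t u} → Term Γ (s ⊕ t) → Term (Γ ▸ s) u → Term (Γ ▸ t) u → Term Γ u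
    lam  : ∀ {Γ s t} → Term (Γ ▸ s) t → Term Γ (s ⇛ t)
    app  : ∀ {Γ s t} → Term Γ (s ⇛ t) → Term Γ s → Term Γ t

  Ren : Ctx B → Ctx B → Set
  Ren Γ Δ = ∀ {t} → Γ ∋ t → Δ ∋ t

  ext : ∀ {Γ Δ s} → Ren Γ Δ → Ren (Γ ▸ s) (Δ ▸ s)
  ext r here = here
  ext r (there x) = there (r x)

  rename : ∀ {Γ Δ t} → Ren Γ Δ → Term Γ t → Term Δ t
  rename r (var x) = var (r x)
  rename r (con c M) = con c (rename r M)
  rename r (eff e M) = eff e (rename r M)
  rename r unit = unit
  rename r (pair M N) = pair (rename r M) (rename r N)
  rename r (fst M) = fst (rename r M)
  rename r (snd M) = snd (rename r M)
  rename r (absurd M) = absurd (rename r M)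
  rename r (inl M) = inl (rename r M)
  rename r (inr M) = inr (rename r M)
  rename r (case M N₁ N₂) = case (rename r M) (rename (ext r) N₁) (rename (ext r) N₂)
  rename r (lam M) = lam (rename (ext r) M)
  rename r (app M N) = app (rename r M) (rename r N)

  Sub : Ctx B → Ctx B → Set
  Sub Γ Δ = ∀ {t} → Γ ∋ t → Term Δ t

  exts : ∀ {Γ Δ s} → Sub Γ Δ → Sub (Γ ▸ s) (Δ ▸ s)
  exts σ here = var here
  exts σ (there x) = rename there (σ x)

  subst : ∀ {Γ Δ t} → Sub Γ Δ → Term Γ t → Term Δ t
  subst σ (var x) = σ x
  subst σ (con c M) = con c (subst σ M)
  subst σ (eff e M) = eff e (subst σ M)
  subst σ unit = unit
  subst σ (pair M N) = pair (subst σ M) (subst σ N)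
  subst σ (fst M) = fst (subst σ M)
  subst σ (snd M) = snd (subst σ M)
  subst σ (absurd M) = absurd (subst σ M)
  subst σ (inl M) = inl (subst σ M)
  subst σ (inr M) = inr (subst σ M)
  subst σ (case M N₁ N₂) = case (subst σ M) (subst (exts σ) N₁) (subst (exts σ) N₂)
  subst σ (lam M) = lam (subst (exts σ) M)
  subst σ (app M N) = app (subst σ M) (subst σ N)

module Sem {o ℓ e} (C : BCCC o ℓ e) (T : MonadOps C) where
  open BCCCKit C
  open MonadOps T

  ⟦_⟧ty : ∀ {B : Set} → (B → Obj) → Ty B → Obj
  ⟦ A ⟧ty (base b) = A b
  ⟦ A ⟧ty 𝟙 = 𝟏
  ⟦ A ⟧ty 𝟘 = 𝟎
  ⟦ A ⟧ty (s ⊗ t) = ⟦ A ⟧ty s × ⟦ A ⟧ty t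
  ⟦ A ⟧ty (s ⊕ t) = ⟦ A ⟧ty s + ⟦ A ⟧ty t
  ⟦ A ⟧ty (s ⇛ t) = F₀ (⟦ A ⟧ty t) ^ ⟦ A ⟧ty s

  ⟦_⟧ctx : ∀ {B : Set} → (B → Obj) → Ctx B → Obj
  ⟦ A ⟧ctx ε = 𝟏
  ⟦ A ⟧ctx (Γ ▸ t) = ⟦ A ⟧ctx Γ × ⟦ A ⟧ty t

  record Structure (Σ : Sig) : Set (o ⊔ ℓ) where
    open Sig Σ
    field
      A  : B → Obj
      aK : (c : K) → ⟦ A ⟧ty (ar (inj₁ c)) ⇒ ⟦ A ⟧ty (car (inj₁ c))
      aE : (e : E) → ⟦ A ⟧ty (ar (inj₂ e)) ⇒ F₀ (⟦ A ⟧ty (car (inj₂ e)))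

  module Interp {Σ : Sig} (𝒜 : Structure Σ) where
    open Structure 𝒜

    lookup : ∀ {Γ t} → Γ ∋ t → ⟦ A ⟧ctx Γ ⇒ ⟦ A ⟧ty t
    lookup here = π₂
    lookup (there x) = lookup x ∘ π₁

    ⟦_⟧ : ∀ {Γ t} → Term Σ Γ t → ⟦ A ⟧ctx Γ ⇒ F₀ (⟦ A ⟧ty t)
    ⟦ var x ⟧ = η ∘ lookup x
    ⟦ con c M ⟧ = F₁ (aK c) ∘ ⟦ M ⟧
    ⟦ eff e M ⟧ = μ ∘ F₁ (aE e) ∘ ⟦ M ⟧
    ⟦ unit ⟧ = η ∘ !
    ⟦ pair M N ⟧ = μ ∘ F₁ st ∘ st' ∘ ⟨ ⟦ M ⟧ , ⟦ N ⟧ ⟩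
    ⟦ fst M ⟧ = F₁ π₁ ∘ ⟦ M ⟧
    ⟦ snd M ⟧ = F₁ π₂ ∘ ⟦ M ⟧
    ⟦ absurd M ⟧ = F₁ ¡ ∘ ⟦ M ⟧
    ⟦ inl M ⟧ = F₁ ι₁ ∘ ⟦ M ⟧
    ⟦ inr M ⟧ = F₁ ι₂ ∘ ⟦ M ⟧
    ⟦ case M N₁ N₂ ⟧ = μ ∘ F₁ ([ ⟦ N₁ ⟧ , ⟦ N₂ ⟧ ] ∘ dist) ∘ st ∘ ⟨ id , ⟦ M ⟧ ⟩
    ⟦ lam M ⟧ = η ∘ curry ⟦ M ⟧
    ⟦ app M N ⟧ = μ ∘ F₁ μ ∘ F₁ (F₁ ev) ∘ F₁ st ∘ st' ∘ ⟨ ⟦ M ⟧ , ⟦ N ⟧ ⟩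

module _ {B : Set} where
  bY : Ty (B ⊎ ⊤)
  bY = base (inj₂ tt)

  _° : Ty B → Ty (B ⊎ ⊤)
  base b ° = base (inj₁ b)
  𝟙 ° = 𝟙
  𝟘 ° = 𝟘
  (s ⊗ t) ° = s ° ⊗ t °
  (s ⊕ t) ° = s ° ⊕ t °
  (s ⇛ t) ° = (s ° ⊗ bY) ⇛ (t ° ⊗ bY)

  SPSTy : Ty B → Ty (B ⊎ ⊤)
  SPSTy t = t ° ⊗ bY

  _°c : Ctx B → Ctx (B ⊎ ⊤)
  ε °c = ε
  (Γ ▸ t) °c = Γ °c ▸ t °

  SPSCtx : Ctx B → Ctx (B ⊎ ⊤)
  SPSCtx Γ = Γ °c ▸ bY

  var° : ∀ {Γ t} → Γ ∋ t → Γ °c ∋ t °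
  var° here = here
  var° (there x) = there (var° x)

  °-ground : ∀ {t} → Ground t → Ground (t °)
  °-ground (base b) = base (inj₁ b)
  °-ground 𝟙 = 𝟙
  °-ground 𝟘 = 𝟘
  °-ground (g ⊗ h) = °-ground g ⊗ °-ground h
  °-ground (g ⊕ h) = °-ground g ⊕ °-ground h

SPSSig : Sig → Sig
SPSSig Σ = record
  { B = B ⊎ ⊤ ; K = K ; E = E
  ; ar = λ k → ar k ° ⊗ bY
  ; car = λ k → car k ° ⊗ bY
  ; ar-ground = λ k → °-ground (ar-ground k) ⊗ base (inj₂ tt)
  ; car-ground = λ k → °-ground (car-ground k) ⊗ base (inj₂ tt)
  }
  where open Sig Σ

module SPSTrans (Σ : Sig) where
  open Sig Σ
  Σ' = SPSSig Σ

  -- renaming used for  λy.SPS(N)  placed under two further binders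
  under2 : ∀ {Γ s} → Ren Σ' (Γ °c ▸ bY) (Γ °c ▸ bY ▸ s ▸ bY)
  under2 here = here
  under2 (there x) = there (there (there x))

  -- the substitution  [π₁ z / x, π₂ z / y]
  bindSub : ∀ {Γ t} → Sub Σ' (Γ °c ▸ t ° ▸ bY) (Γ °c ▸ bY ▸ SPSTy t)
  bindSub here = snd (var here)
  bindSub (there here) = fst (var here)
  bindSub (there (there x)) = var (there (there x))

  v0 : ∀ {Γ : Ctx (B ⊎ ⊤)} {t} → Term Σ' (Γ ▸ t) t
  v0 = var here

  SPS : ∀ {Γ t} → Term Σ Γ t → Term Σ' (SPSCtx Γ) (SPSTy t)
  SPS (var x) = pair (var (there (var° x))) (var here)
  SPS (con c M) = con c (SPS M)
  SPS (eff e M) = eff e (SPS M)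
  SPS unit = pair unit (var here)
  SPS (pair M N) =
    app (lam (pair (pair (fst v0) (fst (snd v0))) (snd (snd v0))))
        (app (lam (pair (fst v0) (app (lam (rename Σ' under2 (SPS N))) (snd v0))))
             (SPS M))
  SPS (fst M) = app (lam (pair (fst (fst v0)) (snd v0))) (SPS M)
  SPS (snd M) = app (lam (pair (snd (fst v0)) (snd v0))) (SPS M)
  SPS (absurd M) = app (lam (pair (absurd (fst v0)) (snd v0))) (SPS M)
  SPS (inl M) = app (lam (pair (inl (fst v0)) (snd v0))) (SPS M)
  SPS (inr M) = app (lam (pair (inr (fst v0)) (snd v0))) (SPS M)
  SPS (case M M₁ M₂) =
    case (app (lam (case (fst v0) (inl (pair v0 (snd (var (there here)))))
                                  (inr (pair v0 (snd (var (there here)))))))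
              (SPS M))
         (subst Σ' bindSub (SPS M₁))
         (subst Σ' bindSub (SPS M₂))
  SPS (lam M) = pair (lam (subst Σ' bindSub (SPS M))) (var here)
  SPS (app M N) =
    app (lam (app (fst v0) (app (lam (rename Σ' under2 (SPS N))) (snd v0)))) (SPS M)

module SPSSem {o ℓ e} (C : BCCC o ℓ e) (T : MonadOps C) (Y : BCCC.Obj C) where
  open BCCCKit C
  S = SOps C T Y
  module T = MonadOps T
  module S = MonadOps S
  module SemS = Sem C S
  module SemT = Sem C T

  module _ {B : Set} (A : B → Obj) where
    A' : B ⊎ ⊤ → Obj
    A' (inj₁ b) = A b
    A' (inj₂ _) = Y

    ⟦_⟧S : Ty B → Obj
    ⟦_⟧S = SemS.⟦ A ⟧ty

    ⟦_⟧T : Ty (B ⊎ ⊤) → Obj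
    ⟦_⟧T = SemT.⟦ A' ⟧ty

    ρ : (t : Ty B) → ⟦ t ⟧S ⇒ ⟦ t ° ⟧T
    ρ⁻¹ : (t : Ty B) → ⟦ t ° ⟧T ⇒ ⟦ t ⟧S
    ρ (base b) = id
    ρ 𝟙 = id
    ρ 𝟘 = id
    ρ (s ⊗ t) = ρ s ⁂ ρ t
    ρ (s ⊕ t) = ρ s ⊹ ρ t
    ρ (s ⇛ t) = curryIso ∘ expMap (ρ⁻¹ s) (S.F₁ (ρ t))
    ρ⁻¹ (base b) = id
    ρ⁻¹ 𝟙 = id
    ρ⁻¹ 𝟘 = id
    ρ⁻¹ (s ⊗ t) = ρ⁻¹ s ⁂ ρ⁻¹ t
    ρ⁻¹ (s ⊕ t) = ρ⁻¹ s ⊹ ρ⁻¹ t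
    ρ⁻¹ (s ⇛ t) = expMap (ρ s) (S.F₁ (ρ⁻¹ t)) ∘ curryIso⁻¹

    ρCtx⁻¹ : (Γ : Ctx B) → SemT.⟦ A' ⟧ctx (Γ °c) ⇒ SemS.⟦ A ⟧ctx Γ
    ρCtx⁻¹ ε = id
    ρCtx⁻¹ (Γ ▸ t) = ρCtx⁻¹ Γ ⁂ ρ⁻¹ t

  SPSStructure : ∀ {Σ : Sig} → SemS.Structure Σ → SemT.Structure (SPSSig Σ)
  SPSStructure {Σ} 𝒜 = record
    { A = A' A
    ; aK = λ c → (ρ A (car (inj₁ c)) ∘ aK c ∘ ρ⁻¹ A (ar (inj₁ c))) ⁂ id
    ; aE = λ e → uncurry (S.F₁ (ρ A (car (inj₂ e))) ∘ aE e ∘ ρ⁻¹ A (ar (inj₂ e)))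
    }
    where open Sig Σ
          open SemS.Structure 𝒜

module Submission where

-- S = T(- × Y)^Y carries its state in the exponent, the SPS translation carries it as an extra
-- variable; uncurrying moves between the two. Transposing each operation of S (unit,
-- multiplication, strength, and hence bind, pairing and application) gives the corresponding
-- T-operation with the state threaded by hand, which is exactly what SPS spells out in the syntax.
-- So, writing m ≈[ r ] R for m ≈ T(r × Y) ∘ R, one shows ⟦SPS M⟧ ≈[ ρ t ] (⟦M⟧ ∘ ρΓ⁻¹)† by
-- induction on M; the isomorphisms ρ enter only through ρ⁻¹ ∘ ρ = id at argument positions,
-- and the theorem follows by moving T(ρ t × Y) back inside the transpose.

open import Defs
open import Data.Sum using (inj₁; inj₂)
open import Relation.Binary using (Setoid; IsEquivalence)
import Relation.Binary.Reasoning.Setoid as SetoidReasoning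

module BCCCProperties {o ℓ e} (C : BCCC o ℓ e) where
  open BCCCKit C public

  hom : Obj → Obj → Setoid ℓ e
  hom A B = record { Carrier = A ⇒ B ; _≈_ = _≈_ ; isEquivalence = ≈-equiv }

  module HomReasoning {A B : Obj} = SetoidReasoning (hom A B)
  open HomReasoning public

  open module ≈ {A B : Obj} = IsEquivalence (≈-equiv {A} {B}) public
    using () renaming (refl to ≈-refl; sym to ≈-sym; trans to ≈-trans)

  infixr 4 _⟩∘⟨_ refl⟩∘⟨_
  infixl 5 _⟩∘⟨refl

  _⟩∘⟨_ : ∀ {A B D} {f h : B ⇒ D} {g i : A ⇒ B} → f ≈ h → g ≈ i → f ∘ g ≈ h ∘ i
  _⟩∘⟨_ = ∘-resp-≈

  refl⟩∘⟨_ : ∀ {A B D} {f : B ⇒ D} {g i : A ⇒ B} → g ≈ i → f ∘ g ≈ f ∘ i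
  refl⟩∘⟨ p = ∘-resp-≈ ≈-refl p

  _⟩∘⟨refl : ∀ {A B D} {f h : B ⇒ D} {g : A ⇒ B} → f ≈ h → f ∘ g ≈ h ∘ g
  p ⟩∘⟨refl = ∘-resp-≈ p ≈-refl

  sym-assoc : ∀ {A B D F} {f : A ⇒ B} {g : B ⇒ D} {h : D ⇒ F} → h ∘ (g ∘ f) ≈ (h ∘ g) ∘ f
  sym-assoc = ≈-sym assoc

  assoc² : ∀ {A B D F G} {f : A ⇒ B} {g : B ⇒ D} {h : D ⇒ F} {i : F ⇒ G} →
           (i ∘ h ∘ g) ∘ f ≈ i ∘ h ∘ g ∘ f
  assoc² = ≈-trans assoc (refl⟩∘⟨ assoc)

  assoc³ : ∀ {A B D F G H} {f : A ⇒ B} {g : B ⇒ D} {h : D ⇒ F} {i : F ⇒ G} {j : G ⇒ H} →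
           (j ∘ i ∘ h ∘ g) ∘ f ≈ j ∘ i ∘ h ∘ g ∘ f
  assoc³ = ≈-trans assoc (refl⟩∘⟨ assoc²)

  assoc⁵ : ∀ {A B D F G H I J} {f : A ⇒ B} {g : B ⇒ D} {h : D ⇒ F} {i : F ⇒ G} {j : G ⇒ H}
             {k : H ⇒ I} {l : I ⇒ J} →
           (l ∘ k ∘ j ∘ i ∘ h ∘ g) ∘ f ≈ l ∘ k ∘ j ∘ i ∘ h ∘ g ∘ f
  assoc⁵ = ≈-trans assoc (refl⟩∘⟨ ≈-trans assoc (refl⟩∘⟨ assoc³))

  !-unique₂ : ∀ {A} {f g : A ⇒ 𝟏} → f ≈ g
  !-unique₂ {f = f} {g} = ≈-trans (!-unique f) (≈-sym (!-unique g))

  ¡-unique₂ : ∀ {A} {f g : 𝟎 ⇒ A} → f ≈ g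
  ¡-unique₂ {f = f} {g} = ≈-trans (¡-unique f) (≈-sym (¡-unique g))

  ⟨⟩-cong₂ : ∀ {A B D} {f f' : D ⇒ A} {g g' : D ⇒ B} → f ≈ f' → g ≈ g' → ⟨ f , g ⟩ ≈ ⟨ f' , g' ⟩
  ⟨⟩-cong₂ p q = ⟨⟩-unique (≈-trans project₁ p) (≈-trans project₂ q)

  ⟨⟩∘ : ∀ {A B D F} {f : D ⇒ A} {g : D ⇒ B} {h : F ⇒ D} → ⟨ f , g ⟩ ∘ h ≈ ⟨ f ∘ h , g ∘ h ⟩
  ⟨⟩∘ = ⟨⟩-unique (≈-trans sym-assoc (project₁ ⟩∘⟨refl)) (≈-trans sym-assoc (project₂ ⟩∘⟨refl))

  ⟨π₁,π₂⟩≈id : ∀ {A B} → ⟨ π₁ , π₂ ⟩ ≈ id {A × B}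
  ⟨π₁,π₂⟩≈id = ≈-sym (⟨⟩-unique identityʳ identityʳ)

  ⟨⟩-η : ∀ {A B D} {f : D ⇒ A × B} → ⟨ π₁ ∘ f , π₂ ∘ f ⟩ ≈ f
  ⟨⟩-η = ≈-trans (≈-sym ⟨⟩∘) (≈-trans (⟨π₁,π₂⟩≈id ⟩∘⟨refl) identityˡ)

  ⁂∘⟨⟩ : ∀ {A B A' B' D} {f : A ⇒ A'} {g : B ⇒ B'} {h : D ⇒ A} {k : D ⇒ B} →
         (f ⁂ g) ∘ ⟨ h , k ⟩ ≈ ⟨ f ∘ h , g ∘ k ⟩
  ⁂∘⟨⟩ = ≈-trans ⟨⟩∘ (⟨⟩-cong₂ (≈-trans assoc (refl⟩∘⟨ project₁)) (≈-trans assoc (refl⟩∘⟨ project₂)))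

  ⁂∘⁂ : ∀ {A B A' B' A'' B''} {f : A' ⇒ A''} {g : B' ⇒ B''} {h : A ⇒ A'} {k : B ⇒ B'} →
        (f ⁂ g) ∘ (h ⁂ k) ≈ (f ∘ h) ⁂ (g ∘ k)
  ⁂∘⁂ = ≈-trans ⁂∘⟨⟩ (⟨⟩-cong₂ sym-assoc sym-assoc)

  ⁂-cong₂ : ∀ {A B A' B'} {f f' : A ⇒ A'} {g g' : B ⇒ B'} → f ≈ f' → g ≈ g' → f ⁂ g ≈ f' ⁂ g'
  ⁂-cong₂ p q = ⟨⟩-cong₂ (p ⟩∘⟨refl) (q ⟩∘⟨refl)

  id⁂id : ∀ {A B} → id {A} ⁂ id {B} ≈ id
  id⁂id = ≈-trans (⟨⟩-cong₂ identityˡ identityˡ) ⟨π₁,π₂⟩≈id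

  ⁂≈⁂id∘id⁂ : ∀ {A B A' B'} {f : A ⇒ A'} {g : B ⇒ B'} → f ⁂ g ≈ (f ⁂ id) ∘ (id ⁂ g)
  ⁂≈⁂id∘id⁂ = ≈-sym (≈-trans ⁂∘⁂ (⁂-cong₂ identityʳ identityˡ))

  ⁂≈id⁂∘⁂id : ∀ {A B A' B'} {f : A ⇒ A'} {g : B ⇒ B'} → f ⁂ g ≈ (id ⁂ g) ∘ (f ⁂ id)
  ⁂≈id⁂∘⁂id = ≈-sym (≈-trans ⁂∘⁂ (⁂-cong₂ identityˡ identityʳ))

  swap∘⟨⟩ : ∀ {A B D} {f : D ⇒ A} {g : D ⇒ B} → swap ∘ ⟨ f , g ⟩ ≈ ⟨ g , f ⟩
  swap∘⟨⟩ = ≈-trans ⟨⟩∘ (⟨⟩-cong₂ project₂ project₁)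

  swap∘swap : ∀ {A B} → swap {A} {B} ∘ swap ≈ id
  swap∘swap = ≈-trans swap∘⟨⟩ ⟨π₁,π₂⟩≈id

  α∘⟨⟨⟩⟩ : ∀ {A B D X} {a : X ⇒ A} {b : X ⇒ B} {c : X ⇒ D} → α ∘ ⟨ ⟨ a , b ⟩ , c ⟩ ≈ ⟨ a , ⟨ b , c ⟩ ⟩
  α∘⟨⟨⟩⟩ = ≈-trans ⟨⟩∘ (⟨⟩-cong₂ (≈-trans assoc (≈-trans (refl⟩∘⟨ project₁) project₁))
             (≈-trans ⟨⟩∘ (⟨⟩-cong₂ (≈-trans assoc (≈-trans (refl⟩∘⟨ project₁) project₂)) project₂)))

  α⁻¹∘⟨⟩ : ∀ {A B D X} {x : X ⇒ A} {y : X ⇒ B × D} → α⁻¹ ∘ ⟨ x , y ⟩ ≈ ⟨ ⟨ x , π₁ ∘ y ⟩ , π₂ ∘ y ⟩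
  α⁻¹∘⟨⟩ = ≈-trans ⟨⟩∘ (⟨⟩-cong₂ (≈-trans ⟨⟩∘ (⟨⟩-cong₂ project₁ (≈-trans assoc (refl⟩∘⟨ project₂))))
             (≈-trans assoc (refl⟩∘⟨ project₂)))

  α⁻¹-natural : ∀ {A B D A' B' D'} {f : A ⇒ A'} {g : B ⇒ B'} {h : D ⇒ D'} →
                α⁻¹ ∘ (f ⁂ (g ⁂ h)) ≈ ((f ⁂ g) ⁂ h) ∘ α⁻¹
  α⁻¹-natural {f = f} {g} {h} = begin
    α⁻¹ ∘ (f ⁂ (g ⁂ h))
      ≈⟨ α⁻¹∘⟨⟩ ⟩
    ⟨ ⟨ f ∘ π₁ , π₁ ∘ (g ⁂ h) ∘ π₂ ⟩ , π₂ ∘ (g ⁂ h) ∘ π₂ ⟩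
      ≈⟨ ⟨⟩-cong₂ (⟨⟩-cong₂ ≈-refl (≈-trans sym-assoc (≈-trans (project₁ ⟩∘⟨refl) assoc)))
         (≈-trans sym-assoc (≈-trans (project₂ ⟩∘⟨refl) assoc)) ⟩
    ⟨ ⟨ f ∘ π₁ , g ∘ π₁ ∘ π₂ ⟩ , h ∘ π₂ ∘ π₂ ⟩
      ≈⟨ ≈-sym (≈-trans ⁂∘⟨⟩ (⟨⟩-cong₂ ⁂∘⟨⟩ ≈-refl)) ⟩
    ((f ⁂ g) ⁂ h) ∘ α⁻¹ ∎

  curry-cong : ∀ {A B D} {f g : D × A ⇒ B} → f ≈ g → curry f ≈ curry g
  curry-cong p = λ-unique (≈-trans β p)

  uncurry-cong : ∀ {A B D} {f g : D ⇒ B ^ A} → f ≈ g → uncurry f ≈ uncurry g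
  uncurry-cong p = refl⟩∘⟨ ⁂-cong₂ p ≈-refl

  uncurry-curry : ∀ {A B D} {f : D × A ⇒ B} → uncurry (curry f) ≈ f
  uncurry-curry = ≈-trans (refl⟩∘⟨ ⟨⟩-cong₂ ≈-refl identityˡ) β

  curry-unique : ∀ {A B D} {f : D × A ⇒ B} {h : D ⇒ B ^ A} → uncurry h ≈ f → h ≈ curry f
  curry-unique p = λ-unique (≈-trans (refl⟩∘⟨ ⟨⟩-cong₂ ≈-refl (≈-sym identityˡ)) p)

  curry-uncurry : ∀ {A B D} {h : D ⇒ B ^ A} → curry (uncurry h) ≈ h
  curry-uncurry = ≈-sym (curry-unique ≈-refl)

  uncurry-injective : ∀ {A B D} {h k : D ⇒ B ^ A} → uncurry h ≈ uncurry k → h ≈ k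
  uncurry-injective p = ≈-trans (≈-sym curry-uncurry) (≈-trans (curry-cong p) curry-uncurry)

  uncurry-∘ : ∀ {A B D F} {f : D ⇒ B ^ A} {h : F ⇒ D} → uncurry (f ∘ h) ≈ uncurry f ∘ (h ⁂ id)
  uncurry-∘ = ≈-trans (refl⟩∘⟨ ≈-trans (⁂-cong₂ ≈-refl (≈-sym identityˡ)) (≈-sym ⁂∘⁂)) sym-assoc

  uncurry-curry∘ : ∀ {A B D F} {f : D × A ⇒ B} {h : F ⇒ D} → uncurry (curry f ∘ h) ≈ f ∘ (h ⁂ id)
  uncurry-curry∘ = ≈-trans uncurry-∘ (uncurry-curry ⟩∘⟨refl)

  curry-∘ : ∀ {A B D F} {f : D × A ⇒ B} {h : F ⇒ D} → curry f ∘ h ≈ curry (f ∘ (h ⁂ id))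
  curry-∘ = curry-unique uncurry-curry∘

  uncurry∘⟨⟩ : ∀ {A B D X} {f : D ⇒ B ^ A} {a : X ⇒ D} {b : X ⇒ A} → uncurry f ∘ ⟨ a , b ⟩ ≈ ev ∘ ⟨ f ∘ a , b ⟩
  uncurry∘⟨⟩ = ≈-trans assoc (refl⟩∘⟨ ≈-trans ⁂∘⟨⟩ (⟨⟩-cong₂ ≈-refl identityˡ))

  ev∘⟨curry∘,⟩ : ∀ {A B D F} {f : D × A ⇒ B} {a : F ⇒ D} {b : F ⇒ A} → ev ∘ ⟨ curry f ∘ a , b ⟩ ≈ f ∘ ⟨ a , b ⟩
  ev∘⟨curry∘,⟩ = ≈-trans (≈-sym uncurry∘⟨⟩) (uncurry-curry ⟩∘⟨refl)

  uncurry-id : ∀ {A B} → uncurry (id {B ^ A}) ≈ ev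
  uncurry-id = ≈-trans (refl⟩∘⟨ id⁂id) identityʳ

  uncurry-expMap∘ : ∀ {A A' B B' D} {f : A' ⇒ A} {g : B ⇒ B'} {h : D ⇒ B ^ A} →
                    uncurry (expMap f g ∘ h) ≈ g ∘ uncurry h ∘ (id ⁂ f)
  uncurry-expMap∘ {f = f} {g} {h} = begin
    uncurry (expMap f g ∘ h)          ≈⟨ uncurry-curry∘ ⟩
    (g ∘ ev ∘ (id ⁂ f)) ∘ (h ⁂ id)    ≈⟨ assoc² ⟩
    g ∘ ev ∘ (id ⁂ f) ∘ (h ⁂ id)      ≈⟨ refl⟩∘⟨ refl⟩∘⟨ ≈-trans (≈-sym ⁂≈id⁂∘⁂id) ⁂≈⁂id∘id⁂ ⟩
    g ∘ ev ∘ (h ⁂ id) ∘ (id ⁂ f)      ≈⟨ refl⟩∘⟨ sym-assoc ⟩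
    g ∘ uncurry h ∘ (id ⁂ f)          ∎

  expMap-∘ : ∀ {A A' A'' B B' B''} {f : A' ⇒ A} {g : B ⇒ B'} {f' : A'' ⇒ A'} {g' : B' ⇒ B''} →
             expMap f' g' ∘ expMap f g ≈ expMap (f ∘ f') (g' ∘ g)
  expMap-∘ {f = f} {g} {f'} {g'} = uncurry-injective (begin
    uncurry (expMap f' g' ∘ expMap f g)   ≈⟨ uncurry-expMap∘ ⟩
    g' ∘ uncurry (expMap f g) ∘ (id ⁂ f') ≈⟨ refl⟩∘⟨ uncurry-curry ⟩∘⟨refl ⟩
    g' ∘ (g ∘ ev ∘ (id ⁂ f)) ∘ (id ⁂ f')  ≈⟨ refl⟩∘⟨ assoc² ⟩
    g' ∘ g ∘ ev ∘ (id ⁂ f) ∘ (id ⁂ f')    ≈⟨ refl⟩∘⟨ refl⟩∘⟨ refl⟩∘⟨ ≈-trans ⁂∘⁂ (⁂-cong₂ identityˡ ≈-refl) ⟩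
    g' ∘ g ∘ ev ∘ (id ⁂ (f ∘ f'))         ≈⟨ sym-assoc ⟩
    (g' ∘ g) ∘ ev ∘ (id ⁂ (f ∘ f'))       ≈⟨ uncurry-curry ⟨
    uncurry (expMap (f ∘ f') (g' ∘ g))    ∎)

  expMap-id : ∀ {A B} → expMap (id {A}) (id {B}) ≈ id
  expMap-id = uncurry-injective (≈-trans uncurry-curry identityˡ)

  expMap-cong₂ : ∀ {A A' B B'} {f f' : A' ⇒ A} {g g' : B ⇒ B'} → f ≈ f' → g ≈ g' → expMap f g ≈ expMap f' g'
  expMap-cong₂ p q = curry-cong (q ⟩∘⟨ refl⟩∘⟨ ⁂-cong₂ ≈-refl p)

  uncurry-curryIso∘ : ∀ {D Y Z W} {h : W ⇒ (D ^ Y) ^ Z} →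
                      uncurry (curryIso ∘ h) ≈ ev ∘ ⟨ ev ∘ ⟨ h ∘ π₁ , π₁ ∘ π₂ ⟩ , π₂ ∘ π₂ ⟩
  uncurry-curryIso∘ {h = h} = begin
    uncurry (curryIso ∘ h)                                  ≈⟨ uncurry-curry∘ ⟩
    (ev ∘ ⟨ ev ∘ ⟨ π₁ , π₁ ∘ π₂ ⟩ , π₂ ∘ π₂ ⟩) ∘ (h ⁂ id)   ≈⟨ assoc ⟩
    ev ∘ ⟨ ev ∘ ⟨ π₁ , π₁ ∘ π₂ ⟩ , π₂ ∘ π₂ ⟩ ∘ (h ⁂ id)     ≈⟨ refl⟩∘⟨ ≈-trans ⟨⟩∘ (⟨⟩-cong₂
         (≈-trans assoc (refl⟩∘⟨ ≈-trans ⟨⟩∘ (⟨⟩-cong₂ project₁ (≈-trans assoc (refl⟩∘⟨ ≈-trans project₂ identityˡ)))))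
         (≈-trans assoc (refl⟩∘⟨ ≈-trans project₂ identityˡ))) ⟩
    ev ∘ ⟨ ev ∘ ⟨ h ∘ π₁ , π₁ ∘ π₂ ⟩ , π₂ ∘ π₂ ⟩           ∎

  curryIso∘curryIso⁻¹ : ∀ {D Y Z} → curryIso {D} {Y} {Z} ∘ curryIso⁻¹ ≈ id
  curryIso∘curryIso⁻¹ = uncurry-injective (begin
    uncurry (curryIso ∘ curryIso⁻¹)                        ≈⟨ uncurry-curryIso∘ ⟩
    ev ∘ ⟨ ev ∘ ⟨ curryIso⁻¹ ∘ π₁ , π₁ ∘ π₂ ⟩ , π₂ ∘ π₂ ⟩  ≈⟨ refl⟩∘⟨ ⟨⟩-cong₂ ev∘⟨curry∘,⟩ ≈-refl ⟩
    ev ∘ ⟨ curry g ∘ ⟨ π₁ , π₁ ∘ π₂ ⟩ , π₂ ∘ π₂ ⟩          ≈⟨ ev∘⟨curry∘,⟩ ⟩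
    g ∘ ⟨ ⟨ π₁ , π₁ ∘ π₂ ⟩ , π₂ ∘ π₂ ⟩                     ≈⟨ assoc ⟩
    ev ∘ α ∘ α⁻¹                                           ≈⟨ refl⟩∘⟨ α∘α⁻¹ ⟩
    ev ∘ id                                                ≈⟨ identityʳ ⟩
    ev                                                     ≈⟨ uncurry-id ⟨
    uncurry id                                             ∎)
    where
    g = ev ∘ ⟨ π₁ ∘ π₁ , ⟨ π₂ ∘ π₁ , π₂ ⟩ ⟩
    α∘α⁻¹ : ∀ {A B D} → α ∘ α⁻¹ {A} {B} {D} ≈ id
    α∘α⁻¹ = ≈-trans α∘⟨⟨⟩⟩ (≈-trans (⟨⟩-cong₂ ≈-refl ⟨⟩-η) ⟨π₁,π₂⟩≈id)

  α∘⟨⟩ : ∀ {A B D X} {x : X ⇒ A × B} {c : X ⇒ D} → α ∘ ⟨ x , c ⟩ ≈ ⟨ π₁ ∘ x , ⟨ π₂ ∘ x , c ⟩ ⟩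
  α∘⟨⟩ = ≈-trans ⟨⟩∘ (⟨⟩-cong₂ (≈-trans assoc (refl⟩∘⟨ project₁))
           (≈-trans ⟨⟩∘ (⟨⟩-cong₂ (≈-trans assoc (refl⟩∘⟨ project₁)) project₂)))

  α-natural : ∀ {A B D A' B' D'} {f : A ⇒ A'} {g : B ⇒ B'} {h : D ⇒ D'} →
              α ∘ ((f ⁂ g) ⁂ h) ≈ (f ⁂ (g ⁂ h)) ∘ α
  α-natural {f = f} {g} {h} = begin
    α ∘ ((f ⁂ g) ⁂ h)
      ≈⟨ α∘⟨⟩ ⟩
    ⟨ π₁ ∘ (f ⁂ g) ∘ π₁ , ⟨ π₂ ∘ (f ⁂ g) ∘ π₁ , h ∘ π₂ ⟩ ⟩
      ≈⟨ ⟨⟩-cong₂ (≈-trans sym-assoc (≈-trans (project₁ ⟩∘⟨refl) assoc))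
         (⟨⟩-cong₂ (≈-trans sym-assoc (≈-trans (project₂ ⟩∘⟨refl) assoc)) ≈-refl) ⟩
    ⟨ f ∘ π₁ ∘ π₁ , ⟨ g ∘ π₂ ∘ π₁ , h ∘ π₂ ⟩ ⟩
      ≈⟨ ≈-sym (≈-trans ⁂∘⟨⟩ (⟨⟩-cong₂ ≈-refl ⁂∘⟨⟩)) ⟩
    (f ⁂ (g ⁂ h)) ∘ α ∎

  curryIso⁻¹∘curryIso : ∀ {D Y Z} → curryIso⁻¹ ∘ curryIso {D} {Y} {Z} ≈ id
  curryIso⁻¹∘curryIso = uncurry-injective (uncurry-injective (begin
    uncurry (uncurry (curryIso⁻¹ ∘ curryIso))         ≈⟨ uncurry-cong uncurry-curry∘ ⟩
    uncurry (curry g ∘ (curryIso ⁂ id))               ≈⟨ uncurry-curry∘ ⟩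
    g ∘ ((curryIso ⁂ id) ⁂ id)                        ≈⟨ assoc ⟩
    ev ∘ α ∘ ((curryIso ⁂ id) ⁂ id)                   ≈⟨ refl⟩∘⟨ α-natural ⟩
    ev ∘ (curryIso ⁂ (id ⁂ id)) ∘ α                   ≈⟨ refl⟩∘⟨ ⁂-cong₂ ≈-refl id⁂id ⟩∘⟨refl ⟩
    ev ∘ (curryIso ⁂ id) ∘ α                          ≈⟨ sym-assoc ⟩
    uncurry curryIso ∘ α                              ≈⟨ uncurry-curry ⟩∘⟨refl ⟩
    (ev ∘ ⟨ ev ∘ ⟨ π₁ , π₁ ∘ π₂ ⟩ , π₂ ∘ π₂ ⟩) ∘ α    ≈⟨ ≈-trans assoc (refl⟩∘⟨ ≈-trans ⟨⟩∘ (⟨⟩-cong₂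
         (≈-trans assoc (refl⟩∘⟨ ≈-trans ⟨⟩∘ (⟨⟩-cong₂ project₁ (≈-trans assoc (≈-trans (refl⟩∘⟨ project₂) project₁)))))
         (≈-trans assoc (≈-trans (refl⟩∘⟨ project₂) project₂)))) ⟩
    ev ∘ ⟨ ev ∘ ⟨ π₁ ∘ π₁ , π₂ ∘ π₁ ⟩ , π₂ ⟩          ≈⟨ refl⟩∘⟨ ⟨⟩-cong₂ (refl⟩∘⟨ ⟨⟩-η) (≈-sym identityˡ) ⟩
    ev ∘ ⟨ ev ∘ π₁ , id ∘ π₂ ⟩                        ≈⟨ refl⟩∘⟨ ⁂-cong₂ (≈-sym uncurry-id) ≈-refl ⟩
    uncurry (uncurry id)                              ∎))
    where
    g = ev ∘ ⟨ π₁ ∘ π₁ , ⟨ π₂ ∘ π₁ , π₂ ⟩ ⟩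

  []-cong₂ : ∀ {A B D} {f f' : A ⇒ D} {g g' : B ⇒ D} → f ≈ f' → g ≈ g' → [ f , g ] ≈ [ f' , g' ]
  []-cong₂ p q = []-unique (≈-trans inject₁ p) (≈-trans inject₂ q)

  ∘[] : ∀ {A B D F} {f : A ⇒ D} {g : B ⇒ D} {h : D ⇒ F} → h ∘ [ f , g ] ≈ [ h ∘ f , h ∘ g ]
  ∘[] = []-unique (≈-trans assoc (refl⟩∘⟨ inject₁)) (≈-trans assoc (refl⟩∘⟨ inject₂))

  []-ext : ∀ {A B D} {h k : A + B ⇒ D} → h ∘ ι₁ ≈ k ∘ ι₁ → h ∘ ι₂ ≈ k ∘ ι₂ → h ≈ k
  []-ext p q = ≈-trans ([]-unique p q) (≈-sym ([]-unique ≈-refl ≈-refl))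

  []∘⊹ : ∀ {A B A' B' D} {f : A' ⇒ D} {g : B' ⇒ D} {f' : A ⇒ A'} {g' : B ⇒ B'} →
         [ f , g ] ∘ (f' ⊹ g') ≈ [ f ∘ f' , g ∘ g' ]
  []∘⊹ = ≈-trans ∘[] ([]-cong₂ (≈-trans sym-assoc (inject₁ ⟩∘⟨refl)) (≈-trans sym-assoc (inject₂ ⟩∘⟨refl)))

  ⊹∘⊹ : ∀ {A B A' B' A'' B''} {f : A' ⇒ A''} {g : B' ⇒ B''} {f' : A ⇒ A'} {g' : B ⇒ B'} →
        (f ⊹ g) ∘ (f' ⊹ g') ≈ (f ∘ f') ⊹ (g ∘ g')
  ⊹∘⊹ = ≈-trans []∘⊹ ([]-cong₂ assoc assoc)

  ⊹-cong₂ : ∀ {A B A' B'} {f f' : A ⇒ A'} {g g' : B ⇒ B'} → f ≈ f' → g ≈ g' → f ⊹ g ≈ f' ⊹ g'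
  ⊹-cong₂ p q = []-cong₂ (refl⟩∘⟨ p) (refl⟩∘⟨ q)

  id⊹id : ∀ {A B} → id {A} ⊹ id {B} ≈ id
  id⊹id = ≈-sym ([]-unique (≈-trans identityˡ (≈-sym identityʳ)) (≈-trans identityˡ (≈-sym identityʳ)))

  dist∘⟨,ι₁∘⟩ : ∀ {X A B D} {a : D ⇒ X} {b : D ⇒ A} → dist {X} {A} {B} ∘ ⟨ a , ι₁ ∘ b ⟩ ≈ ι₁ ∘ ⟨ a , b ⟩
  dist∘⟨,ι₁∘⟩ {a = a} {b} = begin
    (ev ∘ ⟨ [ c₁ , c₂ ] ∘ π₂ , π₁ ⟩) ∘ ⟨ a , ι₁ ∘ b ⟩
      ≈⟨ assoc ⟩
    ev ∘ ⟨ [ c₁ , c₂ ] ∘ π₂ , π₁ ⟩ ∘ ⟨ a , ι₁ ∘ b ⟩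
      ≈⟨ refl⟩∘⟨ ≈-trans ⟨⟩∘ (⟨⟩-cong₂ (≈-trans assoc (refl⟩∘⟨ project₂)) project₁) ⟩
    ev ∘ ⟨ [ c₁ , c₂ ] ∘ ι₁ ∘ b , a ⟩
      ≈⟨ refl⟩∘⟨ ⟨⟩-cong₂ (≈-trans sym-assoc (inject₁ ⟩∘⟨refl)) ≈-refl ⟩
    ev ∘ ⟨ c₁ ∘ b , a ⟩
      ≈⟨ ev∘⟨curry∘,⟩ ⟩
    (ι₁ ∘ swap) ∘ ⟨ b , a ⟩
      ≈⟨ ≈-trans assoc (refl⟩∘⟨ swap∘⟨⟩) ⟩
    ι₁ ∘ ⟨ a , b ⟩ ∎
    where
    c₁ = curry (ι₁ ∘ swap)
    c₂ = curry (ι₂ ∘ swap)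

  dist∘⟨,ι₂∘⟩ : ∀ {X A B D} {a : D ⇒ X} {b : D ⇒ B} → dist {X} {A} {B} ∘ ⟨ a , ι₂ ∘ b ⟩ ≈ ι₂ ∘ ⟨ a , b ⟩
  dist∘⟨,ι₂∘⟩ {a = a} {b} = begin
    (ev ∘ ⟨ [ c₁ , c₂ ] ∘ π₂ , π₁ ⟩) ∘ ⟨ a , ι₂ ∘ b ⟩
      ≈⟨ assoc ⟩
    ev ∘ ⟨ [ c₁ , c₂ ] ∘ π₂ , π₁ ⟩ ∘ ⟨ a , ι₂ ∘ b ⟩
      ≈⟨ refl⟩∘⟨ ≈-trans ⟨⟩∘ (⟨⟩-cong₂ (≈-trans assoc (refl⟩∘⟨ project₂)) project₁) ⟩
    ev ∘ ⟨ [ c₁ , c₂ ] ∘ ι₂ ∘ b , a ⟩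
      ≈⟨ refl⟩∘⟨ ⟨⟩-cong₂ (≈-trans sym-assoc (inject₂ ⟩∘⟨refl)) ≈-refl ⟩
    ev ∘ ⟨ c₂ ∘ b , a ⟩
      ≈⟨ ev∘⟨curry∘,⟩ ⟩
    (ι₂ ∘ swap) ∘ ⟨ b , a ⟩
      ≈⟨ ≈-trans assoc (refl⟩∘⟨ swap∘⟨⟩) ⟩
    ι₂ ∘ ⟨ a , b ⟩ ∎
    where
    c₁ = curry (ι₁ ∘ swap)
    c₂ = curry (ι₂ ∘ swap)

  []∘dist∘⟨,ι₁∘⟩ : ∀ {X A B D F} {f : X × A ⇒ F} {g : X × B ⇒ F} {a : D ⇒ X} {b : D ⇒ A} →
                   [ f , g ] ∘ dist ∘ ⟨ a , ι₁ ∘ b ⟩ ≈ f ∘ ⟨ a , b ⟩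
  []∘dist∘⟨,ι₁∘⟩ = ≈-trans (refl⟩∘⟨ dist∘⟨,ι₁∘⟩) (≈-trans sym-assoc (inject₁ ⟩∘⟨refl))

  []∘dist∘⟨,ι₂∘⟩ : ∀ {X A B D F} {f : X × A ⇒ F} {g : X × B ⇒ F} {a : D ⇒ X} {b : D ⇒ B} →
                   [ f , g ] ∘ dist ∘ ⟨ a , ι₂ ∘ b ⟩ ≈ g ∘ ⟨ a , b ⟩
  []∘dist∘⟨,ι₂∘⟩ = ≈-trans (refl⟩∘⟨ dist∘⟨,ι₂∘⟩) (≈-trans sym-assoc (inject₂ ⟩∘⟨refl))

  -- Transposing along swap reduces this to the universal property of A + B.
  id⁂ι-jointly-epic : ∀ {X A B D} {h k : X × (A + B) ⇒ D} →
                      h ∘ (id ⁂ ι₁) ≈ k ∘ (id ⁂ ι₁) → h ∘ (id ⁂ ι₂) ≈ k ∘ (id ⁂ ι₂) → h ≈ k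
  id⁂ι-jointly-epic {h = h} {k} p q = begin
    h                  ≈⟨ ≈-sym identityʳ ⟩
    h ∘ id             ≈⟨ refl⟩∘⟨ ≈-sym swap∘swap ⟩
    h ∘ swap ∘ swap    ≈⟨ sym-assoc ⟩
    (h ∘ swap) ∘ swap  ≈⟨ swapped ⟩∘⟨refl ⟩
    (k ∘ swap) ∘ swap  ≈⟨ ≈-trans assoc (≈-trans (refl⟩∘⟨ swap∘swap) identityʳ) ⟩
    k                  ∎
    where
    swap-⁂ : ∀ {P Q R S} {j : Q × S ⇒ R} {ι : P ⇒ S} → (j ∘ swap) ∘ (ι ⁂ id {Q}) ≈ (j ∘ (id ⁂ ι)) ∘ swap
    swap-⁂ = ≈-trans assoc (≈-trans (refl⟩∘⟨ ≈-trans swap∘⟨⟩ (≈-sym ⁂∘⟨⟩)) sym-assoc)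
    transposed : ∀ {Z} {ι : Z ⇒ _} → h ∘ (id ⁂ ι) ≈ k ∘ (id ⁂ ι) → curry (h ∘ swap) ∘ ι ≈ curry (k ∘ swap) ∘ ι
    transposed r = ≈-trans curry-∘ (≈-trans (curry-cong (≈-trans swap-⁂ (≈-trans (r ⟩∘⟨refl) (≈-sym swap-⁂)))) (≈-sym curry-∘))
    swapped : h ∘ swap ≈ k ∘ swap
    swapped = ≈-trans (≈-sym uncurry-curry) (≈-trans (uncurry-cong ([]-ext (transposed p) (transposed q))) uncurry-curry)

  id⁂⟨ι⁂id⟩-jointly-epic : ∀ {X A B Z D} {h k : X × ((A + B) × Z) ⇒ D} →
                           h ∘ (id ⁂ (ι₁ ⁂ id)) ≈ k ∘ (id ⁂ (ι₁ ⁂ id)) →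
                           h ∘ (id ⁂ (ι₂ ⁂ id)) ≈ k ∘ (id ⁂ (ι₂ ⁂ id)) → h ≈ k
  id⁂⟨ι⁂id⟩-jointly-epic {X} {A} {B} {Z} {h = h} {k} p q = begin
    h                ≈⟨ ≈-sym identityʳ ⟩
    h ∘ id           ≈⟨ refl⟩∘⟨ ≈-sym j⁻¹∘j ⟩
    h ∘ j⁻¹ ∘ j      ≈⟨ sym-assoc ⟩
    (h ∘ j⁻¹) ∘ j    ≈⟨ id⁂ι-jointly-epic (restrict p) (restrict q) ⟩∘⟨refl ⟩
    (k ∘ j⁻¹) ∘ j    ≈⟨ assoc ⟩
    k ∘ j⁻¹ ∘ j      ≈⟨ refl⟩∘⟨ j⁻¹∘j ⟩
    k ∘ id           ≈⟨ identityʳ ⟩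
    k                ∎
    where
    j : X × ((A + B) × Z) ⇒ (X × Z) × (A + B)
    j = ⟨ ⟨ π₁ , π₂ ∘ π₂ ⟩ , π₁ ∘ π₂ ⟩
    j⁻¹ : ∀ {W} → (X × Z) × W ⇒ X × (W × Z)
    j⁻¹ = ⟨ π₁ ∘ π₁ , ⟨ π₂ , π₂ ∘ π₁ ⟩ ⟩
    j⁻¹∘j : j⁻¹ ∘ j ≈ id
    j⁻¹∘j = ≈-trans ⟨⟩∘ (≈-trans (⟨⟩-cong₂ (≈-trans assoc (≈-trans (refl⟩∘⟨ project₁) project₁))
              (≈-trans ⟨⟩∘ (≈-trans (⟨⟩-cong₂ project₂ (≈-trans assoc (≈-trans (refl⟩∘⟨ project₁) project₂))) ⟨⟩-η)))
              ⟨π₁,π₂⟩≈id)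
    j⁻¹-natural : ∀ {V W} {ι : V ⇒ W} → j⁻¹ ∘ (id ⁂ ι) ≈ (id ⁂ (ι ⁂ id)) ∘ j⁻¹
    j⁻¹-natural {ι = ι} =
      ≈-trans ⟨⟩∘ (≈-trans (⟨⟩-cong₂ π₁-part (≈-trans ⟨⟩∘ (≈-trans (⟨⟩-cong₂ project₂ π₁-part) (≈-sym ⁂∘⟨⟩))))
                           (≈-sym ⁂∘⟨⟩))
      where
      π₁-part : ∀ {P} {p : X × Z ⇒ P} → (p ∘ π₁) ∘ (id ⁂ ι) ≈ id ∘ p ∘ π₁
      π₁-part = ≈-trans assoc (≈-trans (refl⟩∘⟨ ≈-trans project₁ identityˡ) (≈-sym identityˡ))
    restrict : ∀ {V} {ι : V ⇒ A + B} → h ∘ (id ⁂ (ι ⁂ id)) ≈ k ∘ (id ⁂ (ι ⁂ id)) →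
               (h ∘ j⁻¹) ∘ (id ⁂ ι) ≈ (k ∘ j⁻¹) ∘ (id ⁂ ι)
    restrict r = ≈-trans assoc (≈-trans (refl⟩∘⟨ j⁻¹-natural) (≈-trans sym-assoc (≈-trans (r ⟩∘⟨refl)
                   (≈-trans assoc (≈-trans (refl⟩∘⟨ ≈-sym j⁻¹-natural) sym-assoc)))))

  dist∘⁂ι₁ : ∀ {X X' A B} {f : X ⇒ X'} → dist {X'} {A} {B} ∘ (f ⁂ ι₁) ≈ ι₁ ∘ (f ⁂ id)
  dist∘⁂ι₁ = ≈-trans dist∘⟨,ι₁∘⟩ (refl⟩∘⟨ ⟨⟩-cong₂ ≈-refl (≈-sym identityˡ))

  dist∘⁂ι₂ : ∀ {X X' A B} {f : X ⇒ X'} → dist {X'} {A} {B} ∘ (f ⁂ ι₂) ≈ ι₂ ∘ (f ⁂ id)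
  dist∘⁂ι₂ = ≈-trans dist∘⟨,ι₂∘⟩ (refl⟩∘⟨ ⟨⟩-cong₂ ≈-refl (≈-sym identityˡ))

  dist-natural : ∀ {X X' A B} {h : X ⇒ X'} → dist {X'} {A} {B} ∘ (h ⁂ id) ≈ ((h ⁂ id) ⊹ (h ⁂ id)) ∘ dist
  dist-natural {X} {X'} {A} {B} {h} = id⁂ι-jointly-epic
    (≈-trans (≈-trans pull dist∘⁂ι₁) (≈-sym (≈-trans (push dist∘⁂ι₁) inject₁)))
    (≈-trans (≈-trans pull dist∘⁂ι₂) (≈-sym (≈-trans (push dist∘⁂ι₂) inject₂)))
    where
    pull : ∀ {V} {ι : V ⇒ A + B} → (dist ∘ (h ⁂ id)) ∘ (id ⁂ ι) ≈ dist ∘ (h ⁂ ι)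
    pull = ≈-trans assoc (refl⟩∘⟨ ≈-trans ⁂∘⁂ (⁂-cong₂ identityʳ identityˡ))
    push : ∀ {P V F} {ι : V ⇒ A + B} {ι' : P × V ⇒ P × A + P × B} {g : P × A + P × B ⇒ F} →
           dist ∘ (id ⁂ ι) ≈ ι' ∘ (id ⁂ id) →
           (g ∘ dist) ∘ (id ⁂ ι) ≈ g ∘ ι'
    push law = ≈-trans assoc (refl⟩∘⟨ ≈-trans law (≈-trans (refl⟩∘⟨ id⁂id) identityʳ))

  []∘dist∘⁂id : ∀ {X X' A B D} {f : X' × A ⇒ D} {g : X' × B ⇒ D} {h : X ⇒ X'} →
                [ f , g ] ∘ dist ∘ (h ⁂ id) ≈ [ f ∘ (h ⁂ id) , g ∘ (h ⁂ id) ] ∘ dist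
  []∘dist∘⁂id = ≈-trans (refl⟩∘⟨ dist-natural) (≈-trans sym-assoc ([]∘⊹ ⟩∘⟨refl))

  []∘dist∘⁂ι₁ : ∀ {X X' A B D} {f : X' × A ⇒ D} {g : X' × B ⇒ D} {h : X ⇒ X'} →
                ([ f , g ] ∘ dist) ∘ (h ⁂ ι₁) ≈ f ∘ (h ⁂ id)
  []∘dist∘⁂ι₁ = ≈-trans assoc (≈-trans (refl⟩∘⟨ dist∘⁂ι₁) (≈-trans sym-assoc (inject₁ ⟩∘⟨refl)))

  []∘dist∘⁂ι₂ : ∀ {X X' A B D} {f : X' × A ⇒ D} {g : X' × B ⇒ D} {h : X ⇒ X'} →
                ([ f , g ] ∘ dist) ∘ (h ⁂ ι₂) ≈ g ∘ (h ⁂ id)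
  []∘dist∘⁂ι₂ = ≈-trans assoc (≈-trans (refl⟩∘⟨ dist∘⁂ι₂) (≈-trans sym-assoc (inject₂ ⟩∘⟨refl)))

  id⁂⟨⁂id⟩∘id⁂⟨⁂id⟩ : ∀ {X A B D Z} {f : B ⇒ D} {g : A ⇒ B} →
                      (id {X} ⁂ (f ⁂ id {Z})) ∘ (id ⁂ (g ⁂ id)) ≈ id ⁂ ((f ∘ g) ⁂ id)
  id⁂⟨⁂id⟩∘id⁂⟨⁂id⟩ = ≈-trans ⁂∘⁂ (⁂-cong₂ identityˡ (≈-trans ⁂∘⁂ (⁂-cong₂ ≈-refl identityˡ)))

-- pairᴹ and appᴹ are the composites Sem.Interp uses for pair and app; they only need the bare
-- operations, so the same notation serves T and S = T(- × Y)^Y.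
module MonadOpsProperties {o ℓ e} {C : BCCC o ℓ e} (M : MonadOps C) where
  open BCCCProperties C
  open MonadOps M

  bind : ∀ {Γ A B} → Γ ⇒ F₀ A → Γ × A ⇒ F₀ B → Γ ⇒ F₀ B
  bind m k = μ ∘ F₁ k ∘ st ∘ ⟨ id , m ⟩

  pairᴹ : ∀ {Γ A B} → Γ ⇒ F₀ A → Γ ⇒ F₀ B → Γ ⇒ F₀ (A × B)
  pairᴹ m n = μ ∘ F₁ st ∘ st' ∘ ⟨ m , n ⟩

  appᴹ : ∀ {Γ A B} → Γ ⇒ F₀ (F₀ B ^ A) → Γ ⇒ F₀ A → Γ ⇒ F₀ B
  appᴹ m n = μ ∘ F₁ μ ∘ F₁ (F₁ ev) ∘ F₁ st ∘ st' ∘ ⟨ m , n ⟩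

  pairᴹ-cong₂ : ∀ {Γ A B} {m m' : Γ ⇒ F₀ A} {n n' : Γ ⇒ F₀ B} → m ≈ m' → n ≈ n' → pairᴹ m n ≈ pairᴹ m' n'
  pairᴹ-cong₂ p q = refl⟩∘⟨ refl⟩∘⟨ refl⟩∘⟨ ⟨⟩-cong₂ p q

  pairᴹ∘ : ∀ {Γ Δ A B} {m : Γ ⇒ F₀ A} {n : Γ ⇒ F₀ B} {h : Δ ⇒ Γ} → pairᴹ m n ∘ h ≈ pairᴹ (m ∘ h) (n ∘ h)
  pairᴹ∘ = ≈-trans assoc³ (refl⟩∘⟨ refl⟩∘⟨ refl⟩∘⟨ ⟨⟩∘)

  appᴹ-cong₂ : ∀ {Γ A B} {m m' : Γ ⇒ F₀ (F₀ B ^ A)} {n n' : Γ ⇒ F₀ A} → m ≈ m' → n ≈ n' → appᴹ m n ≈ appᴹ m' n'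
  appᴹ-cong₂ p q = refl⟩∘⟨ refl⟩∘⟨ refl⟩∘⟨ refl⟩∘⟨ refl⟩∘⟨ ⟨⟩-cong₂ p q

  appᴹ∘ : ∀ {Γ Δ A B} {m : Γ ⇒ F₀ (F₀ B ^ A)} {n : Γ ⇒ F₀ A} {h : Δ ⇒ Γ} → appᴹ m n ∘ h ≈ appᴹ (m ∘ h) (n ∘ h)
  appᴹ∘ = ≈-trans assoc⁵ (refl⟩∘⟨ refl⟩∘⟨ refl⟩∘⟨ refl⟩∘⟨ refl⟩∘⟨ ⟨⟩∘)

module StrongMonadProperties {o ℓ e} {C : BCCC o ℓ e} (T : StrongMonad C) where
  open BCCCProperties C public
  open StrongMonad T public
  open MonadOps ops public
  open MonadOpsProperties ops public

  F₁∘F₁∘ : ∀ {A B D X} {f : A ⇒ B} {g : B ⇒ D} {h : X ⇒ F₀ A} → F₁ g ∘ F₁ f ∘ h ≈ F₁ (g ∘ f) ∘ h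
  F₁∘F₁∘ = ≈-trans sym-assoc (≈-sym F-∘ ⟩∘⟨refl)

  F₁⁂id∘F₁⁂id∘ : ∀ {A B A' D X} {f : A ⇒ B} {g : B ⇒ D} {h : X ⇒ F₀ (A × A')} →
                 F₁ (g ⁂ id {A'}) ∘ F₁ (f ⁂ id) ∘ h ≈ F₁ ((g ∘ f) ⁂ id) ∘ h
  F₁⁂id∘F₁⁂id∘ = ≈-trans F₁∘F₁∘ (F-resp-≈ (≈-trans ⁂∘⁂ (⁂-cong₂ ≈-refl identityˡ)) ⟩∘⟨refl)

  F₁∘η∘ : ∀ {A B X} {f : A ⇒ B} {g : X ⇒ A} → F₁ f ∘ η ∘ g ≈ η ∘ f ∘ g
  F₁∘η∘ = ≈-trans sym-assoc (≈-trans (η-natural ⟩∘⟨refl) assoc)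

  μ∘η∘ : ∀ {A X} {f : X ⇒ F₀ A} → μ ∘ η ∘ f ≈ f
  μ∘η∘ = ≈-trans sym-assoc (≈-trans (μ-η ⟩∘⟨refl) identityˡ)

  μ∘F₁F₁∘ : ∀ {A B X} {g : A ⇒ B} {h : X ⇒ F₀ (F₀ A)} → μ ∘ F₁ (F₁ g) ∘ h ≈ F₁ g ∘ μ ∘ h
  μ∘F₁F₁∘ = ≈-trans sym-assoc (≈-trans (≈-sym μ-natural ⟩∘⟨refl) assoc)

  μ∘F₁μ∘ : ∀ {A X} {h : X ⇒ F₀ (F₀ (F₀ A))} → μ ∘ F₁ μ ∘ h ≈ μ ∘ μ ∘ h
  μ∘F₁μ∘ = ≈-trans sym-assoc (≈-trans (μ-assoc ⟩∘⟨refl) assoc)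

  st∘⁂id : ∀ {X X' W} {h : X ⇒ X'} → st {X'} {W} ∘ (h ⁂ id) ≈ F₁ (h ⁂ id) ∘ st
  st∘⁂id = ≈-sym (≈-trans st-natural (refl⟩∘⟨ ⁂-cong₂ ≈-refl F-id))

  st∘⟨,η∘⟩ : ∀ {Γ A B} {a : Γ ⇒ A} {b : Γ ⇒ B} → st ∘ ⟨ a , η ∘ b ⟩ ≈ η ∘ ⟨ a , b ⟩
  st∘⟨,η∘⟩ {a = a} {b} = begin
    st ∘ ⟨ a , η ∘ b ⟩            ≈⟨ refl⟩∘⟨ ≈-trans ⁂∘⟨⟩ (⟨⟩-cong₂ identityˡ ≈-refl) ⟨
    st ∘ (id ⁂ η) ∘ ⟨ a , b ⟩     ≈⟨ sym-assoc ⟩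
    (st ∘ (id ⁂ η)) ∘ ⟨ a , b ⟩   ≈⟨ st-η ⟩∘⟨refl ⟩
    η ∘ ⟨ a , b ⟩                 ∎

  st∘⟨⟩ : ∀ {Γ A X} {a : Γ ⇒ X} {m : Γ ⇒ F₀ A} → st ∘ ⟨ a , m ⟩ ≈ F₁ (a ⁂ id) ∘ st ∘ ⟨ id , m ⟩
  st∘⟨⟩ {a = a} {m} = begin
    st ∘ ⟨ a , m ⟩                  ≈⟨ refl⟩∘⟨ ≈-trans ⁂∘⟨⟩ (⟨⟩-cong₂ identityʳ identityˡ) ⟨
    st ∘ (a ⁂ id) ∘ ⟨ id , m ⟩      ≈⟨ ≈-trans sym-assoc (st∘⁂id ⟩∘⟨refl) ⟩
    (F₁ (a ⁂ id) ∘ st) ∘ ⟨ id , m ⟩ ≈⟨ assoc ⟩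
    F₁ (a ⁂ id) ∘ st ∘ ⟨ id , m ⟩   ∎

  F₁π₂∘st∘⟨id,⟩ : ∀ {Γ A} {m : Γ ⇒ F₀ A} → F₁ π₂ ∘ st ∘ ⟨ id , m ⟩ ≈ m
  F₁π₂∘st∘⟨id,⟩ = ≈-trans sym-assoc (≈-trans (st-unit ⟩∘⟨refl) project₂)

  bind-cong₂ : ∀ {Γ A B} {m m' : Γ ⇒ F₀ A} {k k' : Γ × A ⇒ F₀ B} → m ≈ m' → k ≈ k' → bind m k ≈ bind m' k'
  bind-cong₂ p q = refl⟩∘⟨ F-resp-≈ q ⟩∘⟨ refl⟩∘⟨ ⟨⟩-cong₂ ≈-refl p

  bind-congʳ : ∀ {Γ A B} {m : Γ ⇒ F₀ A} {k k' : Γ × A ⇒ F₀ B} → k ≈ k' → bind m k ≈ bind m k'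
  bind-congʳ = bind-cong₂ ≈-refl

  η∘-bind : ∀ {Γ A B} {a : Γ ⇒ A} {k : Γ × A ⇒ F₀ B} → bind (η ∘ a) k ≈ k ∘ ⟨ id , a ⟩
  η∘-bind {a = a} {k} = begin
    μ ∘ F₁ k ∘ st ∘ ⟨ id , η ∘ a ⟩  ≈⟨ refl⟩∘⟨ refl⟩∘⟨ st∘⟨,η∘⟩ ⟩
    μ ∘ F₁ k ∘ η ∘ ⟨ id , a ⟩       ≈⟨ refl⟩∘⟨ F₁∘η∘ ⟩
    μ ∘ η ∘ k ∘ ⟨ id , a ⟩          ≈⟨ μ∘η∘ ⟩
    k ∘ ⟨ id , a ⟩                  ∎

  bind-η∘ : ∀ {Γ A B} {m : Γ ⇒ F₀ A} {q : Γ × A ⇒ B} → bind m (η ∘ q) ≈ F₁ q ∘ st ∘ ⟨ id , m ⟩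
  bind-η∘ = ≈-trans (refl⟩∘⟨ (F-∘ ⟩∘⟨refl)) (≈-trans (refl⟩∘⟨ assoc) (≈-trans sym-assoc (≈-trans (μ-Fη ⟩∘⟨refl) identityˡ)))

  bind-η∘∘π₂ : ∀ {Γ A B} {m : Γ ⇒ F₀ A} {g : A ⇒ B} → bind m (η ∘ g ∘ π₂) ≈ F₁ g ∘ m
  bind-η∘∘π₂ = ≈-trans bind-η∘ (≈-trans (≈-sym F₁∘F₁∘) (refl⟩∘⟨ F₁π₂∘st∘⟨id,⟩))

  bind∘ : ∀ {Γ Δ A B} {m : Γ ⇒ F₀ A} {k : Γ × A ⇒ F₀ B} {h : Δ ⇒ Γ} →
          bind m k ∘ h ≈ bind (m ∘ h) (k ∘ (h ⁂ id))
  bind∘ {m = m} {k} {h} = begin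
    (μ ∘ F₁ k ∘ st ∘ ⟨ id , m ⟩) ∘ h            ≈⟨ assoc³ ⟩
    μ ∘ F₁ k ∘ st ∘ ⟨ id , m ⟩ ∘ h              ≈⟨ refl⟩∘⟨ refl⟩∘⟨ refl⟩∘⟨ ≈-trans ⟨⟩∘ (⟨⟩-cong₂ identityˡ ≈-refl) ⟩
    μ ∘ F₁ k ∘ st ∘ ⟨ h , m ∘ h ⟩               ≈⟨ refl⟩∘⟨ refl⟩∘⟨ st∘⟨⟩ ⟩
    μ ∘ F₁ k ∘ F₁ (h ⁂ id) ∘ st ∘ ⟨ id , m ∘ h ⟩ ≈⟨ refl⟩∘⟨ F₁∘F₁∘ ⟩
    μ ∘ F₁ (k ∘ (h ⁂ id)) ∘ st ∘ ⟨ id , m ∘ h ⟩ ∎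

  F₁∘bind : ∀ {Γ A B D} {m : Γ ⇒ F₀ A} {k : Γ × A ⇒ F₀ B} {g : B ⇒ D} →
            F₁ g ∘ bind m k ≈ bind m (F₁ g ∘ k)
  F₁∘bind {m = m} {k} {g} = begin
    F₁ g ∘ μ ∘ F₁ k ∘ st ∘ ⟨ id , m ⟩         ≈⟨ sym-assoc ⟩
    (F₁ g ∘ μ) ∘ F₁ k ∘ st ∘ ⟨ id , m ⟩       ≈⟨ μ-natural ⟩∘⟨refl ⟩
    (μ ∘ F₁ (F₁ g)) ∘ F₁ k ∘ st ∘ ⟨ id , m ⟩  ≈⟨ ≈-trans assoc (refl⟩∘⟨ F₁∘F₁∘) ⟩
    μ ∘ F₁ (F₁ g ∘ k) ∘ st ∘ ⟨ id , m ⟩       ∎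

  μ∘F₁∘bind : ∀ {Γ A B D} {m : Γ ⇒ F₀ A} {k : Γ × A ⇒ F₀ B} {g : B ⇒ F₀ D} →
              μ ∘ F₁ g ∘ bind m k ≈ bind m (μ ∘ F₁ g ∘ k)
  μ∘F₁∘bind {m = m} {k} {g} = begin
    μ ∘ F₁ g ∘ bind m k                        ≈⟨ refl⟩∘⟨ F₁∘bind ⟩
    μ ∘ μ ∘ F₁ (F₁ g ∘ k) ∘ st ∘ ⟨ id , m ⟩    ≈⟨ μ∘F₁μ∘ ⟨
    μ ∘ F₁ μ ∘ F₁ (F₁ g ∘ k) ∘ st ∘ ⟨ id , m ⟩ ≈⟨ refl⟩∘⟨ F₁∘F₁∘ ⟩
    μ ∘ F₁ (μ ∘ F₁ g ∘ k) ∘ st ∘ ⟨ id , m ⟩    ∎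

  bind-F₁∘ : ∀ {Γ A A' B} {m : Γ ⇒ F₀ A} {f : A ⇒ A'} {k : Γ × A' ⇒ F₀ B} →
             bind (F₁ f ∘ m) k ≈ bind m (k ∘ (id ⁂ f))
  bind-F₁∘ {m = m} {f} {k} = begin
    μ ∘ F₁ k ∘ st ∘ ⟨ id , F₁ f ∘ m ⟩           ≈⟨ refl⟩∘⟨ refl⟩∘⟨ refl⟩∘⟨ ≈-trans ⁂∘⟨⟩ (⟨⟩-cong₂ identityˡ ≈-refl) ⟨
    μ ∘ F₁ k ∘ st ∘ (id ⁂ F₁ f) ∘ ⟨ id , m ⟩    ≈⟨ refl⟩∘⟨ refl⟩∘⟨ ≈-trans sym-assoc (≈-sym st-natural ⟩∘⟨refl) ⟩
    μ ∘ F₁ k ∘ (F₁ (id ⁂ f) ∘ st) ∘ ⟨ id , m ⟩  ≈⟨ refl⟩∘⟨ ≈-trans (refl⟩∘⟨ assoc) F₁∘F₁∘ ⟩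
    μ ∘ F₁ (k ∘ (id ⁂ f)) ∘ st ∘ ⟨ id , m ⟩     ∎

  μ∘F₁∘st∘⟨⟩ : ∀ {Γ A X B} {a : Γ ⇒ X} {m : Γ ⇒ F₀ A} {k : X × A ⇒ F₀ B} →
               μ ∘ F₁ k ∘ st ∘ ⟨ a , m ⟩ ≈ bind m (k ∘ (a ⁂ id))
  μ∘F₁∘st∘⟨⟩ = ≈-trans (refl⟩∘⟨ refl⟩∘⟨ st∘⟨⟩) (refl⟩∘⟨ F₁∘F₁∘)

  -- The strength axiom for α, specialised to the diagonal.
  bind-st∘⟨id,⟩ : ∀ {Γ A B} {m : Γ ⇒ F₀ A} {l : Γ × (Γ × A) ⇒ F₀ B} →
                  bind (st ∘ ⟨ id , m ⟩) l ≈ bind m (l ∘ ⟨ π₁ , id ⟩)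
  bind-st∘⟨id,⟩ {m = m} = ≈-trans (refl⟩∘⟨ refl⟩∘⟨ st∘⟨id,st⟩) (refl⟩∘⟨ F₁∘F₁∘)
    where
    st∘⟨id,st⟩ : st ∘ ⟨ id , st ∘ ⟨ id , m ⟩ ⟩ ≈ F₁ ⟨ π₁ , id ⟩ ∘ st ∘ ⟨ id , m ⟩
    st∘⟨id,st⟩ = begin
      st ∘ ⟨ id , st ∘ ⟨ id , m ⟩ ⟩
        ≈⟨ refl⟩∘⟨ ≈-trans ⁂∘⟨⟩ (⟨⟩-cong₂ identityˡ ≈-refl) ⟨
      st ∘ (id ⁂ st) ∘ ⟨ id , ⟨ id , m ⟩ ⟩
        ≈⟨ refl⟩∘⟨ refl⟩∘⟨ α∘⟨⟨⟩⟩ ⟨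
      st ∘ (id ⁂ st) ∘ α ∘ ⟨ ⟨ id , id ⟩ , m ⟩
        ≈⟨ ≈-trans (refl⟩∘⟨ sym-assoc) sym-assoc ⟩
      (st ∘ (id ⁂ st) ∘ α) ∘ ⟨ ⟨ id , id ⟩ , m ⟩
        ≈⟨ ≈-sym st-α ⟩∘⟨refl ⟩
      (F₁ α ∘ st) ∘ ⟨ ⟨ id , id ⟩ , m ⟩
        ≈⟨ ≈-trans assoc (refl⟩∘⟨ st∘⟨⟩) ⟩
      F₁ α ∘ F₁ (⟨ id , id ⟩ ⁂ id) ∘ st ∘ ⟨ id , m ⟩
        ≈⟨ F₁∘F₁∘ ⟩
      F₁ (α ∘ (⟨ id , id ⟩ ⁂ id)) ∘ st ∘ ⟨ id , m ⟩
        ≈⟨ F-resp-≈ (≈-trans (refl⟩∘⟨ ⟨⟩-cong₂ (≈-trans ⟨⟩∘ (⟨⟩-cong₂ identityˡ identityˡ)) identityˡ)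
           (≈-trans α∘⟨⟨⟩⟩ (⟨⟩-cong₂ ≈-refl ⟨π₁,π₂⟩≈id))) ⟩∘⟨refl ⟩
      F₁ ⟨ π₁ , id ⟩ ∘ st ∘ ⟨ id , m ⟩ ∎

  bind-bind-η∘ : ∀ {Γ A B D} {m : Γ ⇒ F₀ A} {g : Γ × A ⇒ B} {l : Γ × B ⇒ F₀ D} →
                 bind (bind m (η ∘ g)) l ≈ bind m (l ∘ ⟨ π₁ , g ⟩)
  bind-bind-η∘ {m = m} {g} {l} = begin
    bind (bind m (η ∘ g)) l
      ≈⟨ bind-cong₂ bind-η∘ ≈-refl ⟩
    bind (F₁ g ∘ st ∘ ⟨ id , m ⟩) l
      ≈⟨ bind-F₁∘ ⟩
    bind (st ∘ ⟨ id , m ⟩) (l ∘ (id ⁂ g))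
      ≈⟨ bind-st∘⟨id,⟩ ⟩
    bind m ((l ∘ (id ⁂ g)) ∘ ⟨ π₁ , id ⟩)
      ≈⟨ bind-congʳ (≈-trans assoc (refl⟩∘⟨ ≈-trans ⁂∘⟨⟩ (⟨⟩-cong₂ identityˡ identityʳ))) ⟩
    bind m (l ∘ ⟨ π₁ , g ⟩) ∎

  pairᴹ-as-bind : ∀ {Γ A B} {m : Γ ⇒ F₀ A} {n : Γ ⇒ F₀ B} → pairᴹ m n ≈ bind m (st ∘ ⟨ π₂ , n ∘ π₁ ⟩)
  pairᴹ-as-bind {m = m} {n} = begin
    μ ∘ F₁ st ∘ (F₁ swap ∘ st ∘ swap) ∘ ⟨ m , n ⟩
      ≈⟨ refl⟩∘⟨ refl⟩∘⟨ ≈-trans assoc (refl⟩∘⟨ ≈-trans assoc (refl⟩∘⟨ swap∘⟨⟩)) ⟩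
    μ ∘ F₁ st ∘ F₁ swap ∘ st ∘ ⟨ n , m ⟩
      ≈⟨ refl⟩∘⟨ refl⟩∘⟨ refl⟩∘⟨ st∘⟨⟩ ⟩
    μ ∘ F₁ st ∘ F₁ swap ∘ F₁ (n ⁂ id) ∘ st ∘ ⟨ id , m ⟩
      ≈⟨ refl⟩∘⟨ refl⟩∘⟨ F₁∘F₁∘ ⟩
    μ ∘ F₁ st ∘ F₁ (swap ∘ (n ⁂ id)) ∘ st ∘ ⟨ id , m ⟩
      ≈⟨ refl⟩∘⟨ F₁∘F₁∘ ⟩
    μ ∘ F₁ (st ∘ swap ∘ (n ⁂ id)) ∘ st ∘ ⟨ id , m ⟩
      ≈⟨ bind-congʳ (refl⟩∘⟨ ≈-trans swap∘⟨⟩ (⟨⟩-cong₂ identityˡ ≈-refl)) ⟩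
    μ ∘ F₁ (st ∘ ⟨ π₂ , n ∘ π₁ ⟩) ∘ st ∘ ⟨ id , m ⟩ ∎

  pairᴹ-η∘ : ∀ {Γ A B} {a : Γ ⇒ A} {n : Γ ⇒ F₀ B} → pairᴹ (η ∘ a) n ≈ st ∘ ⟨ a , n ⟩
  pairᴹ-η∘ = ≈-trans pairᴹ-as-bind (≈-trans η∘-bind (≈-trans assoc (refl⟩∘⟨ ≈-trans ⟨⟩∘
               (⟨⟩-cong₂ project₂ (≈-trans assoc (≈-trans (refl⟩∘⟨ project₁) identityʳ))))))

  pairᴹ-η∘η∘ : ∀ {Γ A B} {a : Γ ⇒ A} {b : Γ ⇒ B} → pairᴹ (η ∘ a) (η ∘ b) ≈ η ∘ ⟨ a , b ⟩
  pairᴹ-η∘η∘ = ≈-trans pairᴹ-η∘ st∘⟨,η∘⟩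

  appᴹ-as-pairᴹ : ∀ {Γ A B} {m : Γ ⇒ F₀ (F₀ B ^ A)} {n : Γ ⇒ F₀ A} → appᴹ m n ≈ μ ∘ F₁ ev ∘ pairᴹ m n
  appᴹ-as-pairᴹ {m = m} {n} = begin
    μ ∘ F₁ μ ∘ F₁ (F₁ ev) ∘ F₁ st ∘ st' ∘ ⟨ m , n ⟩  ≈⟨ μ∘F₁μ∘ ⟩
    μ ∘ μ ∘ F₁ (F₁ ev) ∘ F₁ st ∘ st' ∘ ⟨ m , n ⟩     ≈⟨ refl⟩∘⟨ μ∘F₁F₁∘ ⟩
    μ ∘ F₁ ev ∘ μ ∘ F₁ st ∘ st' ∘ ⟨ m , n ⟩          ∎

  appᴹ-η∘ : ∀ {Γ A B} {a : Γ ⇒ F₀ B ^ A} {n : Γ ⇒ F₀ A} → appᴹ (η ∘ a) n ≈ μ ∘ F₁ ev ∘ st ∘ ⟨ a , n ⟩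
  appᴹ-η∘ = ≈-trans appᴹ-as-pairᴹ (refl⟩∘⟨ refl⟩∘⟨ pairᴹ-η∘)

module StateTransformerProperties {o ℓ e} {C : BCCC o ℓ e} (T : StrongMonad C) (Y : BCCC.Obj C) where
  open StrongMonadProperties T
  module S where
    open MonadOps (SOps C ops Y) public
    open MonadOpsProperties (SOps C ops Y) public

  SF₁-cong : ∀ {A B} {f g : A ⇒ B} → f ≈ g → S.F₁ f ≈ S.F₁ g
  SF₁-cong p = curry-cong (F-resp-≈ (⁂-cong₂ p ≈-refl) ⟩∘⟨refl)

  uncurry-SF₁ : ∀ {A B} {g : A ⇒ B} → uncurry (S.F₁ g) ≈ F₁ (g ⁂ id) ∘ ev
  uncurry-SF₁ = uncurry-curry

  uncurry-SF₁∘ : ∀ {A B X} {g : A ⇒ B} {f : X ⇒ S.F₀ A} → uncurry (S.F₁ g ∘ f) ≈ F₁ (g ⁂ id) ∘ uncurry f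
  uncurry-SF₁∘ = ≈-trans uncurry-curry∘ assoc

  uncurry-Sη∘ : ∀ {A X} {a : X ⇒ A} → uncurry (S.η ∘ a) ≈ η ∘ (a ⁂ id)
  uncurry-Sη∘ = uncurry-curry∘

  uncurry-Sμ∘ : ∀ {A X} {f : X ⇒ S.F₀ (S.F₀ A)} → uncurry (S.μ ∘ f) ≈ μ ∘ F₁ ev ∘ uncurry f
  uncurry-Sμ∘ = ≈-trans uncurry-curry∘ (≈-trans assoc assoc)

  uncurry-Sst∘⟨⟩ : ∀ {A W X} {a : X ⇒ A} {f : X ⇒ S.F₀ W} →
                   uncurry (S.st ∘ ⟨ a , f ⟩) ≈ F₁ α⁻¹ ∘ st ∘ ⟨ a ∘ π₁ , uncurry f ⟩
  uncurry-Sst∘⟨⟩ {a = a} {f} = begin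
    uncurry (S.st ∘ ⟨ a , f ⟩)
      ≈⟨ uncurry-curry∘ ⟩
    (F₁ α⁻¹ ∘ st ∘ (id ⁂ ev) ∘ α) ∘ (⟨ a , f ⟩ ⁂ id)
      ≈⟨ assoc³ ⟩
    F₁ α⁻¹ ∘ st ∘ (id ⁂ ev) ∘ α ∘ (⟨ a , f ⟩ ⁂ id)
      ≈⟨ refl⟩∘⟨ refl⟩∘⟨ refl⟩∘⟨ ≈-trans (refl⟩∘⟨ ⟨⟩-cong₂ ⟨⟩∘ ≈-refl) α∘⟨⟨⟩⟩ ⟩
    F₁ α⁻¹ ∘ st ∘ (id ⁂ ev) ∘ ⟨ a ∘ π₁ , ⟨ f ∘ π₁ , id ∘ π₂ ⟩ ⟩
      ≈⟨ refl⟩∘⟨ refl⟩∘⟨ ≈-trans ⁂∘⟨⟩ (⟨⟩-cong₂ identityˡ ≈-refl) ⟩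
    F₁ α⁻¹ ∘ st ∘ ⟨ a ∘ π₁ , uncurry f ⟩ ∎

  SF₁-id : ∀ {A} → S.F₁ (id {A}) ≈ id
  SF₁-id = uncurry-injective (≈-trans uncurry-SF₁ (≈-trans (≈-trans (F-resp-≈ id⁂id) F-id ⟩∘⟨refl) (≈-trans identityˡ (≈-sym uncurry-id))))

  SF₁-∘ : ∀ {A B D} {f : A ⇒ B} {g : B ⇒ D} → S.F₁ (g ∘ f) ≈ S.F₁ g ∘ S.F₁ f
  SF₁-∘ {f = f} {g} = uncurry-injective (begin
    uncurry (S.F₁ (g ∘ f))          ≈⟨ uncurry-SF₁ ⟩
    F₁ ((g ∘ f) ⁂ id) ∘ ev          ≈⟨ F₁⁂id∘F₁⁂id∘ ⟨
    F₁ (g ⁂ id) ∘ F₁ (f ⁂ id) ∘ ev  ≈⟨ refl⟩∘⟨ uncurry-SF₁ ⟨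
    F₁ (g ⁂ id) ∘ uncurry (S.F₁ f)  ≈⟨ uncurry-SF₁∘ ⟨
    uncurry (S.F₁ g ∘ S.F₁ f)       ∎)

  uncurry-Sbind∘ : ∀ {A B X G} {a : G ⇒ S.F₀ A} {k : G × A ⇒ S.F₀ B} {h : X ⇒ G} →
                   uncurry (S.bind a k ∘ h) ≈ bind (uncurry (a ∘ h)) (uncurry k ∘ α⁻¹ ∘ ((h ∘ π₁) ⁂ id))
  uncurry-Sbind∘ {a = a} {k} {h} = begin
    uncurry (S.bind a k ∘ h)
      ≈⟨ uncurry-cong (≈-trans assoc³ (refl⟩∘⟨ refl⟩∘⟨ refl⟩∘⟨ ≈-trans ⟨⟩∘ (⟨⟩-cong₂ identityˡ ≈-refl))) ⟩
    uncurry (S.μ ∘ S.F₁ k ∘ S.st ∘ ⟨ h , a ∘ h ⟩)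
      ≈⟨ uncurry-Sμ∘ ⟩
    μ ∘ F₁ ev ∘ uncurry (S.F₁ k ∘ S.st ∘ ⟨ h , a ∘ h ⟩)
      ≈⟨ refl⟩∘⟨ refl⟩∘⟨ uncurry-SF₁∘ ⟩
    μ ∘ F₁ ev ∘ F₁ (k ⁂ id) ∘ uncurry (S.st ∘ ⟨ h , a ∘ h ⟩)
      ≈⟨ refl⟩∘⟨ refl⟩∘⟨ refl⟩∘⟨ uncurry-Sst∘⟨⟩ ⟩
    μ ∘ F₁ ev ∘ F₁ (k ⁂ id) ∘ F₁ α⁻¹ ∘ st ∘ ⟨ h ∘ π₁ , uncurry (a ∘ h) ⟩
      ≈⟨ refl⟩∘⟨ F₁∘F₁∘ ⟩
    μ ∘ F₁ (uncurry k) ∘ F₁ α⁻¹ ∘ st ∘ ⟨ h ∘ π₁ , uncurry (a ∘ h) ⟩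
      ≈⟨ refl⟩∘⟨ F₁∘F₁∘ ⟩
    μ ∘ F₁ (uncurry k ∘ α⁻¹) ∘ st ∘ ⟨ h ∘ π₁ , uncurry (a ∘ h) ⟩
      ≈⟨ μ∘F₁∘st∘⟨⟩ ⟩
    bind (uncurry (a ∘ h)) ((uncurry k ∘ α⁻¹) ∘ ((h ∘ π₁) ⁂ id))
      ≈⟨ bind-congʳ assoc ⟩
    bind (uncurry (a ∘ h)) (uncurry k ∘ α⁻¹ ∘ ((h ∘ π₁) ⁂ id)) ∎

  uncurry-Spairᴹ : ∀ {A B X} {a : X ⇒ S.F₀ A} {b : X ⇒ S.F₀ B} →
                   uncurry (S.pairᴹ a b) ≈ bind (uncurry a) (F₁ α⁻¹ ∘ st ∘ ⟨ π₁ ∘ π₂ , uncurry b ∘ (π₁ ⁂ π₂) ⟩)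
  uncurry-Spairᴹ {a = a} {b} = begin
    uncurry (S.μ ∘ S.F₁ S.st ∘ S.st' ∘ ⟨ a , b ⟩)                        ≈⟨ uncurry-Sμ∘ ⟩
    μ ∘ F₁ ev ∘ uncurry (S.F₁ S.st ∘ S.st' ∘ ⟨ a , b ⟩)                  ≈⟨ refl⟩∘⟨ refl⟩∘⟨ uncurry-SF₁∘ ⟩
    μ ∘ F₁ ev ∘ F₁ (S.st ⁂ id) ∘ uncurry (S.st' ∘ ⟨ a , b ⟩)             ≈⟨ refl⟩∘⟨ F₁∘F₁∘ ⟩
    μ ∘ F₁ (uncurry S.st) ∘ uncurry (S.st' ∘ ⟨ a , b ⟩)                  ≈⟨ refl⟩∘⟨ refl⟩∘⟨ uncurry-Sst'∘⟨⟩ ⟩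
    μ ∘ F₁ (uncurry S.st) ∘ F₁ shuffle ∘ st ∘ ⟨ id , uncurry a ⟩         ≈⟨ refl⟩∘⟨ F₁∘F₁∘ ⟩
    bind (uncurry a) (uncurry S.st ∘ shuffle)                            ≈⟨ bind-congʳ uncurry-Sst∘shuffle ⟩
    bind (uncurry a) (F₁ α⁻¹ ∘ st ∘ ⟨ π₁ ∘ π₂ , uncurry b ∘ (π₁ ⁂ π₂) ⟩) ∎
    where
    shuffle = (swap ⁂ id) ∘ α⁻¹ ∘ ((b ∘ π₁) ⁂ id)
    uncurry-Sst'∘⟨⟩ : uncurry (S.st' ∘ ⟨ a , b ⟩) ≈ F₁ shuffle ∘ st ∘ ⟨ id , uncurry a ⟩
    uncurry-Sst'∘⟨⟩ = begin
      uncurry ((S.F₁ swap ∘ S.st ∘ swap) ∘ ⟨ a , b ⟩)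
        ≈⟨ uncurry-cong (≈-trans assoc (refl⟩∘⟨ ≈-trans assoc (refl⟩∘⟨ swap∘⟨⟩))) ⟩
      uncurry (S.F₁ swap ∘ S.st ∘ ⟨ b , a ⟩)
        ≈⟨ uncurry-SF₁∘ ⟩
      F₁ (swap ⁂ id) ∘ uncurry (S.st ∘ ⟨ b , a ⟩)
        ≈⟨ refl⟩∘⟨ uncurry-Sst∘⟨⟩ ⟩
      F₁ (swap ⁂ id) ∘ F₁ α⁻¹ ∘ st ∘ ⟨ b ∘ π₁ , uncurry a ⟩
        ≈⟨ refl⟩∘⟨ refl⟩∘⟨ st∘⟨⟩ ⟩
      F₁ (swap ⁂ id) ∘ F₁ α⁻¹ ∘ F₁ ((b ∘ π₁) ⁂ id) ∘ st ∘ ⟨ id , uncurry a ⟩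
        ≈⟨ refl⟩∘⟨ F₁∘F₁∘ ⟩
      F₁ (swap ⁂ id) ∘ F₁ (α⁻¹ ∘ ((b ∘ π₁) ⁂ id)) ∘ st ∘ ⟨ id , uncurry a ⟩
        ≈⟨ F₁∘F₁∘ ⟩
      F₁ shuffle ∘ st ∘ ⟨ id , uncurry a ⟩ ∎
    ev-shuffle : (id ⁂ ev) ∘ α ∘ shuffle ≈ ⟨ π₁ ∘ π₂ , uncurry b ∘ (π₁ ⁂ π₂) ⟩
    ev-shuffle = begin
      (id ⁂ ev) ∘ α ∘ (swap ⁂ id) ∘ α⁻¹ ∘ ⟨ (b ∘ π₁) ∘ π₁ , id ∘ π₂ ⟩
           ≈⟨ refl⟩∘⟨ refl⟩∘⟨ refl⟩∘⟨ ≈-trans α⁻¹∘⟨⟩ (⟨⟩-cong₂ (⟨⟩-cong₂ ≈-refl (refl⟩∘⟨ identityˡ)) (refl⟩∘⟨ identityˡ)) ⟩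
      (id ⁂ ev) ∘ α ∘ (swap ⁂ id) ∘ ⟨ ⟨ (b ∘ π₁) ∘ π₁ , π₁ ∘ π₂ ⟩ , π₂ ∘ π₂ ⟩
        ≈⟨ refl⟩∘⟨ refl⟩∘⟨ ≈-trans ⁂∘⟨⟩ (⟨⟩-cong₂ swap∘⟨⟩ identityˡ) ⟩
      (id ⁂ ev) ∘ α ∘ ⟨ ⟨ π₁ ∘ π₂ , (b ∘ π₁) ∘ π₁ ⟩ , π₂ ∘ π₂ ⟩
        ≈⟨ refl⟩∘⟨ α∘⟨⟨⟩⟩ ⟩
      (id ⁂ ev) ∘ ⟨ π₁ ∘ π₂ , ⟨ (b ∘ π₁) ∘ π₁ , π₂ ∘ π₂ ⟩ ⟩
        ≈⟨ ≈-trans ⁂∘⟨⟩ (⟨⟩-cong₂ identityˡ ≈-refl) ⟩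
      ⟨ π₁ ∘ π₂ , ev ∘ ⟨ (b ∘ π₁) ∘ π₁ , π₂ ∘ π₂ ⟩ ⟩
        ≈⟨ ⟨⟩-cong₂ ≈-refl (≈-trans (refl⟩∘⟨ ⟨⟩-cong₂ assoc ≈-refl) (≈-sym uncurry∘⟨⟩)) ⟩
      ⟨ π₁ ∘ π₂ , uncurry b ∘ (π₁ ⁂ π₂) ⟩ ∎
    uncurry-Sst∘shuffle : uncurry S.st ∘ shuffle ≈ F₁ α⁻¹ ∘ st ∘ ⟨ π₁ ∘ π₂ , uncurry b ∘ (π₁ ⁂ π₂) ⟩
    uncurry-Sst∘shuffle = ≈-trans (uncurry-curry ⟩∘⟨refl) (≈-trans assoc³ (refl⟩∘⟨ refl⟩∘⟨ ev-shuffle))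

  uncurry-Sappᴹ : ∀ {A B X} {a : X ⇒ S.F₀ (S.F₀ B ^ A)} {b : X ⇒ S.F₀ A} →
                  uncurry (S.appᴹ a b) ≈ μ ∘ F₁ (ev ∘ (ev ⁂ id)) ∘ uncurry (S.pairᴹ a b)
  uncurry-Sappᴹ {a = a} {b} = begin
    uncurry (S.μ ∘ S.F₁ S.μ ∘ S.F₁ (S.F₁ ev) ∘ P)
      ≈⟨ uncurry-Sμ∘ ⟩
    μ ∘ F₁ ev ∘ uncurry (S.F₁ S.μ ∘ S.F₁ (S.F₁ ev) ∘ P)
      ≈⟨ refl⟩∘⟨ refl⟩∘⟨ uncurry-SF₁∘ ⟩
    μ ∘ F₁ ev ∘ F₁ (S.μ ⁂ id) ∘ uncurry (S.F₁ (S.F₁ ev) ∘ P)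
      ≈⟨ refl⟩∘⟨ refl⟩∘⟨ refl⟩∘⟨ uncurry-SF₁∘ ⟩
    μ ∘ F₁ ev ∘ F₁ (S.μ ⁂ id) ∘ F₁ (S.F₁ ev ⁂ id) ∘ uncurry P
      ≈⟨ refl⟩∘⟨ refl⟩∘⟨ F₁∘F₁∘ ⟩
    μ ∘ F₁ ev ∘ F₁ ((S.μ ⁂ id) ∘ (S.F₁ ev ⁂ id)) ∘ uncurry P
      ≈⟨ refl⟩∘⟨ F₁∘F₁∘ ⟩
    μ ∘ F₁ (ev ∘ (S.μ ⁂ id) ∘ (S.F₁ ev ⁂ id)) ∘ uncurry P
      ≈⟨ refl⟩∘⟨ F-resp-≈ uncurry-Sμ∘SF₁ev ⟩∘⟨refl ⟩
    μ ∘ F₁ (μ ∘ F₁ ev₂ ∘ ev) ∘ uncurry P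
      ≈⟨ refl⟩∘⟨ ≈-trans (F-∘ ⟩∘⟨refl) (≈-trans assoc (refl⟩∘⟨ ≈-trans (F-∘ ⟩∘⟨refl) assoc)) ⟩
    μ ∘ F₁ μ ∘ F₁ (F₁ ev₂) ∘ F₁ ev ∘ uncurry P
      ≈⟨ μ∘F₁μ∘ ⟩
    μ ∘ μ ∘ F₁ (F₁ ev₂) ∘ F₁ ev ∘ uncurry P
      ≈⟨ refl⟩∘⟨ μ∘F₁F₁∘ ⟩
    μ ∘ F₁ ev₂ ∘ μ ∘ F₁ ev ∘ uncurry P
      ≈⟨ refl⟩∘⟨ refl⟩∘⟨ uncurry-Sμ∘ ⟨
    μ ∘ F₁ ev₂ ∘ uncurry (S.μ ∘ P) ∎
    where
    P = S.F₁ S.st ∘ S.st' ∘ ⟨ a , b ⟩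
    ev₂ = ev ∘ (ev ⁂ id)
    uncurry-Sμ∘SF₁ev : ev ∘ (S.μ ⁂ id) ∘ (S.F₁ ev ⁂ id) ≈ μ ∘ F₁ ev₂ ∘ ev
    uncurry-Sμ∘SF₁ev = begin
      ev ∘ (S.μ ⁂ id) ∘ (S.F₁ ev ⁂ id)  ≈⟨ sym-assoc ⟩
      uncurry S.μ ∘ (S.F₁ ev ⁂ id)      ≈⟨ uncurry-∘ ⟨
      uncurry (S.μ ∘ S.F₁ ev)           ≈⟨ uncurry-Sμ∘ ⟩
      μ ∘ F₁ ev ∘ uncurry (S.F₁ ev)     ≈⟨ refl⟩∘⟨ refl⟩∘⟨ uncurry-SF₁ ⟩
      μ ∘ F₁ ev ∘ F₁ (ev ⁂ id) ∘ ev     ≈⟨ refl⟩∘⟨ F₁∘F₁∘ ⟩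
      μ ∘ F₁ ev₂ ∘ ev                   ∎

module InterpretationProperties {o ℓ e} {C : BCCC o ℓ e} (T : StrongMonad C)
                                {Σ : Sig} (𝒜 : Sem.Structure C (StrongMonad.ops T) Σ) where
  open StrongMonadProperties T
  open Sem C ops using (⟦_⟧ctx)
  open Sem.Structure 𝒜 using (A)
  open Sem.Interp C ops 𝒜 public

  private
    postcompose-≈ : ∀ {P Q R W} {f : Q ⇒ R} {g : P ⇒ Q} {g' : W ⇒ Q} {h : W ⇒ P} → g' ≈ g ∘ h → f ∘ g' ≈ (f ∘ g) ∘ h
    postcompose-≈ p = ≈-trans (refl⟩∘⟨ p) sym-assoc

    ⟦case⟧-natural : ∀ {Γ Δ X X' Z} {h : Δ ⇒ Γ} {m : Γ ⇒ F₀ (X + X')} {m' : Δ ⇒ F₀ (X + X')}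
                       {n₁ : Γ × X ⇒ F₀ Z} {n₂ : Γ × X' ⇒ F₀ Z} {n₁' : Δ × X ⇒ F₀ Z} {n₂' : Δ × X' ⇒ F₀ Z} →
                     m' ≈ m ∘ h → n₁' ≈ n₁ ∘ (h ⁂ id) → n₂' ≈ n₂ ∘ (h ⁂ id) →
                     bind m' ([ n₁' , n₂' ] ∘ dist) ≈ bind m ([ n₁ , n₂ ] ∘ dist) ∘ h
    ⟦case⟧-natural p q r = ≈-sym (≈-trans bind∘ (bind-cong₂ (≈-sym p)
      (≈-trans assoc (≈-trans []∘dist∘⁂id ([]-cong₂ (≈-sym q) (≈-sym r) ⟩∘⟨refl)))))

    ⟦lam⟧-natural : ∀ {Γ Δ X Z} {h : Δ ⇒ Γ} {n : Γ × X ⇒ F₀ Z} {n' : Δ × X ⇒ F₀ Z} →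
                    n' ≈ n ∘ (h ⁂ id) → η ∘ curry n' ≈ (η ∘ curry n) ∘ h
    ⟦lam⟧-natural p = ≈-sym (≈-trans assoc (refl⟩∘⟨ ≈-trans curry-∘ (curry-cong (≈-sym p))))

  lookup-ext : ∀ {Γ Δ u} (r : Ren Σ Γ Δ) (h : ⟦ A ⟧ctx Δ ⇒ ⟦ A ⟧ctx Γ) →
               (∀ {s} (x : Γ ∋ s) → lookup (r x) ≈ lookup x ∘ h) →
               ∀ {s} (x : Γ ▸ u ∋ s) → lookup (ext Σ r x) ≈ lookup x ∘ (h ⁂ id)
  lookup-ext r h hr here = ≈-sym (≈-trans project₂ identityˡ)
  lookup-ext r h hr (there x) = ≈-trans (hr x ⟩∘⟨refl) (≈-trans assoc (≈-trans (refl⟩∘⟨ ≈-sym project₁) sym-assoc))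

  ⟦rename⟧ : ∀ {Γ Δ t} (r : Ren Σ Γ Δ) (h : ⟦ A ⟧ctx Δ ⇒ ⟦ A ⟧ctx Γ) →
             (∀ {s} (x : Γ ∋ s) → lookup (r x) ≈ lookup x ∘ h) →
             (M : Term Σ Γ t) → ⟦ rename Σ r M ⟧ ≈ ⟦ M ⟧ ∘ h
  ⟦rename⟧ r h hr (var x) = postcompose-≈ (hr x)
  ⟦rename⟧ r h hr (con c M) = postcompose-≈ (⟦rename⟧ r h hr M)
  ⟦rename⟧ r h hr (eff e M) = postcompose-≈ (postcompose-≈ (⟦rename⟧ r h hr M))
  ⟦rename⟧ r h hr unit = postcompose-≈ !-unique₂
  ⟦rename⟧ r h hr (pair M N) = ≈-trans (pairᴹ-cong₂ (⟦rename⟧ r h hr M) (⟦rename⟧ r h hr N)) (≈-sym pairᴹ∘)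
  ⟦rename⟧ r h hr (fst M) = postcompose-≈ (⟦rename⟧ r h hr M)
  ⟦rename⟧ r h hr (snd M) = postcompose-≈ (⟦rename⟧ r h hr M)
  ⟦rename⟧ r h hr (absurd M) = postcompose-≈ (⟦rename⟧ r h hr M)
  ⟦rename⟧ r h hr (inl M) = postcompose-≈ (⟦rename⟧ r h hr M)
  ⟦rename⟧ r h hr (inr M) = postcompose-≈ (⟦rename⟧ r h hr M)
  ⟦rename⟧ r h hr (case M N₁ N₂) = ⟦case⟧-natural (⟦rename⟧ r h hr M)
    (⟦rename⟧ (ext Σ r) (h ⁂ id) (lookup-ext r h hr) N₁) (⟦rename⟧ (ext Σ r) (h ⁂ id) (lookup-ext r h hr) N₂)
  ⟦rename⟧ r h hr (lam M) = ⟦lam⟧-natural (⟦rename⟧ (ext Σ r) (h ⁂ id) (lookup-ext r h hr) M)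
  ⟦rename⟧ r h hr (app M N) = ≈-trans (appᴹ-cong₂ (⟦rename⟧ r h hr M) (⟦rename⟧ r h hr N)) (≈-sym appᴹ∘)

  ⟦exts⟧ : ∀ {Γ Δ u} (σ : Sub Σ Γ Δ) (h : ⟦ A ⟧ctx Δ ⇒ ⟦ A ⟧ctx Γ) →
           (∀ {s} (x : Γ ∋ s) → ⟦ σ x ⟧ ≈ η ∘ lookup x ∘ h) →
           ∀ {s} (x : Γ ▸ u ∋ s) → ⟦ exts Σ σ x ⟧ ≈ η ∘ lookup x ∘ (h ⁂ id)
  ⟦exts⟧ σ h hσ here = refl⟩∘⟨ ≈-sym (≈-trans project₂ identityˡ)
  ⟦exts⟧ σ h hσ (there x) = ≈-trans (⟦rename⟧ there π₁ (λ _ → ≈-refl) (σ x))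
    (≈-trans (hσ x ⟩∘⟨refl) (≈-trans assoc² (refl⟩∘⟨ ≈-trans (refl⟩∘⟨ ≈-sym project₁) sym-assoc)))

  ⟦subst⟧ : ∀ {Γ Δ t} (σ : Sub Σ Γ Δ) (h : ⟦ A ⟧ctx Δ ⇒ ⟦ A ⟧ctx Γ) →
            (∀ {s} (x : Γ ∋ s) → ⟦ σ x ⟧ ≈ η ∘ lookup x ∘ h) →
            (M : Term Σ Γ t) → ⟦ subst Σ σ M ⟧ ≈ ⟦ M ⟧ ∘ h
  ⟦subst⟧ σ h hσ (var x) = ≈-trans (hσ x) sym-assoc
  ⟦subst⟧ σ h hσ (con c M) = postcompose-≈ (⟦subst⟧ σ h hσ M)
  ⟦subst⟧ σ h hσ (eff e M) = postcompose-≈ (postcompose-≈ (⟦subst⟧ σ h hσ M))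
  ⟦subst⟧ σ h hσ unit = postcompose-≈ !-unique₂
  ⟦subst⟧ σ h hσ (pair M N) = ≈-trans (pairᴹ-cong₂ (⟦subst⟧ σ h hσ M) (⟦subst⟧ σ h hσ N)) (≈-sym pairᴹ∘)
  ⟦subst⟧ σ h hσ (fst M) = postcompose-≈ (⟦subst⟧ σ h hσ M)
  ⟦subst⟧ σ h hσ (snd M) = postcompose-≈ (⟦subst⟧ σ h hσ M)
  ⟦subst⟧ σ h hσ (absurd M) = postcompose-≈ (⟦subst⟧ σ h hσ M)
  ⟦subst⟧ σ h hσ (inl M) = postcompose-≈ (⟦subst⟧ σ h hσ M)
  ⟦subst⟧ σ h hσ (inr M) = postcompose-≈ (⟦subst⟧ σ h hσ M)
  ⟦subst⟧ σ h hσ (case M N₁ N₂) = ⟦case⟧-natural (⟦subst⟧ σ h hσ M)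
    (⟦subst⟧ (exts Σ σ) (h ⁂ id) (⟦exts⟧ σ h hσ) N₁) (⟦subst⟧ (exts Σ σ) (h ⁂ id) (⟦exts⟧ σ h hσ) N₂)
  ⟦subst⟧ σ h hσ (lam M) = ⟦lam⟧-natural (⟦subst⟧ (exts Σ σ) (h ⁂ id) (⟦exts⟧ σ h hσ) M)
  ⟦subst⟧ σ h hσ (app M N) = ≈-trans (appᴹ-cong₂ (⟦subst⟧ σ h hσ M) (⟦subst⟧ σ h hσ N)) (≈-sym appᴹ∘)

  ⟦app-lam⟧ : ∀ {Γ s t} {P : Term Σ (Γ ▸ s) t} {X : Term Σ Γ s} → ⟦ app (lam P) X ⟧ ≈ bind ⟦ X ⟧ ⟦ P ⟧
  ⟦app-lam⟧ {P = P} {X} = begin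
    appᴹ (η ∘ curry ⟦ P ⟧) ⟦ X ⟧              ≈⟨ appᴹ-η∘ ⟩
    μ ∘ F₁ ev ∘ st ∘ ⟨ curry ⟦ P ⟧ , ⟦ X ⟧ ⟩  ≈⟨ μ∘F₁∘st∘⟨⟩ ⟩
    bind ⟦ X ⟧ (ev ∘ (curry ⟦ P ⟧ ⁂ id))      ≈⟨ bind-congʳ uncurry-curry ⟩
    bind ⟦ X ⟧ ⟦ P ⟧                          ∎

module Simulation {o ℓ e} {C : BCCC o ℓ e} (T : StrongMonad C) (Y : BCCC.Obj C) where
  open StrongMonadProperties T public
  open StateTransformerProperties T Y public

  infix 4 _≈[_]_
  _≈[_]_ : ∀ {X A A'} → X ⇒ F₀ (A' × Y) → A ⇒ A' → X ⇒ F₀ (A × Y) → Set e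
  m ≈[ r ] R = m ≈ F₁ (r ⁂ id) ∘ R

  ⇛map : ∀ {A A' B B'} → A' ⇒ A → B ⇒ B' → S.F₀ B ^ A ⇒ F₀ (B' × Y) ^ (A' × Y)
  ⇛map r⁻ q = curryIso ∘ expMap r⁻ (S.F₁ q)

  ⇛map∘⇛map : ∀ {A A' B B'} {r : A ⇒ A'} {r⁻ : A' ⇒ A} {q : B ⇒ B'} {q⁻ : B' ⇒ B} →
              r ∘ r⁻ ≈ id → q ∘ q⁻ ≈ id → ⇛map r⁻ q ∘ (expMap r (S.F₁ q⁻) ∘ curryIso⁻¹) ≈ id
  ⇛map∘⇛map {r = r} {r⁻} {q} {q⁻} p₁ p₂ = begin
    (curryIso ∘ expMap r⁻ (S.F₁ q)) ∘ (expMap r (S.F₁ q⁻) ∘ curryIso⁻¹)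
      ≈⟨ ≈-trans assoc (refl⟩∘⟨ sym-assoc) ⟩
    curryIso ∘ (expMap r⁻ (S.F₁ q) ∘ expMap r (S.F₁ q⁻)) ∘ curryIso⁻¹
      ≈⟨ refl⟩∘⟨ expMap-∘ ⟩∘⟨refl ⟩
    curryIso ∘ expMap (r ∘ r⁻) (S.F₁ q ∘ S.F₁ q⁻) ∘ curryIso⁻¹
      ≈⟨ refl⟩∘⟨ expMap-cong₂ p₁ (≈-trans (≈-sym SF₁-∘) (≈-trans (SF₁-cong p₂) SF₁-id)) ⟩∘⟨refl ⟩
    curryIso ∘ expMap id id ∘ curryIso⁻¹
      ≈⟨ refl⟩∘⟨ ≈-trans (expMap-id ⟩∘⟨refl) identityˡ ⟩
    curryIso ∘ curryIso⁻¹
      ≈⟨ curryIso∘curryIso⁻¹ ⟩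
    id ∎

  ⇛map⁻¹∘⇛map : ∀ {A A' B B'} {r : A ⇒ A'} {r⁻ : A' ⇒ A} {q : B ⇒ B'} {q⁻ : B' ⇒ B} →
                r⁻ ∘ r ≈ id → q⁻ ∘ q ≈ id → (expMap r (S.F₁ q⁻) ∘ curryIso⁻¹) ∘ ⇛map r⁻ q ≈ id
  ⇛map⁻¹∘⇛map {r = r} {r⁻} {q} {q⁻} p₁ p₂ = begin
    (expMap r (S.F₁ q⁻) ∘ curryIso⁻¹) ∘ (curryIso ∘ expMap r⁻ (S.F₁ q))
      ≈⟨ ≈-trans assoc (refl⟩∘⟨ sym-assoc) ⟩
    expMap r (S.F₁ q⁻) ∘ (curryIso⁻¹ ∘ curryIso) ∘ expMap r⁻ (S.F₁ q)
      ≈⟨ refl⟩∘⟨ ≈-trans (curryIso⁻¹∘curryIso ⟩∘⟨refl) identityˡ ⟩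
    expMap r (S.F₁ q⁻) ∘ expMap r⁻ (S.F₁ q)
      ≈⟨ expMap-∘ ⟩
    expMap (r⁻ ∘ r) (S.F₁ q⁻ ∘ S.F₁ q)
      ≈⟨ expMap-cong₂ p₁ (≈-trans (≈-sym SF₁-∘) (≈-trans (SF₁-cong p₂) SF₁-id)) ⟩
    expMap id id
      ≈⟨ expMap-id ⟩
    id ∎

  ev∘⇛map⁂ : ∀ {A A' B B'} {r : A ⇒ A'} {r⁻ : A' ⇒ A} {q : B ⇒ B'} → r⁻ ∘ r ≈ id →
             ev ∘ (⇛map r⁻ q ⁂ (r ⁂ id)) ≈ F₁ (q ⁂ id) ∘ (ev ∘ (ev ⁂ id)) ∘ α⁻¹
  ev∘⇛map⁂ {r = r} {r⁻} {q} p = begin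
    ev ∘ ((curryIso ∘ E) ⁂ (r ⁂ id))
      ≈⟨ refl⟩∘⟨ ⁂≈⁂id∘id⁂ ⟩
    ev ∘ ((curryIso ∘ E) ⁂ id) ∘ (id ⁂ (r ⁂ id))
      ≈⟨ sym-assoc ⟩
    uncurry (curryIso ∘ E) ∘ (id ⁂ (r ⁂ id))
      ≈⟨ uncurry-curryIso∘ ⟩∘⟨refl ⟩
    (ev ∘ ⟨ ev ∘ ⟨ E ∘ π₁ , π₁ ∘ π₂ ⟩ , π₂ ∘ π₂ ⟩) ∘ (id ⁂ (r ⁂ id))
      ≈⟨ assoc ⟩
    ev ∘ ⟨ ev ∘ ⟨ E ∘ π₁ , π₁ ∘ π₂ ⟩ , π₂ ∘ π₂ ⟩ ∘ (id ⁂ (r ⁂ id))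
      ≈⟨ refl⟩∘⟨ ≈-trans ⟨⟩∘ (⟨⟩-cong₂
         (≈-trans assoc (refl⟩∘⟨ ≈-trans ⟨⟩∘ (⟨⟩-cong₂ (≈-trans assoc (≈-trans (refl⟩∘⟨ project₁) (refl⟩∘⟨ identityˡ)))
         (≈-trans assoc (≈-trans (refl⟩∘⟨ project₂) (≈-trans sym-assoc (≈-trans (project₁ ⟩∘⟨refl) assoc)))))))
         (≈-trans assoc (≈-trans (refl⟩∘⟨ project₂) (≈-trans sym-assoc (≈-trans (project₂ ⟩∘⟨refl) (≈-trans assoc identityˡ)))))) ⟩
    ev ∘ ⟨ ev ∘ ⟨ E ∘ π₁ , r ∘ π₁ ∘ π₂ ⟩ , π₂ ∘ π₂ ⟩
      ≈⟨ refl⟩∘⟨ ⟨⟩-cong₂ inner ≈-refl ⟩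
    ev ∘ ⟨ S.F₁ q ∘ ev ∘ ⟨ π₁ , π₁ ∘ π₂ ⟩ , π₂ ∘ π₂ ⟩
      ≈⟨ uncurry∘⟨⟩ ⟨
    uncurry (S.F₁ q) ∘ ⟨ ev ∘ ⟨ π₁ , π₁ ∘ π₂ ⟩ , π₂ ∘ π₂ ⟩
      ≈⟨ ≈-trans (uncurry-SF₁ ⟩∘⟨refl) assoc ⟩
    F₁ (q ⁂ id) ∘ ev ∘ ⟨ ev ∘ ⟨ π₁ , π₁ ∘ π₂ ⟩ , π₂ ∘ π₂ ⟩
      ≈⟨ refl⟩∘⟨ refl⟩∘⟨ ≈-trans ⁂∘⟨⟩ (⟨⟩-cong₂ ≈-refl identityˡ) ⟨
    F₁ (q ⁂ id) ∘ ev ∘ (ev ⁂ id) ∘ α⁻¹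
      ≈⟨ refl⟩∘⟨ sym-assoc ⟩
    F₁ (q ⁂ id) ∘ (ev ∘ (ev ⁂ id)) ∘ α⁻¹ ∎
    where
    E = expMap r⁻ (S.F₁ q)
    inner : ev ∘ ⟨ E ∘ π₁ , r ∘ π₁ ∘ π₂ ⟩ ≈ S.F₁ q ∘ ev ∘ ⟨ π₁ , π₁ ∘ π₂ ⟩
    inner = begin
      ev ∘ ⟨ E ∘ π₁ , r ∘ π₁ ∘ π₂ ⟩
        ≈⟨ uncurry∘⟨⟩ ⟨
      uncurry E ∘ ⟨ π₁ , r ∘ π₁ ∘ π₂ ⟩
        ≈⟨ uncurry-curry ⟩∘⟨refl ⟩
      (S.F₁ q ∘ ev ∘ (id ⁂ r⁻)) ∘ ⟨ π₁ , r ∘ π₁ ∘ π₂ ⟩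
        ≈⟨ assoc² ⟩
      S.F₁ q ∘ ev ∘ (id ⁂ r⁻) ∘ ⟨ π₁ , r ∘ π₁ ∘ π₂ ⟩
        ≈⟨ refl⟩∘⟨ refl⟩∘⟨ ≈-trans ⁂∘⟨⟩ (⟨⟩-cong₂ identityˡ (≈-trans sym-assoc (≈-trans (p ⟩∘⟨refl) identityˡ))) ⟩
      S.F₁ q ∘ ev ∘ ⟨ π₁ , π₁ ∘ π₂ ⟩ ∎

  ≈[]-η : ∀ {X A A'} {r : A ⇒ A'} {g : X ⇒ A} → η ∘ ((r ∘ g) ⁂ id) ≈[ r ] uncurry (S.η ∘ g)
  ≈[]-η {r = r} {g} = begin
    η ∘ ((r ∘ g) ⁂ id)             ≈⟨ refl⟩∘⟨ ≈-trans ⁂∘⁂ (⁂-cong₂ ≈-refl identityˡ) ⟨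
    η ∘ (r ⁂ id) ∘ (g ⁂ id)        ≈⟨ F₁∘η∘ ⟨
    F₁ (r ⁂ id) ∘ η ∘ (g ⁂ id)     ≈⟨ refl⟩∘⟨ uncurry-Sη∘ ⟨
    F₁ (r ⁂ id) ∘ uncurry (S.η ∘ g) ∎

  ≈[]-F₁ : ∀ {X A A' B B'} {m : X ⇒ F₀ (A' × Y)} {R : X ⇒ F₀ (A × Y)} {r : A ⇒ A'} {r' : B ⇒ B'}
             {g : A ⇒ B} {g' : A' ⇒ B'} →
           m ≈[ r ] R → g' ∘ r ≈ r' ∘ g → F₁ (g' ⁂ id) ∘ m ≈[ r' ] F₁ (g ⁂ id) ∘ R
  ≈[]-F₁ {R = R} {r} {r'} {g} {g'} ih sq = begin
    F₁ (g' ⁂ id) ∘ _                  ≈⟨ refl⟩∘⟨ ih ⟩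
    F₁ (g' ⁂ id) ∘ F₁ (r ⁂ id) ∘ R    ≈⟨ F₁⁂id∘F₁⁂id∘ ⟩
    F₁ ((g' ∘ r) ⁂ id) ∘ R            ≈⟨ F-resp-≈ (⁂-cong₂ sq ≈-refl) ⟩∘⟨refl ⟩
    F₁ ((r' ∘ g) ⁂ id) ∘ R            ≈⟨ F₁⁂id∘F₁⁂id∘ ⟨
    F₁ (r' ⁂ id) ∘ F₁ (g ⁂ id) ∘ R    ∎

  ≈[]-eff : ∀ {X A A' B B'} {m : X ⇒ F₀ (A' × Y)} {R : X ⇒ F₀ (A × Y)} {r : A ⇒ A'} {r⁻ : A' ⇒ A}
              {r' : B ⇒ B'} {a : A ⇒ S.F₀ B} →
            m ≈[ r ] R → r⁻ ∘ r ≈ id →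
            μ ∘ F₁ (uncurry (S.F₁ r' ∘ a ∘ r⁻)) ∘ m ≈[ r' ] μ ∘ F₁ (ev ∘ (a ⁂ id)) ∘ R
  ≈[]-eff {R = R} {r} {r⁻} {r'} {a} ih p = begin
    μ ∘ F₁ (uncurry (S.F₁ r' ∘ a ∘ r⁻)) ∘ _                   ≈⟨ refl⟩∘⟨ refl⟩∘⟨ ih ⟩
    μ ∘ F₁ (uncurry (S.F₁ r' ∘ a ∘ r⁻)) ∘ F₁ (r ⁂ id) ∘ R     ≈⟨ refl⟩∘⟨ F₁∘F₁∘ ⟩
    μ ∘ F₁ (uncurry (S.F₁ r' ∘ a ∘ r⁻) ∘ (r ⁂ id)) ∘ R        ≈⟨ refl⟩∘⟨ F-resp-≈ kernel ⟩∘⟨refl ⟩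
    μ ∘ F₁ (F₁ (r' ⁂ id) ∘ ev ∘ (a ⁂ id)) ∘ R                 ≈⟨ refl⟩∘⟨ ≈-trans (F-∘ ⟩∘⟨refl) assoc ⟩
    μ ∘ F₁ (F₁ (r' ⁂ id)) ∘ F₁ (ev ∘ (a ⁂ id)) ∘ R            ≈⟨ μ∘F₁F₁∘ ⟩
    F₁ (r' ⁂ id) ∘ μ ∘ F₁ (ev ∘ (a ⁂ id)) ∘ R                 ∎
    where
    kernel : uncurry (S.F₁ r' ∘ a ∘ r⁻) ∘ (r ⁂ id) ≈ F₁ (r' ⁂ id) ∘ ev ∘ (a ⁂ id)
    kernel = begin
      uncurry (S.F₁ r' ∘ a ∘ r⁻) ∘ (r ⁂ id)
        ≈⟨ uncurry-∘ ⟨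
      uncurry ((S.F₁ r' ∘ a ∘ r⁻) ∘ r)
        ≈⟨ uncurry-cong (≈-trans assoc (refl⟩∘⟨ ≈-trans assoc (≈-trans (refl⟩∘⟨ p) identityʳ))) ⟩
      uncurry (S.F₁ r' ∘ a)
        ≈⟨ uncurry-SF₁∘ ⟩
      F₁ (r' ⁂ id) ∘ ev ∘ (a ⁂ id) ∎

  -- Continues with the value returned by the first computation and runs n in the state it returned.
  thread : ∀ {G A W} → G × Y ⇒ W → (G × Y) × (A × Y) ⇒ A × W
  thread n = ⟨ π₁ ∘ π₂ , n ∘ (π₁ ⁂ π₂) ⟩

  thread∘id⁂⟨⁂id⟩ : ∀ {G A A' B B'} {n : G × Y ⇒ F₀ (B' × Y)} {R : G × Y ⇒ F₀ (B × Y)} {r : B ⇒ B'} {f : A ⇒ A'} →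
                    n ≈[ r ] R → thread n ∘ (id ⁂ (f ⁂ id)) ≈ (f ⁂ F₁ (r ⁂ id)) ∘ thread R
  thread∘id⁂⟨⁂id⟩ ih = ≈-trans ⟨⟩∘ (≈-trans (⟨⟩-cong₂
    (≈-trans assoc (≈-trans (refl⟩∘⟨ project₂) (≈-trans sym-assoc (≈-trans (project₁ ⟩∘⟨refl) assoc))))
    (≈-trans assoc (≈-trans (refl⟩∘⟨ ≈-trans ⁂∘⁂ (⁂-cong₂ identityʳ (≈-trans project₂ identityˡ))) (≈-trans (ih ⟩∘⟨refl) assoc))))
    (≈-sym ⁂∘⟨⟩))

  ≈[]-pair : ∀ {G A A' B B'} {m : G × Y ⇒ F₀ (A' × Y)} {Rm : G × Y ⇒ F₀ (A × Y)}
               {n : G × Y ⇒ F₀ (B' × Y)} {Rn : G × Y ⇒ F₀ (B × Y)} {r : A ⇒ A'} {r' : B ⇒ B'} →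
             m ≈[ r ] Rm → n ≈[ r' ] Rn →
             F₁ α⁻¹ ∘ bind m (st ∘ thread n) ≈[ r ⁂ r' ] bind Rm (F₁ α⁻¹ ∘ st ∘ thread Rn)
  ≈[]-pair {m = m} {Rm} {n} {Rn} {r} {r'} ihM ihN = begin
    F₁ α⁻¹ ∘ bind m (st ∘ thread n)                          ≈⟨ F₁∘bind ⟩
    bind m (F₁ α⁻¹ ∘ st ∘ thread n)                          ≈⟨ bind-cong₂ ihM ≈-refl ⟩
    bind (F₁ (r ⁂ id) ∘ Rm) (F₁ α⁻¹ ∘ st ∘ thread n)         ≈⟨ bind-F₁∘ ⟩
    bind Rm ((F₁ α⁻¹ ∘ st ∘ thread n) ∘ (id ⁂ (r ⁂ id)))     ≈⟨ bind-congʳ continuation ⟩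
    bind Rm (F₁ ((r ⁂ r') ⁂ id) ∘ F₁ α⁻¹ ∘ st ∘ thread Rn)   ≈⟨ F₁∘bind ⟨
    F₁ ((r ⁂ r') ⁂ id) ∘ bind Rm (F₁ α⁻¹ ∘ st ∘ thread Rn)   ∎
    where
    continuation : (F₁ α⁻¹ ∘ st ∘ thread n) ∘ (id ⁂ (r ⁂ id)) ≈ F₁ ((r ⁂ r') ⁂ id) ∘ F₁ α⁻¹ ∘ st ∘ thread Rn
    continuation = begin
      (F₁ α⁻¹ ∘ st ∘ thread n) ∘ (id ⁂ (r ⁂ id))
        ≈⟨ assoc² ⟩
      F₁ α⁻¹ ∘ st ∘ thread n ∘ (id ⁂ (r ⁂ id))
        ≈⟨ refl⟩∘⟨ refl⟩∘⟨ thread∘id⁂⟨⁂id⟩ ihN ⟩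
      F₁ α⁻¹ ∘ st ∘ (r ⁂ F₁ (r' ⁂ id)) ∘ thread Rn
        ≈⟨ refl⟩∘⟨ ≈-trans sym-assoc (≈-trans (≈-sym st-natural ⟩∘⟨refl) assoc) ⟩
      F₁ α⁻¹ ∘ F₁ (r ⁂ (r' ⁂ id)) ∘ st ∘ thread Rn
        ≈⟨ F₁∘F₁∘ ⟩
      F₁ (α⁻¹ ∘ (r ⁂ (r' ⁂ id))) ∘ st ∘ thread Rn
        ≈⟨ F-resp-≈ α⁻¹-natural ⟩∘⟨refl ⟩
      F₁ (((r ⁂ r') ⁂ id) ∘ α⁻¹) ∘ st ∘ thread Rn
        ≈⟨ F₁∘F₁∘ ⟨
      F₁ ((r ⁂ r') ⁂ id) ∘ F₁ α⁻¹ ∘ st ∘ thread Rn ∎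

  ≈[]-app : ∀ {G A A' B B' F'} {m : G × Y ⇒ F₀ (F' × Y)} {Rm : G × Y ⇒ F₀ ((S.F₀ B ^ A) × Y)}
              {n : G × Y ⇒ F₀ (A' × Y)} {Rn : G × Y ⇒ F₀ (A × Y)}
              {rf : S.F₀ B ^ A ⇒ F'} {r : A ⇒ A'} {r' : B ⇒ B'} {evF : F' × (A' × Y) ⇒ F₀ (B' × Y)} →
            m ≈[ rf ] Rm → n ≈[ r ] Rn → evF ∘ (rf ⁂ (r ⁂ id)) ≈ F₁ (r' ⁂ id) ∘ (ev ∘ (ev ⁂ id)) ∘ α⁻¹ →
            bind m (μ ∘ F₁ evF ∘ st ∘ thread n) ≈[ r' ] μ ∘ F₁ (ev ∘ (ev ⁂ id)) ∘ bind Rm (F₁ α⁻¹ ∘ st ∘ thread Rn)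
  ≈[]-app {m = m} {Rm} {n} {Rn} {rf} {r} {r'} {evF} ihM ihN evF-sq = begin
    bind m (μ ∘ F₁ evF ∘ st ∘ thread n)                      ≈⟨ bind-cong₂ ihM ≈-refl ⟩
    bind (F₁ (rf ⁂ id) ∘ Rm) (μ ∘ F₁ evF ∘ st ∘ thread n)    ≈⟨ bind-F₁∘ ⟩
    bind Rm ((μ ∘ F₁ evF ∘ st ∘ thread n) ∘ (id ⁂ (rf ⁂ id))) ≈⟨ bind-congʳ continuation ⟩
    bind Rm (F₁ (r' ⁂ id) ∘ μ ∘ F₁ ev₂ ∘ paired)             ≈⟨ F₁∘bind ⟨
    F₁ (r' ⁂ id) ∘ bind Rm (μ ∘ F₁ ev₂ ∘ paired)             ≈⟨ refl⟩∘⟨ μ∘F₁∘bind ⟨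
    F₁ (r' ⁂ id) ∘ μ ∘ F₁ ev₂ ∘ bind Rm paired               ∎
    where
    ev₂ = ev ∘ (ev ⁂ id)
    paired = F₁ α⁻¹ ∘ st ∘ thread Rn
    continuation : (μ ∘ F₁ evF ∘ st ∘ thread n) ∘ (id ⁂ (rf ⁂ id)) ≈ F₁ (r' ⁂ id) ∘ μ ∘ F₁ ev₂ ∘ paired
    continuation = begin
      (μ ∘ F₁ evF ∘ st ∘ thread n) ∘ (id ⁂ (rf ⁂ id))
        ≈⟨ assoc³ ⟩
      μ ∘ F₁ evF ∘ st ∘ thread n ∘ (id ⁂ (rf ⁂ id))
        ≈⟨ refl⟩∘⟨ refl⟩∘⟨ refl⟩∘⟨ thread∘id⁂⟨⁂id⟩ ihN ⟩
      μ ∘ F₁ evF ∘ st ∘ (rf ⁂ F₁ (r ⁂ id)) ∘ thread Rn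
        ≈⟨ refl⟩∘⟨ refl⟩∘⟨ ≈-trans sym-assoc (≈-trans (≈-sym st-natural ⟩∘⟨refl) assoc) ⟩
      μ ∘ F₁ evF ∘ F₁ (rf ⁂ (r ⁂ id)) ∘ st ∘ thread Rn
        ≈⟨ refl⟩∘⟨ F₁∘F₁∘ ⟩
      μ ∘ F₁ (evF ∘ (rf ⁂ (r ⁂ id))) ∘ st ∘ thread Rn
        ≈⟨ refl⟩∘⟨ F-resp-≈ evF-sq ⟩∘⟨refl ⟩
      μ ∘ F₁ (F₁ (r' ⁂ id) ∘ ev₂ ∘ α⁻¹) ∘ st ∘ thread Rn
        ≈⟨ refl⟩∘⟨ ≈-trans (F-∘ ⟩∘⟨refl) assoc ⟩
      μ ∘ F₁ (F₁ (r' ⁂ id)) ∘ F₁ (ev₂ ∘ α⁻¹) ∘ st ∘ thread Rn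
        ≈⟨ μ∘F₁F₁∘ ⟩
      F₁ (r' ⁂ id) ∘ μ ∘ F₁ (ev₂ ∘ α⁻¹) ∘ st ∘ thread Rn
        ≈⟨ refl⟩∘⟨ refl⟩∘⟨ ≈-trans (F-∘ ⟩∘⟨refl) assoc ⟩
      F₁ (r' ⁂ id) ∘ μ ∘ F₁ ev₂ ∘ paired ∎

  -- The environment of SPS(N)[π₁z/x, π₂z/y].
  unpack : ∀ {G Y' X Z} → (G × Y') × (X × Z) ⇒ (G × X) × Z
  unpack = ⟨ ⟨ π₁ ∘ π₁ , π₁ ∘ π₂ ⟩ , π₂ ∘ π₂ ⟩

  unpack≈ : ∀ {G Y' X Z} → unpack {G} {Y'} {X} {Z} ≈ ((π₁ ⁂ id) ⁂ id) ∘ α⁻¹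
  unpack≈ = ≈-sym (≈-trans ⁂∘⟨⟩ (⟨⟩-cong₂ (≈-trans ⁂∘⟨⟩ (⟨⟩-cong₂ ≈-refl identityˡ)) identityˡ))

  uncurry∘unpack∘id⁂⟨⁂id⟩ : ∀ {G Y' Gs A A' Z D} {n : Gs × A ⇒ D ^ Z} {ρΓ : G ⇒ Gs} {r : A ⇒ A'} {r⁻ : A' ⇒ A} →
                            r⁻ ∘ r ≈ id →
                            uncurry (n ∘ (ρΓ ⁂ r⁻)) ∘ unpack ∘ (id {G × Y'} ⁂ (r ⁂ id)) ≈ uncurry (n ∘ ((ρΓ ∘ π₁) ⁂ id)) ∘ α⁻¹
  uncurry∘unpack∘id⁂⟨⁂id⟩ {n = n} {ρΓ} {r} {r⁻} p = begin
    uncurry (n ∘ (ρΓ ⁂ r⁻)) ∘ unpack ∘ (id ⁂ (r ⁂ id))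
      ≈⟨ refl⟩∘⟨ ≈-trans (unpack≈ ⟩∘⟨refl) assoc ⟩
    uncurry (n ∘ (ρΓ ⁂ r⁻)) ∘ ((π₁ ⁂ id) ⁂ id) ∘ α⁻¹ ∘ (id ⁂ (r ⁂ id))
      ≈⟨ refl⟩∘⟨ refl⟩∘⟨ α⁻¹-natural ⟩
    uncurry (n ∘ (ρΓ ⁂ r⁻)) ∘ ((π₁ ⁂ id) ⁂ id) ∘ ((id ⁂ r) ⁂ id) ∘ α⁻¹
      ≈⟨ refl⟩∘⟨ ≈-trans sym-assoc (≈-trans ⁂∘⁂ (⁂-cong₂ ⁂∘⁂ identityˡ) ⟩∘⟨refl) ⟩
    uncurry (n ∘ (ρΓ ⁂ r⁻)) ∘ ((π₁ ∘ id ⁂ id ∘ r) ⁂ id) ∘ α⁻¹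
      ≈⟨ ≈-trans sym-assoc (≈-sym uncurry-∘ ⟩∘⟨refl) ⟩
    uncurry ((n ∘ (ρΓ ⁂ r⁻)) ∘ (π₁ ∘ id ⁂ id ∘ r)) ∘ α⁻¹
      ≈⟨ uncurry-cong (≈-trans assoc (refl⟩∘⟨ ≈-trans ⁂∘⁂ (⁂-cong₂ (refl⟩∘⟨ identityʳ) (≈-trans (refl⟩∘⟨ identityˡ) p)))) ⟩∘⟨refl ⟩
    uncurry (n ∘ ((ρΓ ∘ π₁) ⁂ id)) ∘ α⁻¹ ∎

  curry-≈-⇛map : ∀ {G Gs A A' B B'} {body : (G × Y) × (A' × Y) ⇒ F₀ (B' × Y)} {n : Gs × A ⇒ S.F₀ B}
                   {ρΓ : G ⇒ Gs} {r⁻ : A' ⇒ A} {q : B ⇒ B'} →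
                 body ≈[ q ] uncurry (n ∘ (ρΓ ⁂ r⁻)) ∘ unpack →
                 curry body ≈ (⇛map r⁻ q ∘ curry n ∘ ρΓ) ∘ π₁
  curry-≈-⇛map {body = body} {n} {ρΓ} {r⁻} {q} hyp =
    ≈-sym (curry-unique (≈-trans uncurry-⇛map (≈-sym (≈-trans hyp body-unfolded))))
    where
    E = expMap r⁻ (S.F₁ q)
    V = n ∘ ⟨ ρΓ ∘ π₁ ∘ π₁ , r⁻ ∘ π₁ ∘ π₂ ⟩
    target = F₁ (q ⁂ id) ∘ ev ∘ ⟨ V , π₂ ∘ π₂ ⟩
    body-unfolded : F₁ (q ⁂ id) ∘ uncurry (n ∘ (ρΓ ⁂ r⁻)) ∘ unpack ≈ target
    body-unfolded = refl⟩∘⟨ ≈-trans assoc (refl⟩∘⟨ ≈-trans ⁂∘⟨⟩ (⟨⟩-cong₂ (≈-trans assoc (refl⟩∘⟨ ⁂∘⟨⟩)) identityˡ))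
    inner : ev ∘ ⟨ (E ∘ curry n ∘ ρΓ ∘ π₁) ∘ π₁ , π₁ ∘ π₂ ⟩ ≈ S.F₁ q ∘ V
    inner = begin
      ev ∘ ⟨ (E ∘ curry n ∘ ρΓ ∘ π₁) ∘ π₁ , π₁ ∘ π₂ ⟩
        ≈⟨ uncurry∘⟨⟩ ⟨
      uncurry (E ∘ curry n ∘ ρΓ ∘ π₁) ∘ ⟨ π₁ , π₁ ∘ π₂ ⟩
        ≈⟨ uncurry-expMap∘ ⟩∘⟨refl ⟩
      (S.F₁ q ∘ uncurry (curry n ∘ ρΓ ∘ π₁) ∘ (id ⁂ r⁻)) ∘ ⟨ π₁ , π₁ ∘ π₂ ⟩
        ≈⟨ (refl⟩∘⟨ uncurry-curry∘ ⟩∘⟨refl) ⟩∘⟨refl ⟩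
      (S.F₁ q ∘ (n ∘ ((ρΓ ∘ π₁) ⁂ id)) ∘ (id ⁂ r⁻)) ∘ ⟨ π₁ , π₁ ∘ π₂ ⟩
        ≈⟨ ≈-trans assoc (refl⟩∘⟨ ≈-trans assoc assoc) ⟩
      S.F₁ q ∘ n ∘ ((ρΓ ∘ π₁) ⁂ id) ∘ (id ⁂ r⁻) ∘ ⟨ π₁ , π₁ ∘ π₂ ⟩
        ≈⟨ refl⟩∘⟨ refl⟩∘⟨ ≈-trans (refl⟩∘⟨ ⁂∘⟨⟩) (≈-trans ⁂∘⟨⟩ (⟨⟩-cong₂ (≈-trans assoc (refl⟩∘⟨ refl⟩∘⟨ identityˡ)) identityˡ)) ⟩
      S.F₁ q ∘ V ∎
    uncurry-⇛map : uncurry ((⇛map r⁻ q ∘ curry n ∘ ρΓ) ∘ π₁) ≈ target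
    uncurry-⇛map = begin
      uncurry ((⇛map r⁻ q ∘ curry n ∘ ρΓ) ∘ π₁)
        ≈⟨ uncurry-cong (≈-trans assoc (≈-trans assoc (refl⟩∘⟨ refl⟩∘⟨ assoc))) ⟩
      uncurry (curryIso ∘ E ∘ curry n ∘ ρΓ ∘ π₁)
        ≈⟨ uncurry-curryIso∘ ⟩
      ev ∘ ⟨ ev ∘ ⟨ (E ∘ curry n ∘ ρΓ ∘ π₁) ∘ π₁ , π₁ ∘ π₂ ⟩ , π₂ ∘ π₂ ⟩
        ≈⟨ refl⟩∘⟨ ⟨⟩-cong₂ inner ≈-refl ⟩
      ev ∘ ⟨ S.F₁ q ∘ V , π₂ ∘ π₂ ⟩
        ≈⟨ uncurry∘⟨⟩ ⟨
      uncurry (S.F₁ q) ∘ ⟨ V , π₂ ∘ π₂ ⟩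
        ≈⟨ ≈-trans (uncurry-SF₁ ⟩∘⟨refl) assoc ⟩
      target ∎

  -- The value of λz. δ(π₁z, x₁. ι₁(x₁, π₂z), x₂. ι₂(x₂, π₂z)) in SPS(δ(M, …)).
  dispatch : ∀ {X Y' A B W} → (X × Y') × ((A + B) × W) ⇒ (A × W) + (B × W)
  dispatch = [ ι₁ ∘ select , ι₂ ∘ select ] ∘ dist ∘ ⟨ id , π₁ ∘ π₂ ⟩
    where
    select : ∀ {P Q R S} → (P × (Q × R)) × S ⇒ S × R
    select = ⟨ π₂ , π₂ ∘ π₂ ∘ π₁ ⟩

  private
    ⟨id,π₁∘π₂⟩∘id⁂⟨⁂id⟩ : ∀ {P A A' W} {f : A ⇒ A'} →
                          ⟨ id , π₁ ∘ π₂ ⟩ ∘ (id {P} ⁂ (f ⁂ id {W})) ≈ ⟨ id ⁂ (f ⁂ id) , f ∘ π₁ ∘ π₂ ⟩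
    ⟨id,π₁∘π₂⟩∘id⁂⟨⁂id⟩ = ≈-trans ⟨⟩∘ (⟨⟩-cong₂ identityˡ
      (≈-trans assoc (≈-trans (refl⟩∘⟨ project₂) (≈-trans sym-assoc (≈-trans (project₁ ⟩∘⟨refl) assoc)))))

    select∘⟨id⁂⟨⁂id⟩,⟩ : ∀ {P A A' W} {f : A ⇒ A'} →
                         ⟨ π₂ , π₂ ∘ π₂ ∘ π₁ ⟩ ∘ ⟨ id {P} ⁂ (f ⁂ id {W}) , π₁ ∘ π₂ ⟩ ≈ π₂
    select∘⟨id⁂⟨⁂id⟩,⟩ = ≈-trans ⟨⟩∘ (≈-trans (⟨⟩-cong₂ project₂
      (≈-trans assoc (≈-trans (refl⟩∘⟨ ≈-trans assoc (refl⟩∘⟨ project₁)) π₂∘π₂∘id⁂⟨⁂id⟩))) ⟨⟩-η)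
      where
      π₂∘π₂∘id⁂⟨⁂id⟩ : ∀ {P A A' W} {f : A ⇒ A'} → π₂ ∘ π₂ ∘ (id {P} ⁂ (f ⁂ id {W})) ≈ π₂ ∘ π₂
      π₂∘π₂∘id⁂⟨⁂id⟩ = ≈-trans (refl⟩∘⟨ project₂) (≈-trans sym-assoc (≈-trans project₂ identityˡ ⟩∘⟨refl))

  ⟨π₁,dispatch⟩∘id⁂⟨ι₁⁂id⟩ : ∀ {X Y' A B W} →
                            ⟨ π₁ , dispatch ⟩ ∘ (id {X × Y'} ⁂ (ι₁ {A} {B} ⁂ id {W})) ≈ id ⁂ ι₁
  ⟨π₁,dispatch⟩∘id⁂⟨ι₁⁂id⟩ = ≈-trans ⟨⟩∘ (⟨⟩-cong₂ project₁ (≈-trans assoc²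
    (≈-trans (refl⟩∘⟨ refl⟩∘⟨ ⟨id,π₁∘π₂⟩∘id⁂⟨⁂id⟩) (≈-trans []∘dist∘⟨,ι₁∘⟩ (≈-trans assoc (refl⟩∘⟨ select∘⟨id⁂⟨⁂id⟩,⟩))))))

  ⟨π₁,dispatch⟩∘id⁂⟨ι₂⁂id⟩ : ∀ {X Y' A B W} →
                            ⟨ π₁ , dispatch ⟩ ∘ (id {X × Y'} ⁂ (ι₂ {A} {B} ⁂ id {W})) ≈ id ⁂ ι₂
  ⟨π₁,dispatch⟩∘id⁂⟨ι₂⁂id⟩ = ≈-trans ⟨⟩∘ (⟨⟩-cong₂ project₁ (≈-trans assoc²
    (≈-trans (refl⟩∘⟨ refl⟩∘⟨ ⟨id,π₁∘π₂⟩∘id⁂⟨⁂id⟩) (≈-trans []∘dist∘⟨,ι₂∘⟩ (≈-trans assoc (refl⟩∘⟨ select∘⟨id⁂⟨⁂id⟩,⟩))))))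

  ≈[]-case-branch :
    ∀ {G Gs A₁ A₂ A₁' A₂' Aᵢ Aᵢ' U U'}
      {L : (G × Y) × ((A₁' × Y) + (A₂' × Y)) ⇒ F₀ (U' × Y)} {k : Gs × (A₁ + A₂) ⇒ S.F₀ U}
      {b : (G × Aᵢ') × Y ⇒ F₀ (U' × Y)} {n : Gs × Aᵢ ⇒ S.F₀ U}
      {ρΓ : G ⇒ Gs} {r⊕ : A₁ + A₂ ⇒ A₁' + A₂'} {rᵢ : Aᵢ ⇒ Aᵢ'} {rᵢ⁻ : Aᵢ' ⇒ Aᵢ} {r : U ⇒ U'}
      {ι : Aᵢ ⇒ A₁ + A₂} {ι' : Aᵢ' ⇒ A₁' + A₂'} {ι'' : Aᵢ' × Y ⇒ (A₁' × Y) + (A₂' × Y)} →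
    r⊕ ∘ ι ≈ ι' ∘ rᵢ → ⟨ π₁ , dispatch ⟩ ∘ (id ⁂ (ι' ⁂ id)) ≈ id ⁂ ι'' →
    L ∘ (id ⁂ ι'') ≈ b ∘ unpack → (∀ {X} {h : X ⇒ Gs} → k ∘ (h ⁂ ι) ≈ n ∘ (h ⁂ id)) →
    b ≈[ r ] uncurry (n ∘ (ρΓ ⁂ rᵢ⁻)) → rᵢ⁻ ∘ rᵢ ≈ id →
    ((L ∘ ⟨ π₁ , dispatch ⟩) ∘ (id ⁂ (r⊕ ⁂ id))) ∘ (id ⁂ (ι ⁂ id)) ≈
    (F₁ (r ⁂ id) ∘ uncurry k ∘ α⁻¹ ∘ ((ρΓ ∘ π₁) ⁂ id)) ∘ (id ⁂ (ι ⁂ id))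
  ≈[]-case-branch {L = L} {k} {b} {n} {ρΓ} {r⊕} {rᵢ} {rᵢ⁻} {r} {ι} {ι'} {ι''} inj disp selT selS ih p =
    ≈-trans lhs (≈-sym rhs)
    where
    D = ⟨ π₁ , dispatch ⟩
    target = F₁ (r ⁂ id) ∘ uncurry (n ∘ ((ρΓ ∘ π₁) ⁂ id)) ∘ α⁻¹
    lhs : ((L ∘ D) ∘ (id ⁂ (r⊕ ⁂ id))) ∘ (id ⁂ (ι ⁂ id)) ≈ target
    lhs = begin
      ((L ∘ D) ∘ (id ⁂ (r⊕ ⁂ id))) ∘ (id ⁂ (ι ⁂ id))  ≈⟨ ≈-trans assoc (refl⟩∘⟨ id⁂⟨⁂id⟩∘id⁂⟨⁂id⟩) ⟩
      (L ∘ D) ∘ (id ⁂ ((r⊕ ∘ ι) ⁂ id))               ≈⟨ refl⟩∘⟨ ⁂-cong₂ ≈-refl (⁂-cong₂ inj ≈-refl) ⟩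
      (L ∘ D) ∘ (id ⁂ ((ι' ∘ rᵢ) ⁂ id))              ≈⟨ refl⟩∘⟨ id⁂⟨⁂id⟩∘id⁂⟨⁂id⟩ ⟨
      (L ∘ D) ∘ (id ⁂ (ι' ⁂ id)) ∘ (id ⁂ (rᵢ ⁂ id))  ≈⟨ ≈-trans assoc (refl⟩∘⟨ ≈-trans sym-assoc (disp ⟩∘⟨refl)) ⟩
      L ∘ (id ⁂ ι'') ∘ (id ⁂ (rᵢ ⁂ id))              ≈⟨ ≈-trans sym-assoc (≈-trans (selT ⟩∘⟨refl) assoc) ⟩
      b ∘ unpack ∘ (id ⁂ (rᵢ ⁂ id))                  ≈⟨ ≈-trans (ih ⟩∘⟨refl) assoc ⟩
      F₁ (r ⁂ id) ∘ uncurry (n ∘ (ρΓ ⁂ rᵢ⁻)) ∘ unpack ∘ (id ⁂ (rᵢ ⁂ id)) ≈⟨ refl⟩∘⟨ uncurry∘unpack∘id⁂⟨⁂id⟩ p ⟩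
      target                                         ∎
    rhs : (F₁ (r ⁂ id) ∘ uncurry k ∘ α⁻¹ ∘ ((ρΓ ∘ π₁) ⁂ id)) ∘ (id ⁂ (ι ⁂ id)) ≈ target
    rhs = begin
      (F₁ (r ⁂ id) ∘ uncurry k ∘ α⁻¹ ∘ ((ρΓ ∘ π₁) ⁂ id)) ∘ (id ⁂ (ι ⁂ id))
        ≈⟨ assoc³ ⟩
      F₁ (r ⁂ id) ∘ uncurry k ∘ α⁻¹ ∘ ((ρΓ ∘ π₁) ⁂ id) ∘ (id ⁂ (ι ⁂ id))
        ≈⟨ refl⟩∘⟨ refl⟩∘⟨ refl⟩∘⟨ ≈-trans ⁂∘⁂ (⁂-cong₂ identityʳ identityˡ) ⟩
      F₁ (r ⁂ id) ∘ uncurry k ∘ α⁻¹ ∘ ((ρΓ ∘ π₁) ⁂ (ι ⁂ id))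
        ≈⟨ refl⟩∘⟨ refl⟩∘⟨ α⁻¹-natural ⟩
      F₁ (r ⁂ id) ∘ uncurry k ∘ (((ρΓ ∘ π₁) ⁂ ι) ⁂ id) ∘ α⁻¹
        ≈⟨ refl⟩∘⟨ ≈-trans sym-assoc (≈-sym uncurry-∘ ⟩∘⟨refl) ⟩
      F₁ (r ⁂ id) ∘ uncurry (k ∘ ((ρΓ ∘ π₁) ⁂ ι)) ∘ α⁻¹
        ≈⟨ refl⟩∘⟨ uncurry-cong selS ⟩∘⟨refl ⟩
      target ∎

  ≈[]-case : ∀ {G Gs A₁ A₂ A₁' A₂' U U'} {m : G × Y ⇒ F₀ ((A₁' + A₂') × Y)} {Rm : G × Y ⇒ F₀ ((A₁ + A₂) × Y)}
               {b₁ : (G × A₁') × Y ⇒ F₀ (U' × Y)} {b₂ : (G × A₂') × Y ⇒ F₀ (U' × Y)}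
               {n₁ : Gs × A₁ ⇒ S.F₀ U} {n₂ : Gs × A₂ ⇒ S.F₀ U}
               {ρΓ : G ⇒ Gs} {r₁ : A₁ ⇒ A₁'} {r₁⁻ : A₁' ⇒ A₁} {r₂ : A₂ ⇒ A₂'} {r₂⁻ : A₂' ⇒ A₂} {r : U ⇒ U'} →
             m ≈[ r₁ ⊹ r₂ ] Rm →
             b₁ ≈[ r ] uncurry (n₁ ∘ (ρΓ ⁂ r₁⁻)) → b₂ ≈[ r ] uncurry (n₂ ∘ (ρΓ ⁂ r₂⁻)) →
             r₁⁻ ∘ r₁ ≈ id → r₂⁻ ∘ r₂ ≈ id →
             bind (bind m (η ∘ dispatch)) ([ b₁ ∘ unpack , b₂ ∘ unpack ] ∘ dist) ≈[ r ]
             bind Rm (uncurry ([ n₁ , n₂ ] ∘ dist) ∘ α⁻¹ ∘ ((ρΓ ∘ π₁) ⁂ id))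
  ≈[]-case {G = G} {U' = U'} {m = m} {Rm} {b₁} {b₂} {n₁} {n₂} {ρΓ} {r₁} {r₁⁻} {r₂} {r₂⁻} {r} ihM ih₁ ih₂ p₁ p₂ = begin
    bind (bind m (η ∘ dispatch)) L
      ≈⟨ bind-bind-η∘ ⟩
    bind m (L ∘ ⟨ π₁ , dispatch ⟩)
      ≈⟨ bind-cong₂ ihM ≈-refl ⟩
    bind (F₁ ((r₁ ⊹ r₂) ⁂ id) ∘ Rm) (L ∘ ⟨ π₁ , dispatch ⟩)
      ≈⟨ bind-F₁∘ ⟩
    bind Rm ((L ∘ ⟨ π₁ , dispatch ⟩) ∘ (id ⁂ ((r₁ ⊹ r₂) ⁂ id)))
      ≈⟨ bind-congʳ (id⁂⟨ι⁂id⟩-jointly-epic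
         (≈[]-case-branch inject₁ ⟨π₁,dispatch⟩∘id⁂⟨ι₁⁂id⟩ (selT []∘dist∘⁂ι₁) []∘dist∘⁂ι₁ ih₁ p₁)
         (≈[]-case-branch inject₂ ⟨π₁,dispatch⟩∘id⁂⟨ι₂⁂id⟩ (selT []∘dist∘⁂ι₂) []∘dist∘⁂ι₂ ih₂ p₂)) ⟩
    bind Rm (F₁ (r ⁂ id) ∘ uncurry k ∘ α⁻¹ ∘ ((ρΓ ∘ π₁) ⁂ id))
      ≈⟨ F₁∘bind ⟨
    F₁ (r ⁂ id) ∘ bind Rm (uncurry k ∘ α⁻¹ ∘ ((ρΓ ∘ π₁) ⁂ id)) ∎
    where
    L = [ b₁ ∘ unpack , b₂ ∘ unpack ] ∘ dist
    k = [ n₁ , n₂ ] ∘ dist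
    selT : ∀ {V} {ι : V ⇒ _} {f : (G × Y) × V ⇒ F₀ (U' × Y)} → L ∘ (id ⁂ ι) ≈ f ∘ (id ⁂ id) → L ∘ (id ⁂ ι) ≈ f
    selT sel = ≈-trans sel (≈-trans (refl⟩∘⟨ id⁂id) identityʳ)

module SPSCorrectness {o ℓ e} {C : BCCC o ℓ e} (T : StrongMonad C) (Y : BCCC.Obj C)
                      {Σ : Sig} (𝒜 : Sem.Structure C (SOps C (StrongMonad.ops T) Y) Σ) where
  open Simulation T Y
  open Sig Σ
  open SPSTrans Σ
  open Sem.Structure 𝒜 using (A)
  module P = SPSSem C ops Y
  module ⟦S⟧ = Sem.Interp C (SOps C ops Y) 𝒜
  module ⟦T⟧ = InterpretationProperties T (P.SPSStructure 𝒜)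

  ρ : (t : Ty B) → P.⟦_⟧S A t ⇒ P.⟦_⟧T A (t °)
  ρ = P.ρ A

  ρ⁻¹ : (t : Ty B) → P.⟦_⟧T A (t °) ⇒ P.⟦_⟧S A t
  ρ⁻¹ = P.ρ⁻¹ A

  ρΓ⁻¹ : (Γ : Ctx B) → P.SemT.⟦_⟧ctx (P.A' A) (Γ °c) ⇒ P.SemS.⟦_⟧ctx A Γ
  ρΓ⁻¹ = P.ρCtx⁻¹ A

  ρ∘ρ⁻¹ : (t : Ty B) → ρ t ∘ ρ⁻¹ t ≈ id
  ρ⁻¹∘ρ : (t : Ty B) → ρ⁻¹ t ∘ ρ t ≈ id
  ρ∘ρ⁻¹ (base b) = identityˡ
  ρ∘ρ⁻¹ 𝟙 = identityˡ
  ρ∘ρ⁻¹ 𝟘 = identityˡ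
  ρ∘ρ⁻¹ (s ⊗ t) = ≈-trans ⁂∘⁂ (≈-trans (⁂-cong₂ (ρ∘ρ⁻¹ s) (ρ∘ρ⁻¹ t)) id⁂id)
  ρ∘ρ⁻¹ (s ⊕ t) = ≈-trans ⊹∘⊹ (≈-trans (⊹-cong₂ (ρ∘ρ⁻¹ s) (ρ∘ρ⁻¹ t)) id⊹id)
  ρ∘ρ⁻¹ (s ⇛ t) = ⇛map∘⇛map (ρ∘ρ⁻¹ s) (ρ∘ρ⁻¹ t)
  ρ⁻¹∘ρ (base b) = identityˡ
  ρ⁻¹∘ρ 𝟙 = identityˡ
  ρ⁻¹∘ρ 𝟘 = identityˡ
  ρ⁻¹∘ρ (s ⊗ t) = ≈-trans ⁂∘⁂ (≈-trans (⁂-cong₂ (ρ⁻¹∘ρ s) (ρ⁻¹∘ρ t)) id⁂id)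
  ρ⁻¹∘ρ (s ⊕ t) = ≈-trans ⊹∘⊹ (≈-trans (⊹-cong₂ (ρ⁻¹∘ρ s) (ρ⁻¹∘ρ t)) id⊹id)
  ρ⁻¹∘ρ (s ⇛ t) = ⇛map⁻¹∘⇛map (ρ⁻¹∘ρ s) (ρ⁻¹∘ρ t)

  ρ∘lookup∘ρΓ⁻¹ : ∀ {Γ t} (x : Γ ∋ t) → ρ t ∘ ⟦S⟧.lookup x ∘ ρΓ⁻¹ Γ ≈ ⟦T⟧.lookup (var° x)
  ρ∘lookup∘ρΓ⁻¹ {Γ ▸ t} here = begin
    ρ t ∘ π₂ ∘ (ρΓ⁻¹ Γ ⁂ ρ⁻¹ t)  ≈⟨ refl⟩∘⟨ project₂ ⟩
    ρ t ∘ ρ⁻¹ t ∘ π₂            ≈⟨ sym-assoc ⟩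
    (ρ t ∘ ρ⁻¹ t) ∘ π₂          ≈⟨ ≈-trans (ρ∘ρ⁻¹ t ⟩∘⟨refl) identityˡ ⟩
    π₂                          ∎
  ρ∘lookup∘ρΓ⁻¹ {Γ ▸ s} {t} (there x) = begin
    ρ t ∘ (⟦S⟧.lookup x ∘ π₁) ∘ (ρΓ⁻¹ Γ ⁂ ρ⁻¹ s) ≈⟨ refl⟩∘⟨ ≈-trans assoc (refl⟩∘⟨ project₁) ⟩
    ρ t ∘ ⟦S⟧.lookup x ∘ ρΓ⁻¹ Γ ∘ π₁              ≈⟨ ≈-trans (refl⟩∘⟨ sym-assoc) sym-assoc ⟩
    (ρ t ∘ ⟦S⟧.lookup x ∘ ρΓ⁻¹ Γ) ∘ π₁            ≈⟨ ρ∘lookup∘ρΓ⁻¹ x ⟩∘⟨refl ⟩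
    ⟦T⟧.lookup (var° x) ∘ π₁                      ∎

  ⟦_⟧ᵘ : ∀ {Γ t} → Term Σ Γ t → P.SemT.⟦_⟧ctx (P.A' A) (SPSCtx Γ) ⇒ F₀ (P.⟦_⟧S A t × Y)
  ⟦_⟧ᵘ {Γ} M = uncurry (⟦S⟧.⟦ M ⟧ ∘ ρΓ⁻¹ Γ)

  Correct : ∀ {Γ t} → Term Σ Γ t → Set e
  Correct {t = t} M = ⟦T⟧.⟦ SPS M ⟧ ≈[ ρ t ] ⟦ M ⟧ᵘ

  correct-var : ∀ {Γ t} (x : Γ ∋ t) → Correct (var x)
  correct-var {Γ} {t} x = begin
    pairᴹ (η ∘ ⟦T⟧.lookup (var° x) ∘ π₁) (η ∘ π₂)
      ≈⟨ pairᴹ-η∘η∘ ⟩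
    η ∘ ⟨ ⟦T⟧.lookup (var° x) ∘ π₁ , π₂ ⟩
      ≈⟨ refl⟩∘⟨ ⟨⟩-cong₂ (≈-sym (ρ∘lookup∘ρΓ⁻¹ x) ⟩∘⟨refl) (≈-sym identityˡ) ⟩
    η ∘ ((ρ t ∘ ⟦S⟧.lookup x ∘ ρΓ⁻¹ Γ) ⁂ id)
      ≈⟨ ≈[]-η ⟩
    F₁ (ρ t ⁂ id) ∘ uncurry (S.η ∘ ⟦S⟧.lookup x ∘ ρΓ⁻¹ Γ)
      ≈⟨ refl⟩∘⟨ uncurry-cong sym-assoc ⟩
    F₁ (ρ t ⁂ id) ∘ ⟦ var x ⟧ᵘ ∎

  correct-unit : ∀ {Γ} → Correct {Γ} unit
  correct-unit {Γ} = begin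
    pairᴹ (η ∘ !) (η ∘ π₂)              ≈⟨ pairᴹ-η∘η∘ ⟩
    η ∘ ⟨ ! , π₂ ⟩                      ≈⟨ refl⟩∘⟨ ⟨⟩-cong₂ !-unique₂ (≈-sym identityˡ) ⟩
    η ∘ ((id ∘ ! ∘ ρΓ⁻¹ Γ) ⁂ id)        ≈⟨ ≈[]-η ⟩
    F₁ (id ⁂ id) ∘ uncurry (S.η ∘ ! ∘ ρΓ⁻¹ Γ) ≈⟨ refl⟩∘⟨ uncurry-cong sym-assoc ⟩
    F₁ (id ⁂ id) ∘ ⟦_⟧ᵘ {Γ} unit        ∎

  correct-con : ∀ {Γ} c (M : Term Σ Γ (ar (inj₁ c))) → Correct M → Correct (con c M)
  correct-con c M ih = ≈-trans (≈[]-F₁ ih (≈-trans assoc (refl⟩∘⟨ ≈-trans assoc (≈-trans (refl⟩∘⟨ ρ⁻¹∘ρ (ar (inj₁ c))) identityʳ))))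
    (refl⟩∘⟨ ≈-sym (≈-trans (uncurry-cong assoc) uncurry-SF₁∘))

  correct-eff : ∀ {Γ} e (M : Term Σ Γ (ar (inj₂ e))) → Correct M → Correct (eff e M)
  correct-eff e M ih = ≈-trans (≈[]-eff ih (ρ⁻¹∘ρ (ar (inj₂ e))))
    (refl⟩∘⟨ ≈-sym (≈-trans (uncurry-cong assoc²) (≈-trans uncurry-Sμ∘ (refl⟩∘⟨ ≈-trans (refl⟩∘⟨ uncurry-SF₁∘) F₁∘F₁∘))))

  correct-unary : ∀ {Γ s t} (M : Term Σ Γ s) (g : P.⟦_⟧S A s ⇒ P.⟦_⟧S A t) (g' : P.⟦_⟧T A (s °) ⇒ P.⟦_⟧T A (t °))
                    (body : Term (SPSSig Σ) (SPSCtx Γ ▸ SPSTy s) (t °)) →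
                  ⟦T⟧.⟦ body ⟧ ≈ F₁ g' ∘ F₁ π₁ ∘ η ∘ π₂ → g' ∘ ρ s ≈ ρ t ∘ g → Correct M →
                  ⟦T⟧.⟦ app (lam (pair body (snd v0))) (SPS M) ⟧ ≈[ ρ t ] uncurry ((S.F₁ g ∘ ⟦S⟧.⟦ M ⟧) ∘ ρΓ⁻¹ Γ)
  correct-unary {Γ} {s} {t} M g g' body ⟦body⟧ sq ih = begin
    ⟦T⟧.⟦ app (lam (pair body (snd v0))) (SPS M) ⟧
      ≈⟨ ⟦T⟧.⟦app-lam⟧ {P = pair body (snd v0)} {X = SPS M} ⟩
    bind ⟦T⟧.⟦ SPS M ⟧ (pairᴹ ⟦T⟧.⟦ body ⟧ (F₁ π₂ ∘ η ∘ π₂))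
      ≈⟨ bind-congʳ (≈-trans (pairᴹ-cong₂ (≈-trans ⟦body⟧ (refl⟩∘⟨ F₁∘η∘)) F₁∘η∘)
         (≈-trans (pairᴹ-cong₂ F₁∘η∘ ≈-refl) pairᴹ-η∘η∘)) ⟩
    bind ⟦T⟧.⟦ SPS M ⟧ (η ∘ ⟨ g' ∘ π₁ ∘ π₂ , π₂ ∘ π₂ ⟩)
      ≈⟨ bind-congʳ (refl⟩∘⟨ ≈-sym (≈-trans ⟨⟩∘ (⟨⟩-cong₂ assoc (≈-trans assoc identityˡ)))) ⟩
    bind ⟦T⟧.⟦ SPS M ⟧ (η ∘ (g' ⁂ id) ∘ π₂)
      ≈⟨ bind-η∘∘π₂ ⟩
    F₁ (g' ⁂ id) ∘ ⟦T⟧.⟦ SPS M ⟧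
      ≈⟨ ≈[]-F₁ ih sq ⟩
    F₁ (ρ t ⁂ id) ∘ F₁ (g ⁂ id) ∘ ⟦ M ⟧ᵘ
      ≈⟨ refl⟩∘⟨ ≈-sym (≈-trans (uncurry-cong assoc) uncurry-SF₁∘) ⟩
    F₁ (ρ t ⁂ id) ∘ uncurry ((S.F₁ g ∘ ⟦S⟧.⟦ M ⟧) ∘ ρΓ⁻¹ Γ) ∎

  correct-fst : ∀ {Γ s t} (M : Term Σ Γ (s ⊗ t)) → Correct M → Correct (fst M)
  correct-fst {Γ} {s} {t} M = correct-unary {Γ} {s ⊗ t} {s} M π₁ π₁ (fst (fst v0)) ≈-refl project₁

  correct-snd : ∀ {Γ s t} (M : Term Σ Γ (s ⊗ t)) → Correct M → Correct (snd M)
  correct-snd {Γ} {s} {t} M = correct-unary {Γ} {s ⊗ t} {t} M π₂ π₂ (snd (fst v0)) ≈-refl project₂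

  correct-inl : ∀ {Γ s t} (M : Term Σ Γ s) → Correct M → Correct (inl {t = t} M)
  correct-inl {Γ} {s} {t} M = correct-unary {Γ} {s} {s ⊕ t} M ι₁ ι₁ (inl (fst v0)) ≈-refl (≈-sym inject₁)

  correct-inr : ∀ {Γ s t} (M : Term Σ Γ t) → Correct M → Correct (inr {s = s} M)
  correct-inr {Γ} {s} {t} M = correct-unary {Γ} {t} {s ⊕ t} M ι₂ ι₂ (inr (fst v0)) ≈-refl (≈-sym inject₂)

  correct-absurd : ∀ {Γ t} (M : Term Σ Γ 𝟘) → Correct M → Correct (absurd {t = t} M)
  correct-absurd {Γ} {t} M = correct-unary {Γ} {𝟘} {t} M ¡ ¡ (absurd (fst v0)) ≈-refl ¡-unique₂

  ⟦rename-under2⟧ : ∀ {Γ s u} (N : Term (SPSSig Σ) (SPSCtx Γ) u) →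
                    ⟦T⟧.⟦ rename (SPSSig Σ) (under2 {Γ} {s}) N ⟧ ≈ ⟦T⟧.⟦ N ⟧ ∘ ⟨ π₁ ∘ π₁ ∘ π₁ , π₂ ⟩
  ⟦rename-under2⟧ = ⟦T⟧.⟦rename⟧ under2 ⟨ π₁ ∘ π₁ ∘ π₁ , π₂ ⟩ lookup-under2
    where
    lookup-under2 : ∀ {Γ s u} (x : SPSCtx Γ ∋ u) → ⟦T⟧.lookup (under2 {Γ} {s} x) ≈ ⟦T⟧.lookup x ∘ ⟨ π₁ ∘ π₁ ∘ π₁ , π₂ ⟩
    lookup-under2 here = ≈-sym project₂
    lookup-under2 (there x) = ≈-trans assoc (≈-trans assoc (≈-sym (≈-trans assoc (refl⟩∘⟨ project₁))))

  -- The λy.SPS(N) redex re-runs N in the outer context, with the state produced by M.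
  ⟦run-in-state⟧ : ∀ {Γ s w} (N : Term Σ Γ s) →
                   ⟦T⟧.⟦ app (lam (rename (SPSSig Σ) (under2 {Γ} {w ⊗ bY}) (SPS N))) (snd v0) ⟧ ≈ ⟦T⟧.⟦ SPS N ⟧ ∘ (π₁ ⁂ π₂)
  ⟦run-in-state⟧ {Γ} {s} {w} N = begin
    ⟦T⟧.⟦ app (lam N') (snd v0) ⟧
      ≈⟨ ⟦T⟧.⟦app-lam⟧ {P = N'} {X = snd v0} ⟩
    bind (F₁ π₂ ∘ η ∘ π₂) ⟦T⟧.⟦ N' ⟧
      ≈⟨ ≈-trans (bind-cong₂ F₁∘η∘ ≈-refl) η∘-bind ⟩
    ⟦T⟧.⟦ N' ⟧ ∘ ⟨ id , π₂ ∘ π₂ ⟩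
      ≈⟨ ⟦rename-under2⟧ (SPS N) ⟩∘⟨refl ⟩
    (⟦T⟧.⟦ SPS N ⟧ ∘ ⟨ π₁ ∘ π₁ ∘ π₁ , π₂ ⟩) ∘ ⟨ id , π₂ ∘ π₂ ⟩
      ≈⟨ ≈-trans assoc (refl⟩∘⟨ ≈-trans ⟨⟩∘ (⟨⟩-cong₂
         (≈-trans assoc (refl⟩∘⟨ ≈-trans assoc (≈-trans (refl⟩∘⟨ project₁) identityʳ))) project₂)) ⟩
    ⟦T⟧.⟦ SPS N ⟧ ∘ (π₁ ⁂ π₂) ∎
    where N' = rename (SPSSig Σ) (under2 {Γ} {w ⊗ bY}) (SPS N)

  correct-pair : ∀ {Γ s t} (M : Term Σ Γ s) (N : Term Σ Γ t) → Correct M → Correct N → Correct (pair M N)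
  correct-pair {Γ} {s} {t} M N ihM ihN = begin
    ⟦T⟧.⟦ app (lam reassoc) (app (lam run-N) (SPS M)) ⟧
      ≈⟨ ⟦T⟧.⟦app-lam⟧ {P = reassoc} {X = app (lam run-N) (SPS M)} ⟩
    bind ⟦T⟧.⟦ app (lam run-N) (SPS M) ⟧ ⟦T⟧.⟦ reassoc ⟧
      ≈⟨ ≈-trans (bind-congʳ ⟦reassoc⟧) bind-η∘∘π₂ ⟩
    F₁ α⁻¹ ∘ ⟦T⟧.⟦ app (lam run-N) (SPS M) ⟧
      ≈⟨ refl⟩∘⟨ ≈-trans (⟦T⟧.⟦app-lam⟧ {P = run-N} {X = SPS M}) (bind-congʳ ⟦run-N⟧) ⟩
    F₁ α⁻¹ ∘ bind ⟦T⟧.⟦ SPS M ⟧ (st ∘ thread ⟦T⟧.⟦ SPS N ⟧)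
      ≈⟨ ≈[]-pair ihM ihN ⟩
    F₁ ((ρ s ⁂ ρ t) ⁂ id) ∘ bind ⟦ M ⟧ᵘ (F₁ α⁻¹ ∘ st ∘ thread ⟦ N ⟧ᵘ)
      ≈⟨ refl⟩∘⟨ uncurry-Spairᴹ ⟨
    F₁ ((ρ s ⁂ ρ t) ⁂ id) ∘ uncurry (S.pairᴹ (⟦S⟧.⟦ M ⟧ ∘ ρΓ⁻¹ Γ) (⟦S⟧.⟦ N ⟧ ∘ ρΓ⁻¹ Γ))
         ≈⟨ refl⟩∘⟨ uncurry-cong (≈-sym S.pairᴹ∘) ⟩
    F₁ ((ρ s ⁂ ρ t) ⁂ id) ∘ ⟦ pair M N ⟧ᵘ ∎
    where
    reassoc = pair (pair (fst v0) (fst (snd v0))) (snd (snd v0))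
    run-N = pair (fst v0) (app (lam (rename (SPSSig Σ) under2 (SPS N))) (snd v0))
    ⟦reassoc⟧ : ⟦T⟧.⟦ reassoc ⟧ ≈ η ∘ α⁻¹ ∘ π₂
    ⟦reassoc⟧ = begin
      pairᴹ (pairᴹ (F₁ π₁ ∘ η ∘ π₂) (F₁ π₁ ∘ F₁ π₂ ∘ η ∘ π₂)) (F₁ π₂ ∘ F₁ π₂ ∘ η ∘ π₂)
           ≈⟨ pairᴹ-cong₂ (≈-trans (pairᴹ-cong₂ F₁∘η∘ (≈-trans (refl⟩∘⟨ F₁∘η∘) F₁∘η∘)) pairᴹ-η∘η∘) (≈-trans (refl⟩∘⟨ F₁∘η∘) F₁∘η∘) ⟩
      pairᴹ (η ∘ ⟨ π₁ ∘ π₂ , π₁ ∘ π₂ ∘ π₂ ⟩) (η ∘ π₂ ∘ π₂ ∘ π₂)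
        ≈⟨ pairᴹ-η∘η∘ ⟩
      η ∘ ⟨ ⟨ π₁ ∘ π₂ , π₁ ∘ π₂ ∘ π₂ ⟩ , π₂ ∘ π₂ ∘ π₂ ⟩
        ≈⟨ refl⟩∘⟨ ≈-sym (≈-trans ⟨⟩∘ (⟨⟩-cong₂ (≈-trans ⟨⟩∘ (⟨⟩-cong₂ ≈-refl assoc)) assoc)) ⟩
      η ∘ α⁻¹ ∘ π₂ ∎
    ⟦run-N⟧ : ⟦T⟧.⟦ run-N ⟧ ≈ st ∘ thread ⟦T⟧.⟦ SPS N ⟧
    ⟦run-N⟧ = ≈-trans (pairᴹ-cong₂ F₁∘η∘ (⟦run-in-state⟧ {w = s °} N)) pairᴹ-η∘

  correct-app : ∀ {Γ s t} (M : Term Σ Γ (s ⇛ t)) (N : Term Σ Γ s) → Correct M → Correct N → Correct (app M N)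
  correct-app {Γ} {s} {t} M N ihM ihN = begin
    ⟦T⟧.⟦ app (lam apply) (SPS M) ⟧                                        ≈⟨ ⟦T⟧.⟦app-lam⟧ {P = apply} {X = SPS M} ⟩
    bind ⟦T⟧.⟦ SPS M ⟧ ⟦T⟧.⟦ apply ⟧                                       ≈⟨ bind-congʳ ⟦apply⟧ ⟩
    bind ⟦T⟧.⟦ SPS M ⟧ (μ ∘ F₁ ev ∘ st ∘ thread ⟦T⟧.⟦ SPS N ⟧)             ≈⟨ ≈[]-app ihM ihN (ev∘⇛map⁂ (ρ⁻¹∘ρ s)) ⟩
    F₁ (ρ t ⁂ id) ∘ μ ∘ F₁ ev₂ ∘ bind ⟦ M ⟧ᵘ (F₁ α⁻¹ ∘ st ∘ thread ⟦ N ⟧ᵘ) ≈⟨ refl⟩∘⟨ refl⟩∘⟨ refl⟩∘⟨ uncurry-Spairᴹ ⟨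
    F₁ (ρ t ⁂ id) ∘ μ ∘ F₁ ev₂ ∘ uncurry (S.pairᴹ (⟦S⟧.⟦ M ⟧ ∘ ρΓ⁻¹ Γ) (⟦S⟧.⟦ N ⟧ ∘ ρΓ⁻¹ Γ)) ≈⟨ refl⟩∘⟨ uncurry-Sappᴹ ⟨
    F₁ (ρ t ⁂ id) ∘ uncurry (S.appᴹ (⟦S⟧.⟦ M ⟧ ∘ ρΓ⁻¹ Γ) (⟦S⟧.⟦ N ⟧ ∘ ρΓ⁻¹ Γ)) ≈⟨ refl⟩∘⟨ uncurry-cong (≈-sym S.appᴹ∘) ⟩
    F₁ (ρ t ⁂ id) ∘ ⟦ app M N ⟧ᵘ                                           ∎
    where
    apply = app (fst v0) (app (lam (rename (SPSSig Σ) under2 (SPS N))) (snd v0))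
    ev₂ = ev ∘ (ev ⁂ id)
    ⟦apply⟧ : ⟦T⟧.⟦ apply ⟧ ≈ μ ∘ F₁ ev ∘ st ∘ thread ⟦T⟧.⟦ SPS N ⟧
    ⟦apply⟧ = ≈-trans (appᴹ-cong₂ F₁∘η∘ (⟦run-in-state⟧ {w = (s ⇛ t) °} N)) appᴹ-η∘

  ⟦subst-bindSub⟧ : ∀ {Γ t u} (N : Term (SPSSig Σ) (SPSCtx (Γ ▸ t)) u) →
                    ⟦T⟧.⟦ subst (SPSSig Σ) (bindSub {Γ} {t}) N ⟧ ≈ ⟦T⟧.⟦ N ⟧ ∘ unpack
  ⟦subst-bindSub⟧ = ⟦T⟧.⟦subst⟧ bindSub unpack ⟦bindSub⟧
    where
    ⟦bindSub⟧ : ∀ {Γ t u} (x : SPSCtx (Γ ▸ t) ∋ u) → ⟦T⟧.⟦ bindSub {Γ} {t} x ⟧ ≈ η ∘ ⟦T⟧.lookup x ∘ unpack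
    ⟦bindSub⟧ here = ≈-trans F₁∘η∘ (refl⟩∘⟨ ≈-sym project₂)
    ⟦bindSub⟧ (there here) = ≈-trans F₁∘η∘ (refl⟩∘⟨ ≈-sym (≈-trans assoc (≈-trans (refl⟩∘⟨ project₁) project₂)))
    ⟦bindSub⟧ (there (there x)) =
      refl⟩∘⟨ ≈-trans assoc (≈-sym (≈-trans assoc (≈-trans (refl⟩∘⟨ project₁) (≈-trans assoc (refl⟩∘⟨ project₁)))))

  correct-lam : ∀ {Γ s t} (M : Term Σ (Γ ▸ s) t) → Correct M → Correct (lam M)
  correct-lam {Γ} {s} {t} M ih = begin
    pairᴹ (η ∘ curry ⟦T⟧.⟦ body ⟧) (η ∘ π₂)             ≈⟨ pairᴹ-η∘η∘ ⟩
    η ∘ ⟨ curry ⟦T⟧.⟦ body ⟧ , π₂ ⟩                     ≈⟨ refl⟩∘⟨ ⟨⟩-cong₂ (curry-≈-⇛map ⟦body⟧) (≈-sym identityˡ) ⟩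
    η ∘ ((ρ (s ⇛ t) ∘ curry ⟦S⟧.⟦ M ⟧ ∘ ρΓ⁻¹ Γ) ⁂ id)    ≈⟨ ≈[]-η ⟩
    F₁ (ρ (s ⇛ t) ⁂ id) ∘ uncurry (S.η ∘ curry ⟦S⟧.⟦ M ⟧ ∘ ρΓ⁻¹ Γ) ≈⟨ refl⟩∘⟨ uncurry-cong sym-assoc ⟩
    F₁ (ρ (s ⇛ t) ⁂ id) ∘ ⟦ lam M ⟧ᵘ                     ∎
    where
    body = subst (SPSSig Σ) bindSub (SPS M)
    ⟦body⟧ : ⟦T⟧.⟦ body ⟧ ≈[ ρ t ] uncurry (⟦S⟧.⟦ M ⟧ ∘ (ρΓ⁻¹ Γ ⁂ ρ⁻¹ s)) ∘ unpack
    ⟦body⟧ = ≈-trans (⟦subst-bindSub⟧ (SPS M)) (≈-trans (ih ⟩∘⟨refl) assoc)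

  correct-case : ∀ {Γ s t u} (M : Term Σ Γ (s ⊕ t)) (M₁ : Term Σ (Γ ▸ s) u) (M₂ : Term Σ (Γ ▸ t) u) →
                 Correct M → Correct M₁ → Correct M₂ → Correct (case M M₁ M₂)
  correct-case {Γ} {s} {t} {u} M M₁ M₂ ihM ih₁ ih₂ = begin
    bind ⟦T⟧.⟦ split ⟧ ([ ⟦T⟧.⟦ body₁ ⟧ , ⟦T⟧.⟦ body₂ ⟧ ] ∘ dist)
      ≈⟨ bind-cong₂ ⟦split⟧ ([]-cong₂ (⟦subst-bindSub⟧ (SPS M₁)) (⟦subst-bindSub⟧ (SPS M₂)) ⟩∘⟨refl) ⟩
    bind (bind ⟦T⟧.⟦ SPS M ⟧ (η ∘ dispatch)) ([ ⟦T⟧.⟦ SPS M₁ ⟧ ∘ unpack , ⟦T⟧.⟦ SPS M₂ ⟧ ∘ unpack ] ∘ dist)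
      ≈⟨ ≈[]-case ihM ih₁ ih₂ (ρ⁻¹∘ρ s) (ρ⁻¹∘ρ t) ⟩
    F₁ (ρ u ⁂ id) ∘ bind ⟦ M ⟧ᵘ (uncurry ([ ⟦S⟧.⟦ M₁ ⟧ , ⟦S⟧.⟦ M₂ ⟧ ] ∘ dist) ∘ α⁻¹ ∘ ((ρΓ⁻¹ Γ ∘ π₁) ⁂ id))
      ≈⟨ refl⟩∘⟨ uncurry-Sbind∘ ⟨
    F₁ (ρ u ⁂ id) ∘ ⟦ case M M₁ M₂ ⟧ᵘ ∎
    where
    tag₁ : Term (SPSSig Σ) (SPSCtx Γ ▸ SPSTy (s ⊕ t) ▸ s °) (SPSTy s ⊕ SPSTy t)
    tag₁ = inl (pair v0 (snd (var (there here))))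
    tag₂ : Term (SPSSig Σ) (SPSCtx Γ ▸ SPSTy (s ⊕ t) ▸ t °) (SPSTy s ⊕ SPSTy t)
    tag₂ = inr (pair v0 (snd (var (there here))))
    split = app (lam (case (fst v0) tag₁ tag₂)) (SPS M)
    body₁ = subst (SPSSig Σ) bindSub (SPS M₁)
    body₂ = subst (SPSSig Σ) bindSub (SPS M₂)
    ⟦tag⟧ : ∀ {P Q R S W} {ι : S × R ⇒ W} →
            F₁ ι ∘ pairᴹ (η ∘ π₂) (F₁ π₂ ∘ η ∘ π₂ ∘ π₁) ≈ η ∘ ι ∘ ⟨ π₂ , π₂ ∘ π₂ ∘ π₁ {P × (Q × R)} {S} ⟩
    ⟦tag⟧ = ≈-trans (refl⟩∘⟨ ≈-trans (pairᴹ-cong₂ ≈-refl F₁∘η∘) pairᴹ-η∘η∘) F₁∘η∘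
    ⟦split⟧ : ⟦T⟧.⟦ split ⟧ ≈ bind ⟦T⟧.⟦ SPS M ⟧ (η ∘ dispatch)
    ⟦split⟧ = ≈-trans (⟦T⟧.⟦app-lam⟧ {P = case (fst v0) tag₁ tag₂} {X = SPS M}) (bind-congʳ (begin
      bind (F₁ π₁ ∘ η ∘ π₂) ([ ⟦T⟧.⟦ tag₁ ⟧ , ⟦T⟧.⟦ tag₂ ⟧ ] ∘ dist)
        ≈⟨ bind-cong₂ F₁∘η∘ ([]-cong₂ ⟦tag⟧ ⟦tag⟧ ⟩∘⟨refl) ⟩
      bind (η ∘ π₁ ∘ π₂) ([ η ∘ ι₁ ∘ select , η ∘ ι₂ ∘ select ] ∘ dist)
        ≈⟨ η∘-bind ⟩
      ([ η ∘ ι₁ ∘ select , η ∘ ι₂ ∘ select ] ∘ dist) ∘ ⟨ id , π₁ ∘ π₂ ⟩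
        ≈⟨ ≈-trans (≈-sym ∘[] ⟩∘⟨refl ⟩∘⟨refl) (≈-trans assoc assoc) ⟩
      η ∘ dispatch ∎))
      where
      select : ∀ {P Q R S} → (P × (Q × R)) × S ⇒ S × R
      select = ⟨ π₂ , π₂ ∘ π₂ ∘ π₁ ⟩

  correct : ∀ {Γ t} (M : Term Σ Γ t) → Correct M
  correct {Γ} {t} (var x) = correct-var {Γ} {t} x
  correct (con c M) = correct-con c M (correct M)
  correct (eff e M) = correct-eff e M (correct M)
  correct {Γ} unit = correct-unit {Γ}
  correct (pair {Γ} {s} {t} M N) = correct-pair {Γ} {s} {t} M N (correct M) (correct N)
  correct (fst {Γ} {s} {t} M) = correct-fst {Γ} {s} {t} M (correct M)
  correct (snd {Γ} {s} {t} M) = correct-snd {Γ} {s} {t} M (correct M)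
  correct (absurd {Γ} {t} M) = correct-absurd {Γ} {t} M (correct M)
  correct (inl {Γ} {s} {t} M) = correct-inl {Γ} {s} {t} M (correct M)
  correct (inr {Γ} {s} {t} M) = correct-inr {Γ} {s} {t} M (correct M)
  correct (case {Γ} {s} {t} {u} M M₁ M₂) = correct-case {Γ} {s} {t} {u} M M₁ M₂ (correct M) (correct M₁) (correct M₂)
  correct (lam {Γ} {s} {t} M) = correct-lam {Γ} {s} {t} M (correct M)
  correct (app {Γ} {s} {t} M N) = correct-app {Γ} {s} {t} M N (correct M) (correct N)

  SPS-sound : ∀ {Γ t} (M : Term Σ Γ t) → ⟦T⟧.⟦ SPS M ⟧ ≈ uncurry (S.F₁ (ρ t) ∘ ⟦S⟧.⟦ M ⟧ ∘ ρΓ⁻¹ Γ)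
  SPS-sound M = ≈-trans (correct M) (≈-sym uncurry-SF₁∘)

lemma5p4 : ∀ {o ℓ e} (C : BCCC o ℓ e) (T : StrongMonad C) (Y : BCCC.Obj C)
             (Σ : Sig) (𝒜 : Sem.Structure C (SOps C (StrongMonad.ops T) Y) Σ)
             {Γ : Ctx (Sig.B Σ)} {t : Ty (Sig.B Σ)} (M : Term Σ Γ t) →
           BCCC._≈_ C
             (Sem.Interp.⟦_⟧ C (StrongMonad.ops T)
                (SPSSem.SPSStructure C (StrongMonad.ops T) Y 𝒜)
                (SPSTrans.SPS Σ M))
             (BCCCKit.uncurry C
                (BCCC._∘_ C (MonadOps.F₁ (SOps C (StrongMonad.ops T) Y)
                               (SPSSem.ρ C (StrongMonad.ops T) Y (Sem.Structure.A 𝒜) t))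
                 (BCCC._∘_ C (Sem.Interp.⟦_⟧ C (SOps C (StrongMonad.ops T) Y) 𝒜 M)
                   (SPSSem.ρCtx⁻¹ C (StrongMonad.ops T) Y (Sem.Structure.A 𝒜) Γ))))
lemma5p4 C T Y Σ 𝒜 M = SPSCorrectness.SPS-sound T Y 𝒜 M
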